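{- Let $\varphi$ be a normal-form $\mathrm{GF}$-sentence with signature $\sigma=\mathrm{Rels}\uplus\mathrm{Cons}$, let $w=\mathrm{wd}(\sigma)$, and let $\boldsymbol{\tau}^*=\bigcup_{k=0}^{w}\boldsymbol{\tau}^*_k$ be a satisfiability witness for $\varphi$. Suppose $p_1,\dots,p_{2^w-1}$ are prime numbers with $|\boldsymbol{\tau}^\sigma_w|\le p_1<p_2<\dots<p_{2^w-1}$. Then the structure $\mathfrak{B}$ produced by the Hashing procedure on input $(\sigma,\boldsymbol{\tau}^*,p_1,\dots,p_{2^w-1})$ satisfies $\mathfrak{B}\models\varphi$ (for any choice of the enumerations used by the procedure).
   Context: Signatures $\sigma=\mathrm{Rels}\uplus\mathrm{Cons}$: finite, $\mathrm{Rels}$ nonempty with arities $\ge1$, $\mathrm{wd}(\sigma)$ the maximal arity. Standard name assumption: constants interpreted by themselves; domain $A=A_0\uplus\mathrm{Cons}$ with unnamed elements $A_0$. $\mathrm{GF}$: first-order formulas (with equality, no function symbols) built from atoms by Boolean connectives and guarded quantifiers $\exists\bar x(\gamma\wedge\psi)$, $\forall\bar x(\gamma\to\psi)$ ($\gamma$ an atom containing $\bar x$ and the free variables of $\psi$). Normal form: finite conjunction of $\exists\bar x(\alpha(\bar x)\wedge\psi)$, $\forall\bar x(\alpha(\bar x)\to\psi)$, $\forall\bar x(\alpha(\bar x)\to\exists\bar y(\beta(\bar x,\bar y)\wedge\psi))$ with $\alpha,\beta$ atoms ($\alpha$ with variables exactly $\bar x$), $\psi$ quantifier-free with free variables among those of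 $\alpha$ (first two forms) or of $\beta$, where $\bar y\subseteq\mathrm{vars}(\beta)\subseteq\bar x\cup\bar y$. Types: $\mathrm{Lit}_k(\sigma)$ = atoms $R(t_1,\dots)$, $R\in\mathrm{Rels}$, $t_i\in\{x_1,\dots,x_k\}\cup\mathrm{Cons}$, and negations (no equality); $k$-type: subset with exactly one of each atom and its negation; $\boldsymbol{\tau}^\sigma_k$ = all $k$-types. Restriction $\mathrm{tp}^\tau[x_{i_1},\dots,x_{i_\ell}]$: literals of $\tau$ with variables among those, renamed $x_{i_j}\mapsto x_j$. Interior of a $k$-type: literals whose variable set is a proper subset of $\{x_1,\dots,x_k\}$; compatible $k$-types: equal interiors. Guarded $k$-type: $k\le1$ or contains a positive literal with variable set exactly $\{x_1,\dots,x_k\}$. $\mathrm{tp}^{\mathfrak{A}}[a_1,\dots,a_k]$ for distinct unnamed elements: literals true under $x_i\mapsto a_i$. Closed: closed under restrictions; consistent: exactly one $0$-type. $\boldsymbol{\tau}$-guarded: every guarded realised $k$-type lies in $\boldsymbol{\tau}_k$. $\boldsymbol{\tau}$-extension property: for $k<\mathrm{wd}(\sigma)$, $\tau_1\in\boldsymbol{\tau}_k$, $\tau_2\in\boldsymbol{\tau}_{k+1}$, $\tau_1\subseteq\tau_2$, every distinct unnamed $\bar a$ of type $\tau_1$ has unnamed $b\notin\bar a$ with $\mathrm{tp}[\bar a,b]=\tau_2$. Satisfiability witness for $\varphi$: closed consistent $\boldsymbol{\tau}^*=\bigcup_{k=0}^{\mathrm{wd}(\sigma)}\boldsymbol{\tau}^*_k$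 with $\emptyset\neq\boldsymbol{\tau}^*_k\subseteq\boldsymbol{\tau}^\sigma_k$, such that every $\boldsymbol{\tau}^*$-guarded $\sigma$-structure with the $\boldsymbol{\tau}^*$-extension property models $\varphi$. Hashing procedure on $(\sigma,\boldsymbol{\tau}^*,p_1,\dots,p_{2^w-1})$: let $M=\prod_{i=1}^{2^w-1}p_i$; start with the factless $\sigma$-structure $\mathfrak{B}$ on domain $([0,w-1]\times[0,M-1])\uplus\mathrm{Cons}$; set the facts on constants according to the unique $0$-type of $\boldsymbol{\tau}^*_0$; for $k=1,\dots,w$: fix an enumeration $\boldsymbol{\tau}^*_k(0),\dots,\boldsymbol{\tau}^*_k(|\boldsymbol{\tau}^*_k|-1)$ of $\boldsymbol{\tau}^*_k$, and for each tuple $(\alpha_1,\beta_1),\dots,(\alpha_k,\beta_k)\in[0,w-1]\times[0,M-1]$ with $\alpha_1<\dots<\alpha_k$: compute $i=2^{\alpha_1}+\dots+2^{\alpha_k}$, $h=((\beta_1+\dots+\beta_k)\bmod p_i)\bmod|\boldsymbol{\tau}^*_k|$, let $\tau=\boldsymbol{\tau}^*_k(h)$, and if $\tau$ is compatible with the current $\mathrm{tp}^{\mathfrak{B}}[(\alpha_1,\beta_1),\dots,(\alpha_k,\beta_k)]$, modify $\mathfrak{B}$ so that this tuple has type $\tau$ (otherwise do nothing). -}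

module Defs where

open import Data.Nat using (ℕ; zero; suc; _+_; _*_; _∸_; _^_; _≤_; _<_; _⊔_; _%_)
open import Data.Fin using (Fin; toℕ; splitAt; _↑ʳ_; inject₁; fromℕ)
import Data.Fin as Fin
open import Data.Bool using (Bool; true; false; T; _∧_; _∨_; if_then_else_; not)
open import Data.Bool.Properties using () renaming (_≟_ to _≟ᵇ_)
open import Data.Sum using (_⊎_; inj₁; inj₂; [_,_]; map₁)
import Data.Sum.Properties as SumP
open import Data.Product using (Σ; Σ-syntax; ∃; _×_; _,_; proj₁; proj₂)
import Data.Product.Properties as ProdP
open import Data.Maybe using (Maybe; just; nothing)
import Data.Maybe as Maybe
open import Data.List using (List; []; _∷_; _++_; map; concatMap; allFin; applyUpTo;
  cartesianProduct; filterᵇ; length; foldr; head)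
open import Data.Bool.ListAction using (all; any)
open import Data.Nat.ListAction using (sum; product)
open import Data.List.Relation.Unary.Any using (Any)
open import Data.List.Relation.Unary.All using (All)
open import Data.List.Relation.Unary.AllPairs using (AllPairs)
open import Data.Vec using (Vec; []; _∷_; toList)
import Data.Vec as Vec
open import Data.Vec.Membership.Propositional using () renaming (_∈_ to _∈ᵥ_)
open import Data.Nat.Primality using (Prime)
open import Function.Definitions using (Injective)
open import Relation.Nullary using (¬_; Dec; yes; no; does)
open import Relation.Binary.Definitions using (DecidableEquality)
open import Relation.Binary.PropositionalEquality using (_≡_; _≢_; _≗_)

-- Signatures: relation symbols Fin nR (nonempty, arities ≥ 1) and
-- constants Fin nC (standard name assumption: constants denote themselves).

record Signature : Set where
  field
    nR     : ℕ
    nC     : ℕ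
    ar     : Fin nR → ℕ
    nR-pos : 1 ≤ nR
    ar-pos : ∀ R → 1 ≤ ar R

module _ (σ : Signature) where
  open Signature σ

  wd : ℕ
  wd = foldr _⊔_ 0 (map ar (allFin nR))

  -- Structures: domain A₀ ⊎ Cons (A₀ = unnamed elements).
  -- (Classical two-valued relations.)

  record Structure (A₀ : Set) : Set where
    field
      rel : (R : Fin nR) → Vec (A₀ ⊎ Fin nC) (ar R) → Bool

  Term : ℕ → Set
  Term n = Fin n ⊎ Fin nC

  data FAtom (n : ℕ) : Set where
    relA : (R : Fin nR) → Vec (Term n) (ar R) → FAtom n
    eqA  : Term n → Term n → FAtom n

  OccursA : ∀ {n} → Fin n → FAtom n → Set
  OccursA i (relA R ts) = inj₁ i ∈ᵥ ts
  OccursA i (eqA t u)   = (t ≡ inj₁ i) ⊎ (u ≡ inj₁ i)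

  data QF (n : ℕ) : Set where
    atomQ : FAtom n → QF n
    negQ  : QF n → QF n
    andQ  : QF n → QF n → QF n
    orQ   : QF n → QF n → QF n

  FreeIn : ∀ {n} → Fin n → QF n → Set
  FreeIn i (atomQ a)  = OccursA i a
  FreeIn i (negQ ψ)   = FreeIn i ψ
  FreeIn i (andQ ψ χ) = FreeIn i ψ ⊎ FreeIn i χ
  FreeIn i (orQ ψ χ)  = FreeIn i ψ ⊎ FreeIn i χ

  -- the three kinds of normal-form conjuncts; x̄ = x_1..x_n, ȳ = x_{n+1}..x_{n+m}
  data Conjunct : Set where
    -- ∃x̄ (α(x̄) ∧ ψ)
    exC    : (n : ℕ) (α : FAtom n) → (∀ i → OccursA i α) → QF n → Conjunct
    -- ∀x̄ (α(x̄) → ψ)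
    allC   : (n : ℕ) (α : FAtom n) → (∀ i → OccursA i α) → QF n → Conjunct
    -- ∀x̄ (α(x̄) → ∃ȳ (β(x̄,ȳ) ∧ ψ))
    allExC : (n m : ℕ) (α : FAtom n) → (∀ i → OccursA i α) →
             (β : FAtom (n + m)) → (∀ (j : Fin m) → OccursA (n ↑ʳ j) β) →
             (ψ : QF (n + m)) → (∀ i → FreeIn i ψ → OccursA i β) → Conjunct

  Sentence : Set
  Sentence = List Conjunct

  module _ {A₀ : Set} (𝔄 : Structure A₀) where
    open Structure 𝔄

    Dom : Set
    Dom = A₀ ⊎ Fin nC

    evalT : ∀ {n} → (Fin n → Dom) → Term n → Dom
    evalT ρ = [ ρ , inj₂ ]

    SatA : ∀ {n} → FAtom n → (Fin n → Dom) → Set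
    SatA (relA R ts) ρ = T (rel R (Vec.map (evalT ρ) ts))
    SatA (eqA t u)   ρ = evalT ρ t ≡ evalT ρ u

    SatQF : ∀ {n} → QF n → (Fin n → Dom) → Set
    SatQF (atomQ a)  ρ = SatA a ρ
    SatQF (negQ ψ)   ρ = ¬ SatQF ψ ρ
    SatQF (andQ ψ χ) ρ = SatQF ψ ρ × SatQF χ ρ
    SatQF (orQ ψ χ)  ρ = SatQF ψ ρ ⊎ SatQF χ ρ

    combine : ∀ {n m} → (Fin n → Dom) → (Fin m → Dom) → Fin (n + m) → Dom
    combine {n} ρ ρ' i = [ ρ , ρ' ] (splitAt n i)

    SatC : Conjunct → Set
    SatC (exC n α _ ψ)  = Σ[ ρ ∈ (Fin n → Dom) ] (SatA α ρ × SatQF ψ ρ)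
    SatC (allC n α _ ψ) = (ρ : Fin n → Dom) → SatA α ρ → SatQF ψ ρ
    SatC (allExC n m α _ β _ ψ _) =
      (ρ : Fin n → Dom) → SatA α ρ →
      Σ[ ρ' ∈ (Fin m → Dom) ] (SatA β (combine ρ ρ') × SatQF ψ (combine ρ ρ'))

    Models : Sentence → Set
    Models φ = All SatC φ

  -- A k-type contains exactly one of each atom and its negation, so it is
  -- represented by the truth value it assigns to each atom.

  TAtom : ℕ → Set
  TAtom k = Σ[ R ∈ Fin nR ] Vec (Fin k ⊎ Fin nC) (ar R)

  KType : ℕ → Set
  KType k = TAtom k → Bool

  -- number of k-types |τ^σ_k| = 2^(number of atoms over x_1..x_k)
  numTypes : ℕ → ℕ
  numTypes k = 2 ^ sum (map (λ R → (k + nC) ^ ar R) (allFin nR))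

  -- restriction tp^τ[x_{f(1)},...,x_{f(ℓ)}] for distinct indices (f injective)
  restrict : ∀ {k ℓ} → KType k → (Fin ℓ → Fin k) → KType ℓ
  restrict τ f (R , s) = τ (R , Vec.map (map₁ f) s)

  decTerm : ∀ {k} → DecidableEquality (Fin k ⊎ Fin nC)
  decTerm = SumP.≡-dec Fin._≟_ Fin._≟_

  isFull : ∀ {k} → TAtom k → Bool
  isFull {k} (R , s) =
    all (λ i → any (λ t → does (decTerm t (inj₁ i))) (toList s)) (allFin k)

  -- compatible: equal interiors (interior = literals whose variable set is
  -- a proper subset of {x_1..x_k})
  Compatible : ∀ {k} → KType k → KType k → Set
  Compatible τ τ' = ∀ a → isFull a ≡ false → τ a ≡ τ' a

  Guarded : ∀ {k} → KType k → Set
  Guarded {k} τ = (k ≤ 1) ⊎ (Σ[ a ∈ TAtom k ] (isFull a ≡ true × τ a ≡ true))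

  _⊆ᵗ_ : ∀ {k} → KType k → KType (suc k) → Set
  τ₁ ⊆ᵗ τ₂ = ∀ a → restrict τ₂ inject₁ a ≡ τ₁ a

  tp : ∀ {A₀ k} → Structure A₀ → (Fin k → A₀) → KType k
  tp 𝔄 ā (R , s) = Structure.rel 𝔄 R (Vec.map (map₁ ā) s)

  -- Sets of types: τ*_k is given by a list; membership is up to
  -- pointwise equality of types.

  TypeFamily : Set
  TypeFamily = (k : ℕ) → List (KType k)

  _∈ᵗ_ : ∀ {k} → KType k → List (KType k) → Set
  τ ∈ᵗ L = Any (λ τ' → τ ≗ τ') L

  Closed : TypeFamily → Set
  Closed τs = ∀ k ℓ → k ≤ wd → (τ : KType k) → τ ∈ᵗ τs k →
              (f : Fin ℓ → Fin k) → Injective _≡_ _≡_ f → restrict τ f ∈ᵗ τs ℓ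

  Consistent : TypeFamily → Set
  Consistent τs = (Σ[ τ ∈ KType 0 ] τ ∈ᵗ τs 0) ×
                  (∀ τ τ' → τ ∈ᵗ τs 0 → τ' ∈ᵗ τs 0 → τ ≗ τ')

  Nonempty : TypeFamily → Set
  Nonempty τs = ∀ k → k ≤ wd → Σ[ τ ∈ KType k ] τ ∈ᵗ τs k

  IsGuardedBy : ∀ {A₀} → Structure A₀ → TypeFamily → Set
  IsGuardedBy {A₀} 𝔄 τs = ∀ k (ā : Fin k → A₀) → Injective _≡_ _≡_ ā →
                          Guarded (tp 𝔄 ā) → tp 𝔄 ā ∈ᵗ τs k

  snoc : ∀ {A : Set} {k} → (Fin k → A) → A → Fin (suc k) → A
  snoc {k = zero}  ā b Fin.zero    = b
  snoc {k = suc k} ā b Fin.zero    = ā Fin.zero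
  snoc {k = suc k} ā b (Fin.suc i) = snoc (λ j → ā (Fin.suc j)) b i

  HasExtension : ∀ {A₀} → Structure A₀ → TypeFamily → Set
  HasExtension {A₀} 𝔄 τs =
    ∀ k → suc k ≤ wd → (τ₁ : KType k) (τ₂ : KType (suc k)) →
    τ₁ ∈ᵗ τs k → τ₂ ∈ᵗ τs (suc k) → τ₁ ⊆ᵗ τ₂ →
    (ā : Fin k → A₀) → Injective _≡_ _≡_ ā → tp 𝔄 ā ≗ τ₁ →
    Σ[ b ∈ A₀ ] ((∀ i → b ≢ ā i) × tp 𝔄 (snoc ā b) ≗ τ₂)

  record IsWitness (φ : Sentence) (τs : TypeFamily) : Set₁ where
    field
      closed     : Closed τs
      consistent : Consistent τs
      nonempty   : Nonempty τs
      models     : (A₀ : Set) (𝔄 : Structure A₀) →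
                   IsGuardedBy 𝔄 τs → HasExtension 𝔄 τs → Models 𝔄 φ

  IsEnumeration : ∀ {k} → List (KType k) → List (KType k) → Set
  IsEnumeration L e = (∀ τ → τ ∈ᵗ e → τ ∈ᵗ L) × (∀ τ → τ ∈ᵗ L → τ ∈ᵗ e) ×
                      AllPairs (λ τ τ' → ¬ (τ ≗ τ')) e

  -- hypotheses on the primes p_1,...,p_{2^w - 1}  (p indexed from 1)
  PrimeHyps : (ℕ → ℕ) → Set
  PrimeHyps p = (∀ i → 1 ≤ i → i ≤ 2 ^ wd ∸ 1 → Prime (p i)) ×
                numTypes wd ≤ p 1 ×
                (∀ i → 1 ≤ i → suc i ≤ 2 ^ wd ∸ 1 → p i < p (suc i))

  allVecs : ∀ {A : Set} → List A → (n : ℕ) → List (Vec A n)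
  allVecs xs zero    = [] ∷ []
  allVecs xs (suc n) = concatMap (λ x → map (x ∷_) (allVecs xs n)) xs

  allTAtoms : (k : ℕ) → List (TAtom k)
  allTAtoms k = concatMap (λ R → map (R ,_) (allVecs (map inj₁ (allFin k) ++ map inj₂ (allFin nC)) (ar R))) (allFin nR)

  compatibleᵇ : ∀ {k} → KType k → KType k → Bool
  compatibleᵇ {k} τ τ' = all (λ a → isFull a ∨ does (τ a ≟ᵇ τ' a)) (allTAtoms k)

  modT : ℕ → ℕ → ℕ
  modT a zero    = a
  modT a (suc n) = a % suc n

  lookupM : ∀ {A : Set} → List A → ℕ → Maybe A
  lookupM []       _       = nothing
  lookupM (x ∷ xs) zero    = just x
  lookupM (x ∷ xs) (suc n) = lookupM xs n

  module Hashing (τs : TypeFamily) (p : ℕ → ℕ) (enum : TypeFamily) where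

    w : ℕ
    w = wd

    M : ℕ
    M = product (map p (applyUpTo suc (2 ^ w ∸ 1)))

    Elem : Set
    Elem = Fin w × Fin M

    decElem : DecidableEquality Elem
    decElem = ProdP.≡-dec Fin._≟_ Fin._≟_

    increasing : ∀ {k} → Vec Elem k → Bool
    increasing []                          = true
    increasing (_ ∷ [])                    = true
    increasing ((a , _) ∷ (b , y) ∷ rest) =
      does (Fin.toℕ a Data.Nat.<? Fin.toℕ b) ∧ increasing ((b , y) ∷ rest)

    tuples : (k : ℕ) → List (Vec Elem k)
    tuples k = filterᵇ increasing (allVecs (cartesianProduct (allFin w) (allFin M)) k)

    indexOf : ∀ {k} → Vec Elem k → Elem → Maybe (Fin k)
    indexOf []      e = nothing
    indexOf (x ∷ t) e with decElem x e
    ... | yes _ = just Fin.zero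
    ... | no  _ = Maybe.map Fin.suc (indexOf t e)

    pullElem : ∀ {k} → Vec Elem k → (Elem ⊎ Fin nC) → Maybe (Fin k ⊎ Fin nC)
    pullElem t (inj₁ e) = Maybe.map inj₁ (indexOf t e)
    pullElem t (inj₂ c) = just (inj₂ c)

    pull : ∀ {k n} → Vec Elem k → Vec (Elem ⊎ Fin nC) n → Maybe (Vec (Fin k ⊎ Fin nC) n)
    pull t []       = just []
    pull t (v ∷ vs) with pullElem t v | pull t vs
    ... | just s | just ss = just (s ∷ ss)
    ... | _      | _       = nothing

    -- stage 0: factless except for the facts on constants, given by the
    -- unique 0-type of τs 0
    stage0 : Structure Elem
    Structure.rel stage0 R v with pull [] v | head (τs 0)
    ... | just s | just τ₀ = τ₀ (R , s)
    ... | _      | _       = false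

    hashType : ∀ {k} → Vec Elem k → Maybe (KType k)
    hashType {k} t =
      lookupM (enum k)
        (modT (modT (sum (map (λ e → Fin.toℕ (proj₂ e)) (toList t)))
                    (p (sum (map (λ e → 2 ^ Fin.toℕ (proj₁ e)) (toList t)))))
              (length (enum k)))

    -- stage k: every increasing k-tuple t with τ = τ*_k(h) compatible with
    -- tp^𝔅[t] gets type τ, i.e. the facts whose variable set (w.r.t. t) is
    -- all of t are set according to τ.  (Distinct tuples of a stage touch
    -- disjoint sets of facts, and the interiors are fixed by earlier stages,
    -- so all tuples of a stage can be processed simultaneously.)
    stepFact : ∀ {k} → Structure Elem → (R : Fin nR) → Vec (Elem ⊎ Fin nC) (ar R) →
               List (Vec Elem k) → Bool
    stepFact 𝔅 R v [] = Structure.rel 𝔅 R v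
    stepFact 𝔅 R v (t ∷ ts) with pull t v | hashType t
    ... | just s | just τ =
      if isFull (R , s)
        then (if compatibleᵇ τ (tp 𝔅 (Vec.lookup t)) then τ (R , s) else Structure.rel 𝔅 R v)
        else stepFact 𝔅 R v ts
    ... | _ | _ = stepFact 𝔅 R v ts

    stage : (k : ℕ) → Structure Elem
    stage zero    = stage0
    Structure.rel (stage (suc k)) R v = stepFact {suc k} (stage k) R v (tuples (suc k))

    𝔅 : Structure Elem
    𝔅 = stage w

module Submission where

open import Defs
open import Data.Nat using (ℕ; _≤_)
open import Data.List using (List)

-- The hashing structure 𝔅 is τ*-guarded, but it has the τ*-extension property only
-- for tuples whose elements lie in pairwise distinct rows α.  To extend such a tuple
-- ā by a type τ₂ ⊇ tp ā, the new element b is put into a free row, and its column β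
-- is chosen by the Chinese remainder theorem modulo the distinct primes p_i: for every
-- set P of positions of ā b containing b, the increasing tuple listing P has row index
-- i = Σ_{u ∈ P} 2^{α_u} (distinct sets give distinct i by uniqueness of binary
-- expansions), and β fixes the residue of the column sum modulo p_i so that the hash
-- selects the restriction of τ₂ to P (every position in the enumeration is reachable
-- since |τ^σ_w| ≤ p_1 ≤ p_i).  The facts below P were fixed at earlier stages and agree
-- with τ₂, so the compatibility test passes.
--
-- Guarded tuples always lie in distinct rows, and satisfaction of a normal-form
-- GF-sentence only looks at guarded tuples.  Hence any two structures that realise
-- only τ*-types on guarded tuples and can extend tuples of a hereditary class
-- containing the guarded ones agree on normal-form sentences.  The witness property
-- applies to the free structure ℭ, whose elements are the formal one-step extensions of
-- tuples of earlier elements by τ*-types; it has the full τ*-extension property, so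
-- ℭ ⊨ φ and therefore 𝔅 ⊨ φ.

module TypeLemmas where

  open import Data.Vec.Membership.Propositional using () renaming (_∈_ to _∈ᵥ_)
  open import Data.Bool using (Bool; true; false; T)
  open import Data.Bool.Properties using (T-≡; T-∨)
  import Data.Bool.Properties as Bool
  open import Data.Empty using (⊥-elim)
  open import Data.Fin using (Fin; inject₁; fromℕ; toℕ; funToFin; finToFun)
  import Data.Fin as Fin
  import Data.Fin.Properties as Fin
  open import Data.Fin.Relation.Unary.Top using (view; ‵fromℕ; ‵inject₁)
  open import Data.List using (List; []; _∷_; _++_; allFin; length; lookup; map; concatMap; foldr; head)
  import Data.List.Properties as List
  open import Data.Nat.ListAction using (sum)
  import Data.List.Relation.Unary.All as All
  open import Data.List.Relation.Unary.All.Properties using (all⁺; all⁻)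
  open import Data.Bool.ListAction using (any)
  open import Data.List.Relation.Unary.Any using (here; there; index)
  import Data.List.Relation.Unary.Any as Any
  open import Data.List.Relation.Unary.Any.Properties using (any⁺; any⁻; lookup-index)
  open import Data.List.Relation.Unary.AllPairs using (AllPairs; []; _∷_)
  open import Data.List.Membership.Propositional using (_∈_)
  open import Data.List.Membership.Propositional.Properties
    using (∈-allFin; ∈-map⁺; ∈-++⁺ˡ; ∈-++⁺ʳ; ∈-concatMap⁺; ∈-lookup)
  open import Data.Nat using (ℕ; zero; suc; _+_; _*_; _≤_; _^_; _⊔_; z≤n; s≤s)
  import Data.Nat.Properties as ℕ
  open import Data.Product using (∃; _×_; _,_; proj₁; proj₂)
  open import Data.Sum using (_⊎_; inj₁; inj₂; map₁)
  open import Data.Maybe using (just)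
  import Data.Sum.Properties as Sum
  open import Data.Vec using (Vec; []; _∷_; toList)
  import Data.Vec as Vec
  import Data.Vec.Properties as Vec
  open import Data.Vec.Relation.Unary.All using ([]; _∷_)
  open import Data.Vec.Relation.Unary.Any using (here; there)
  import Data.Vec.Relation.Unary.All as VAll
  import Data.Vec.Membership.DecPropositional as VecDec
  open import Data.Vec.Membership.Propositional.Properties using (∈-toList⁺; ∈-toList⁻; fromAny)
  import Data.Vec.Relation.Unary.Any.Properties as VAny
  open import Function using (_∘_; id; _⇔_; mk⇔; Equivalence; Inverse)
  open import Function.Definitions using (Injective)
  open import Relation.Binary.PropositionalEquality
  open import Relation.Nullary using (¬_; Dec; yes; no; does)
  open import Relation.Nullary.Decidable using (map′)
  open import Relation.Binary.Definitions using (tri<; tri≈; tri>)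

  does-sound : ∀ {P : Set} (d : Dec P) → T (does d) → P
  does-sound (yes p) _ = p

  does-complete : ∀ {P : Set} (d : Dec P) → P → T (does d)
  does-complete (yes _) _ = _
  does-complete (no ¬p) p = ¬p p

  length-concatMap : ∀ {A B : Set} (f : A → List B) xs → length (concatMap f xs) ≡ sum (map (length ∘ f) xs)
  length-concatMap f []       = refl
  length-concatMap f (x ∷ xs) = trans (List.length-++ (f x)) (cong (length (f x) +_) (length-concatMap f xs))

  AllPairs-lookup : ∀ {A : Set} {R : A → A → Set} {xs : List A} → AllPairs R xs →
                    ∀ {i j} → i Fin.< j → R (lookup xs i) (lookup xs j)
  AllPairs-lookup {xs = x ∷ xs} (x∼xs ∷ _) {Fin.zero} {Fin.suc j} _ = All.lookup x∼xs (∈-lookup j)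
  AllPairs-lookup {xs = x ∷ xs} (_ ∷ pairs) {Fin.suc i} {Fin.suc j} (s≤s i<j) = AllPairs-lookup pairs i<j

  ⊎-elim-≡ : ∀ {A B X : Set} (f : A ⊎ B → X) (s : A ⊎ B) {x} →
             (∀ a → s ≡ inj₁ a → f (inj₁ a) ≡ x) → (∀ b → s ≡ inj₂ b → f (inj₂ b) ≡ x) → f s ≡ x
  ⊎-elim-≡ f (inj₁ a) left right = left a refl
  ⊎-elim-≡ f (inj₂ b) left right = right b refl

  map₁-injective : ∀ {A B C : Set} {f : A → B} → Injective _≡_ _≡_ f →
                   Injective _≡_ _≡_ (map₁ {B = C} f)
  map₁-injective f-inj {inj₁ x} {inj₁ y} eq = cong inj₁ (f-inj (Sum.inj₁-injective eq))
  map₁-injective f-inj {inj₂ x} {inj₂ y} refl = refl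

  Vec-map-injective : ∀ {A B : Set} {f : A → B} → Injective _≡_ _≡_ f →
                      ∀ {n} → Injective _≡_ _≡_ (Vec.map {n = n} f)
  Vec-map-injective f-inj {x = []}     {[]}     eq = refl
  Vec-map-injective f-inj {x = x ∷ xs} {y ∷ ys} eq =
    cong₂ _∷_ (f-inj (Vec.∷-injectiveˡ eq)) (Vec-map-injective f-inj (Vec.∷-injectiveʳ eq))

  map-map₁ : ∀ {A B C D : Set} {f : B → C} {g : A → B} {h : A → C} → f ∘ g ≗ h →
             ∀ {n} (s : Vec (A ⊎ D) n) → Vec.map (map₁ f) (Vec.map (map₁ g) s) ≡ Vec.map (map₁ h) s
  map-map₁ fg≗h s = trans (sym (Vec.map-∘ _ _ s)) (Vec.map-cong (λ x → trans (Sum.map-map x) (Sum.map₁-cong fg≗h x)) s)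

  ∈ᵥ-map⁻ : ∀ {A B : Set} (f : A → B) {n y} {xs : Vec A n} → y ∈ᵥ Vec.map f xs →
            ∃ λ x → x ∈ᵥ xs × y ≡ f x
  ∈ᵥ-map⁻ f = fromAny ∘ VAny.map⁻

  module _ {C : Set} where

    shape-without-last : ∀ {k r} (s : Vec (Fin (suc k) ⊎ C) r) → ¬ inj₁ (fromℕ k) ∈ᵥ s →
                         ∃ λ s′ → s ≡ Vec.map (map₁ inject₁) s′
    shape-without-last []           _    = [] , refl
    shape-without-last (inj₂ c ∷ s) last∉ =
      let s′ , eq = shape-without-last s (last∉ ∘ there) in inj₂ c ∷ s′ , cong (inj₂ c ∷_) eq
    shape-without-last (inj₁ i ∷ s) last∉ with view i | shape-without-last s (last∉ ∘ there)
    ... | ‵inject₁ j | s′ , eq = inj₁ j ∷ s′ , cong (inj₁ (inject₁ j) ∷_) eq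
    ... | ‵fromℕ     | _       = ⊥-elim (last∉ (here refl))

    shape-without-variables : ∀ {k r} (s : Vec (Fin k ⊎ C) r) → (∀ i → ¬ inj₁ i ∈ᵥ s) →
                              ∃ λ (s′ : Vec (Fin 0 ⊎ C) r) → s ≡ Vec.map (map₁ (λ ())) s′
    shape-without-variables []           _    = [] , refl
    shape-without-variables (inj₁ i ∷ s) none = ⊥-elim (none i (here refl))
    shape-without-variables (inj₂ c ∷ s) none =
      let s′ , eq = shape-without-variables s (λ i → none i ∘ there) in inj₂ c ∷ s′ , cong (inj₂ c ∷_) eq

  module _ (σ : Signature) where
    open Signature σ

    module _ {A : Set} where

      snoc-inject₁ : ∀ {k} (ā : Fin k → A) b i → snoc σ ā b (inject₁ i) ≡ ā i
      snoc-inject₁ {suc k} ā b Fin.zero    = refl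
      snoc-inject₁ {suc k} ā b (Fin.suc i) = snoc-inject₁ (ā ∘ Fin.suc) b i

      snoc-last : ∀ {k} (ā : Fin k → A) b → snoc σ ā b (fromℕ k) ≡ b
      snoc-last {zero}  ā b = refl
      snoc-last {suc k} ā b = snoc-last (ā ∘ Fin.suc) b

      snoc-injective : ∀ {k} (ā : Fin k → A) b → Injective _≡_ _≡_ ā → (∀ i → b ≢ ā i) →
                       Injective _≡_ _≡_ (snoc σ ā b)
      snoc-injective {k} ā b ā-inj b∉ā {i} {j} eq with view i | view j
      ... | ‵inject₁ i | ‵inject₁ j =
        cong inject₁ (ā-inj (trans (sym (snoc-inject₁ ā b i)) (trans eq (snoc-inject₁ ā b j))))
      ... | ‵inject₁ i | ‵fromℕ = ⊥-elim (b∉ā i (trans (sym (snoc-last ā b)) (trans (sym eq) (snoc-inject₁ ā b i))))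
      ... | ‵fromℕ | ‵inject₁ j = ⊥-elim (b∉ā j (trans (sym (snoc-last ā b)) (trans eq (snoc-inject₁ ā b j))))
      ... | ‵fromℕ | ‵fromℕ = refl

      snoc-cong : ∀ {k} {ā ā′ : Fin k → A} b → ā ≗ ā′ → snoc σ ā b ≗ snoc σ ā′ b
      snoc-cong {zero}  b eq Fin.zero    = refl
      snoc-cong {suc k} b eq Fin.zero    = eq Fin.zero
      snoc-cong {suc k} b eq (Fin.suc i) = snoc-cong b (eq ∘ Fin.suc) i

      snoc-map : ∀ {B : Set} (f : A → B) {k} (ā : Fin k → A) b → f ∘ snoc σ ā b ≗ snoc σ (f ∘ ā) (f b)
      snoc-map f {zero}  ā b Fin.zero    = refl
      snoc-map f {suc k} ā b Fin.zero    = refl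
      snoc-map f {suc k} ā b (Fin.suc i) = snoc-map f (ā ∘ Fin.suc) b i

    restrict-cong : ∀ {k ℓ} (τ : KType σ k) {f g : Fin ℓ → Fin k} → f ≗ g → restrict σ τ f ≗ restrict σ τ g
    restrict-cong τ f≗g (R , s) = cong (λ s → τ (R , s)) (Vec.map-cong (Sum.map₁-cong f≗g) s)

    restrict-∘ : ∀ {k ℓ m} (τ : KType σ k) (f : Fin ℓ → Fin k) (g : Fin m → Fin ℓ) →
                 restrict σ (restrict σ τ f) g ≗ restrict σ τ (f ∘ g)
    restrict-∘ τ f g (R , s) =
      cong (λ s → τ (R , s)) (trans (sym (Vec.map-∘ (map₁ f) (map₁ g) s)) (Vec.map-cong Sum.map-map s))

    restrict-id : ∀ {k} (τ : KType σ k) → restrict σ τ id ≗ τ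
    restrict-id τ (R , s) = cong (λ s → τ (R , s)) (trans (Vec.map-cong Sum.map-id s) (Vec.map-id s))

    ∈ᵗ-resp-≗ : ∀ {k} {τ τ′ : KType σ k} {L} → τ ≗ τ′ → _∈ᵗ_ σ τ L → _∈ᵗ_ σ τ′ L
    ∈ᵗ-resp-≗ τ≗τ′ = Any.map (λ τ≗ a → trans (sym (τ≗τ′ a)) (τ≗ a))

    module _ {A : Set} (𝔄 : Structure σ A) where

      tp-reindex : ∀ {k ℓ} {e : Fin ℓ → A} {d : Fin k → A} (π : Fin ℓ → Fin k) →
                   e ≗ d ∘ π → tp σ 𝔄 e ≗ restrict σ (tp σ 𝔄 d) π
      tp-reindex {d = d} π e≗dπ (R , s) = cong (Structure.rel 𝔄 R)
        (trans (Vec.map-cong (Sum.map₁-cong e≗dπ) s) (trans (sym (Vec.map-cong Sum.map-map s)) (Vec.map-∘ (map₁ d) (map₁ π) s)))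

      tp-cong : ∀ {k} {e e′ : Fin k → A} → e ≗ e′ → tp σ 𝔄 e ≗ tp σ 𝔄 e′
      tp-cong e≗e′ (R , s) = cong (Structure.rel 𝔄 R) (Vec.map-cong (Sum.map₁-cong e≗e′) s)

    ar≤wd : ∀ R → ar R ≤ wd σ
    ar≤wd R = go (allFin nR) (∈-allFin R)
      where
      go : ∀ Rs → R ∈ Rs → ar R ≤ foldr _⊔_ 0 (map ar Rs)
      go (R′ ∷ Rs) (here refl) = ℕ.m≤m⊔n (ar R) _
      go (R′ ∷ Rs) (there R∈)  = ℕ.≤-trans (go Rs R∈) (ℕ.m≤n⊔m (ar R′) _)

    1≤wd : 1 ≤ wd σ
    1≤wd = ℕ.≤-trans (ar-pos R₀) (ar≤wd R₀)
      where
      R₀ : Fin nR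
      R₀ = Fin.fromℕ< nR-pos

    allVecs-complete : ∀ {A : Set} {xs : List A} {n} (v : Vec A n) → VAll.All (_∈ xs) v → v ∈ allVecs σ xs n
    allVecs-complete []      []           = here refl
    allVecs-complete (x ∷ v) (x∈ ∷ v∈) =
      ∈-concatMap⁺ _ (Any.map (λ { refl → ∈-map⁺ (x ∷_) (allVecs-complete v v∈) }) x∈)

    allTAtoms-complete : ∀ {k} (a : TAtom σ k) → a ∈ allTAtoms σ k
    allTAtoms-complete {k} (R , s) =
      ∈-concatMap⁺ _ (Any.map (λ { refl → ∈-map⁺ (R ,_) (allVecs-complete s (VAll.universal term∈ s)) })
                            (∈-allFin R))
      where
      term∈ : (t : Fin k ⊎ Fin nC) → t ∈ map inj₁ (allFin k) ++ map inj₂ (allFin nC)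
      term∈ (inj₁ i) = ∈-++⁺ˡ (∈-map⁺ inj₁ (∈-allFin i))
      term∈ (inj₂ c) = ∈-++⁺ʳ _ (∈-map⁺ inj₂ (∈-allFin c))

    isFull⇔ : ∀ {k} {R} {s : Vec (Fin k ⊎ Fin nC) (ar R)} → isFull σ (R , s) ≡ true ⇔ (∀ i → inj₁ i ∈ᵥ s)
    isFull⇔ {k} {R} {s} = mk⇔ to from
      where
      occurs : Fin k → Fin k ⊎ Fin nC → Bool
      occurs i t = does (decTerm σ t (inj₁ i))
      to : isFull σ (R , s) ≡ true → ∀ i → inj₁ i ∈ᵥ s
      to full i = ∈-toList⁻ (Any.map (λ {t} t≡ → sym (does-sound (decTerm σ t (inj₁ i)) t≡)) (any⁻ (occurs i) (toList s)
                    (All.lookup (all⁺ (λ i → any (occurs i) (toList s)) (allFin k) (Equivalence.from T-≡ full)) (∈-allFin i))))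
      from : (∀ i → inj₁ i ∈ᵥ s) → isFull σ (R , s) ≡ true
      from occ = Equivalence.to T-≡ (all⁻ (λ i → any (occurs i) (toList s)) {xs = allFin k} (All.tabulate λ {i} _ →
                   any⁺ (occurs i) (Any.map (λ {t} ≡t → does-complete (decTerm σ t (inj₁ i)) (sym ≡t)) (∈-toList⁺ (occ i)))))

    private
      true≢false : true ≢ false
      true≢false ()

    missing-variable : ∀ {k} {R} {s : Vec (Fin k ⊎ Fin nC) (ar R)} → isFull σ (R , s) ≡ false →
                       ∃ λ i → ¬ inj₁ i ∈ᵥ s
    missing-variable {k} {R} {s} notFull =
      Fin.¬∀⟶∃¬ k _ (λ i → VecDec._∈?_ (decTerm σ) (inj₁ i) s)
        (λ occ → true≢false (trans (sym (Equivalence.from isFull⇔ occ)) notFull))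

    compatibleᵇ⇔ : ∀ {k} {τ τ′ : KType σ k} → compatibleᵇ σ τ τ′ ≡ true ⇔ Compatible σ τ τ′
    compatibleᵇ⇔ {k} {τ} {τ′} = mk⇔ to from
      where
      agrees : TAtom σ k → Bool
      agrees a = isFull σ a Data.Bool.∨ does (τ a Bool.≟ τ′ a)
      to : compatibleᵇ σ τ τ′ ≡ true → Compatible σ τ τ′
      to c a notFull with Equivalence.to T-∨ (All.lookup (all⁺ agrees _ (Equivalence.from T-≡ c)) (allTAtoms-complete a))
      ... | inj₁ full = ⊥-elim (subst T notFull full)
      ... | inj₂ eq   = does-sound (τ a Bool.≟ τ′ a) eq
      from : Compatible σ τ τ′ → compatibleᵇ σ τ τ′ ≡ true
      from c = Equivalence.to T-≡ (all⁻ agrees {xs = allTAtoms σ k} (All.tabulate λ {a} _ → Equivalence.from T-∨ (decide a)))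
        where
        decide : ∀ a → T (isFull σ a) ⊎ T (does (τ a Bool.≟ τ′ a))
        decide a with isFull σ a in eq
        ... | true  = inj₁ _
        ... | false = inj₂ (does-complete (τ a Bool.≟ τ′ a) (c a eq))

    _≟ᵗ_ : ∀ {k} (τ τ′ : KType σ k) → Dec (τ ≗ τ′)
    τ ≟ᵗ τ′ = map′ (λ eqs a → All.lookup eqs (allTAtoms-complete a)) (λ τ≗τ′ → All.tabulate (λ {a} _ → τ≗τ′ a))
                   (All.all? (λ a → τ a Bool.≟ τ′ a) (allTAtoms σ _))

    length-allVecs : ∀ {A : Set} (xs : List A) n → length (allVecs σ xs n) ≡ length xs ^ n
    length-allVecs xs zero    = refl
    length-allVecs xs (suc n) = begin
      length (concatMap (λ x → map (x ∷_) (allVecs σ xs n)) xs)   ≡⟨ length-concatMap _ xs ⟩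
      sum (map (λ x → length (map (x ∷_) (allVecs σ xs n))) xs)
        ≡⟨ cong sum (List.map-cong (λ x → List.length-map (x ∷_) (allVecs σ xs n)) xs) ⟩
      sum (map (λ _ → length (allVecs σ xs n)) xs)               ≡⟨ sum-map-const xs ⟩
      length xs * length (allVecs σ xs n)                        ≡⟨ cong (length xs *_) (length-allVecs xs n) ⟩
      length xs ^ suc n                                          ∎
      where
      open ≡-Reasoning
      sum-map-const : ∀ {A : Set} {c} (ys : List A) → sum (map (λ _ → c) ys) ≡ length ys * c
      sum-map-const []       = refl
      sum-map-const (y ∷ ys) = cong (_ +_) (sum-map-const ys)

    length-allTAtoms : ∀ k → length (allTAtoms σ k) ≡ sum (map (λ R → (k + nC) ^ ar R) (allFin nR))
    length-allTAtoms k = trans (length-concatMap _ (allFin nR)) (cong sum (List.map-cong count (allFin nR)))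
      where
      terms : List (Fin k ⊎ Fin nC)
      terms = map inj₁ (allFin k) ++ map inj₂ (allFin nC)
      length-terms : length terms ≡ k + nC
      length-terms = trans (List.length-++ (map inj₁ (allFin k)))
        (cong₂ _+_ (trans (List.length-map inj₁ (allFin k)) (List.length-tabulate {n = k} id))
                   (trans (List.length-map inj₂ (allFin nC)) (List.length-tabulate {n = nC} id)))
      count : ∀ R → length (map {B = TAtom σ k} (R ,_) (allVecs σ terms (ar R))) ≡ (k + nC) ^ ar R
      count R = trans (List.length-map {B = TAtom σ k} (R ,_) (allVecs σ terms (ar R)))
                      (trans (length-allVecs terms (ar R)) (cong (_^ ar R) length-terms))

    numTypes-mono : ∀ {k ℓ} → k ≤ ℓ → numTypes σ k ≤ numTypes σ ℓ
    numTypes-mono k≤ℓ = ℕ.^-monoʳ-≤ 2 (sum-map-mono (allFin nR) (λ R → ℕ.^-monoˡ-≤ (ar R) (ℕ.+-monoˡ-≤ nC k≤ℓ)))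
      where
      sum-map-mono : ∀ {A : Set} {f g : A → ℕ} (xs : List A) → (∀ x → f x ≤ g x) → sum (map f xs) ≤ sum (map g xs)
      sum-map-mono []       f≤g = z≤n
      sum-map-mono (x ∷ xs) f≤g = ℕ.+-mono-≤ (f≤g x) (sum-map-mono xs f≤g)

    typeCode : ∀ {k} → KType σ k → Fin (2 ^ length (allTAtoms σ k))
    typeCode {k} τ = funToFin (λ j → Inverse.from Fin.2↔Bool (τ (lookup (allTAtoms σ k) j)))

    typeCode-injective : ∀ {k} {τ τ′ : KType σ k} → typeCode τ ≡ typeCode τ′ → τ ≗ τ′
    typeCode-injective {k} {τ} {τ′} eq a = begin
      τ a                            ≡⟨ cong τ a≡ ⟩
      τ (lookup (allTAtoms σ k) j)   ≡⟨ Fin2-injective (begin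
        Inverse.from Fin.2↔Bool (τ (lookup (allTAtoms σ k) j))   ≡⟨ sym (Fin.finToFun-funToFin _ j) ⟩
        finToFun (typeCode τ) j                                  ≡⟨ cong (λ c → finToFun c j) eq ⟩
        finToFun (typeCode τ′) j                                 ≡⟨ Fin.finToFun-funToFin _ j ⟩
        Inverse.from Fin.2↔Bool (τ′ (lookup (allTAtoms σ k) j))  ∎) ⟩
      τ′ (lookup (allTAtoms σ k) j)  ≡⟨ cong τ′ (sym a≡) ⟩
      τ′ a                           ∎
      where
      open ≡-Reasoning
      j : Fin (length (allTAtoms σ k))
      j = index (allTAtoms-complete a)
      a≡ : a ≡ lookup (allTAtoms σ k) j
      a≡ = lookup-index (allTAtoms-complete a)
      Fin2-injective : ∀ {x y} → Inverse.from Fin.2↔Bool x ≡ Inverse.from Fin.2↔Bool y → x ≡ y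
      Fin2-injective {x} {y} eq = trans (sym (Inverse.strictlyInverseˡ Fin.2↔Bool x))
                                   (trans (cong (Inverse.to Fin.2↔Bool) eq) (Inverse.strictlyInverseˡ Fin.2↔Bool y))

    length-distinct-types : ∀ {k} (L : List (KType σ k)) → AllPairs (λ τ τ′ → ¬ τ ≗ τ′) L → length L ≤ numTypes σ k
    length-distinct-types {k} L distinct =
      subst (length L ≤_) (cong (2 ^_) (length-allTAtoms k)) (Fin.injective⇒≤ code-injective)
      where
      code-injective : Injective _≡_ _≡_ (typeCode ∘ lookup L)
      code-injective {i} {j} eq with Fin.<-cmp i j
      ... | tri< i<j _ _ = ⊥-elim (AllPairs-lookup distinct i<j (typeCode-injective eq))
      ... | tri≈ _ i≡j _ = i≡j
      ... | tri> _ _ j<i = ⊥-elim (AllPairs-lookup distinct j<i (λ a → sym (typeCode-injective eq a)))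

    lookupM-∈ : ∀ {A : Set} (xs : List A) {j x} → lookupM σ xs j ≡ just x → x ∈ xs
    lookupM-∈ (y ∷ xs) {zero}  refl = here refl
    lookupM-∈ (y ∷ xs) {suc j} eq   = there (lookupM-∈ xs eq)

    lookupM-lookup : ∀ {A : Set} (xs : List A) i → lookupM σ xs (toℕ i) ≡ just (lookup xs i)
    lookupM-lookup (x ∷ xs) Fin.zero    = refl
    lookupM-lookup (x ∷ xs) (Fin.suc i) = lookupM-lookup xs i

    module _ (τs : TypeFamily σ) where

      initialType : Consistent σ τs → ∃ λ τ₀ → head (τs 0) ≡ just τ₀ × _∈ᵗ_ σ τ₀ (τs 0)
      initialType consistent with τs 0 | proj₂ (proj₁ consistent)
      ... | τ₀ ∷ _ | _ = τ₀ , refl , here (λ _ → refl)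

      constant-facts : (closed : Closed σ τs) (consistent : Consistent σ τs) →
                       ∀ {m} {τ : KType σ m} → _∈ᵗ_ σ τ (τs m) → m ≤ wd σ →
                       ∀ R (s : Vec (Fin 0 ⊎ Fin nC) (ar R)) → τ (R , Vec.map (map₁ (λ ())) s) ≡ proj₁ (initialType consistent) (R , s)
      constant-facts closed consistent {m} {τ} τ∈ m≤w R s =
        proj₂ consistent _ _ (closed m 0 m≤w τ τ∈ (λ ()) (λ { {()} })) (proj₂ (proj₂ (initialType consistent))) (R , s)

module Admissibility where

  open import Data.Vec.Membership.Propositional using () renaming (_∈_ to _∈ᵥ_)
  open import Data.Bool using (T)
  open import Data.Unit using (⊤)
  open import Data.Empty using (⊥-elim)
  open import Data.Fin using (Fin; inject₁; inject≤; splitAt; _↑ˡ_; _↑ʳ_)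
  import Data.Fin as Fin
  import Data.Fin.Properties as Fin
  open import Data.Nat using (ℕ; zero; suc; _+_; _≤_; _≤‴_; ≤‴-refl; ≤‴-step; z≤n; s≤s)
  import Data.Nat.Properties as ℕ
  open import Data.Product using (Σ-syntax; ∃; _×_; _,_; proj₁; proj₂)
  open import Data.Sum using (_⊎_; inj₁; inj₂; [_,_]; map₁)
  import Data.Sum.Properties as Sum
  open import Data.Vec using (Vec; []; _∷_)
  import Data.Vec as Vec
  import Data.Vec.Properties as Vec
  open import Data.Vec.Relation.Unary.Any using (here; there; index)
  open import Data.Vec.Membership.Propositional.Properties using (∈-map⁺)
  import Data.Vec.Relation.Unary.Any.Properties as VAny
  open import Function using (_∘_; _⇔_; mk⇔; Equivalence)
  import Function.Properties.Equivalence as ⇔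
  open import Function.Related.TypeIsomorphisms using (¬-cong-⇔)
  open import Data.Product.Function.NonDependent.Propositional using (_×-⇔_)
  open import Data.Sum.Function.Propositional using (_⊎-⇔_)
  open import Data.Bool.Properties using (T-≡)
  open import Function.Definitions using (Injective)
  open import Relation.Binary.Definitions using (DecidableEquality)
  open import Relation.Binary.PropositionalEquality hiding ([_])
  open import Relation.Nullary using (Dec; yes; no; ¬?)
  import Data.List.Relation.Unary.All as All

  open TypeLemmas

  record Factorisation {A C : Set} {m} (v : Vec (A ⊎ C) m) : Set where
    field
      size            : ℕ
      elems           : Fin size → A
      elems-injective : Injective _≡_ _≡_ elems
      shape           : Vec (Fin size ⊎ C) m
      shape-map     : Vec.map (map₁ elems) shape ≡ v
      shape-full    : ∀ i → inj₁ i ∈ᵥ shape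
      size≤           : size ≤ m

  factorise : ∀ {A C : Set} → DecidableEquality A → ∀ {m} (v : Vec (A ⊎ C) m) → Factorisation v
  factorise _≟_ [] = record
    { size = 0 ; elems = λ () ; elems-injective = λ { {()} } ; shape = [] ; shape-map = refl
    ; shape-full = λ () ; size≤ = z≤n }
  factorise _≟_ (inj₂ c ∷ v) = record
    { size = F.size ; elems = F.elems ; elems-injective = F.elems-injective
    ; shape = inj₂ c ∷ F.shape ; shape-map = cong (inj₂ c ∷_) F.shape-map
    ; shape-full = there ∘ F.shape-full ; size≤ = ℕ.m≤n⇒m≤1+n F.size≤ }
    where module F = Factorisation (factorise _≟_ v)
  factorise _≟_ (inj₁ a ∷ v) = extend (Fin.any? (λ j → F.elems j ≟ a))
    where
    module F = Factorisation (factorise _≟_ v)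
    extend : Dec (∃ λ j → F.elems j ≡ a) → Factorisation (inj₁ a ∷ v)
    extend (yes (j , elems-j≡a)) = record
      { size = F.size ; elems = F.elems ; elems-injective = F.elems-injective
      ; shape = inj₁ j ∷ F.shape ; shape-map = cong₂ _∷_ (cong inj₁ elems-j≡a) F.shape-map
      ; shape-full = there ∘ F.shape-full ; size≤ = ℕ.m≤n⇒m≤1+n F.size≤ }
    extend (no a∉) = record
      { size = suc F.size ; elems = elems ; elems-injective = elems-injective
      ; shape = inj₁ Fin.zero ∷ Vec.map (map₁ Fin.suc) F.shape
      ; shape-map = cong (inj₁ a ∷_) (trans (sym (Vec.map-∘ _ _ F.shape))
                                            (trans (Vec.map-cong Sum.map-map F.shape) F.shape-map))
      ; shape-full = λ { Fin.zero → here refl ; (Fin.suc i) → there (∈-map⁺ (map₁ Fin.suc) (F.shape-full i)) }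
      ; size≤ = s≤s F.size≤ }
      where
      elems : Fin (suc F.size) → _
      elems Fin.zero    = a
      elems (Fin.suc i) = F.elems i
      elems-injective : Injective _≡_ _≡_ elems
      elems-injective {Fin.zero}  {Fin.zero}  eq = refl
      elems-injective {Fin.zero}  {Fin.suc j} eq = ⊥-elim (a∉ (j , sym eq))
      elems-injective {Fin.suc i} {Fin.zero}  eq = ⊥-elim (a∉ (i , eq))
      elems-injective {Fin.suc i} {Fin.suc j} eq = cong Fin.suc (F.elems-injective eq)

  record Listing {k} (Q : Fin k → Set) : Set where
    field
      size         : ℕ
      at           : Fin size → Fin k
      at-injective : Injective _≡_ _≡_ at
      at-sound     : ∀ a → Q (at a)
      at-complete  : ∀ j → Q j → ∃ λ a → at a ≡ j

  listing : ∀ {k} {Q : Fin k → Set} → (∀ j → Dec (Q j)) → Listing Q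
  listing {zero} Q? = record
    { size = 0 ; at = λ () ; at-injective = λ { {()} } ; at-sound = λ () ; at-complete = λ () }
  listing {suc k} {Q} Q? with Q? Fin.zero
  ... | yes q₀ = record
    { size = suc L.size ; at = at ; at-injective = at-injective
    ; at-sound = λ { Fin.zero → q₀ ; (Fin.suc a) → L.at-sound a }
    ; at-complete = λ { Fin.zero _ → Fin.zero , refl
                      ; (Fin.suc j) q → let a , eq = L.at-complete j q in Fin.suc a , cong Fin.suc eq } }
    where
    module L = Listing (listing (Q? ∘ Fin.suc))
    at : Fin (suc L.size) → Fin (suc k)
    at Fin.zero    = Fin.zero
    at (Fin.suc a) = Fin.suc (L.at a)
    at-injective : Injective _≡_ _≡_ at
    at-injective {Fin.zero}  {Fin.zero}  eq = refl
    at-injective {Fin.suc a} {Fin.suc b} eq = cong Fin.suc (L.at-injective (Fin.suc-injective eq))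
  ... | no ¬q₀ = record
    { size = L.size ; at = Fin.suc ∘ L.at ; at-injective = L.at-injective ∘ Fin.suc-injective
    ; at-sound = L.at-sound
    ; at-complete = λ { Fin.zero q → ⊥-elim (¬q₀ q)
                      ; (Fin.suc j) q → let a , eq = L.at-complete j q in a , cong Fin.suc eq } }
    where module L = Listing (listing (Q? ∘ Fin.suc))

  record Rearrangement {k} (Q : Fin k → Set) : Set where
    field
      n₁ n₂       : ℕ
      π           : Fin (n₁ + n₂) → Fin k
      π-injective : Injective _≡_ _≡_ π
      π⁻¹         : Fin k → Fin (n₁ + n₂)
      π-π⁻¹       : ∀ l → π (π⁻¹ l) ≡ l
      Q-first     : ∀ a → Q (π (a ↑ˡ n₂))
      π⁻¹-Q       : ∀ l → Q l → ∃ λ a → π⁻¹ l ≡ a ↑ˡ n₂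

  rearrangement : ∀ {k} {Q : Fin k → Set} → (∀ j → Dec (Q j)) → Rearrangement Q
  rearrangement {k} {Q} Q? = record
    { n₁ = In.size ; n₂ = Out.size ; π = π ; π-injective = π-injective ; π⁻¹ = π⁻¹ ; π-π⁻¹ = π-π⁻¹
    ; Q-first = λ a → subst Q (sym (cong [ In.at , Out.at ] (Fin.splitAt-↑ˡ In.size a Out.size))) (In.at-sound a)
    ; π⁻¹-Q = π⁻¹-Q }
    where
    module In  = Listing (listing Q?)
    module Out = Listing (listing (¬? ∘ Q?))
    π : Fin (In.size + Out.size) → Fin k
    π i = [ In.at , Out.at ] (splitAt In.size i)
    π-injective : Injective _≡_ _≡_ π
    π-injective {i} {j} eq with splitAt In.size i in eqi | splitAt In.size j in eqj
    ... | inj₁ a | inj₁ b =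
      trans (sym (Fin.splitAt⁻¹-↑ˡ eqi)) (trans (cong (_↑ˡ Out.size) (In.at-injective eq)) (Fin.splitAt⁻¹-↑ˡ eqj))
    ... | inj₁ a | inj₂ b = ⊥-elim (Out.at-sound b (subst Q eq (In.at-sound a)))
    ... | inj₂ a | inj₁ b = ⊥-elim (Out.at-sound a (subst Q (sym eq) (In.at-sound b)))
    ... | inj₂ a | inj₂ b =
      trans (sym (Fin.splitAt⁻¹-↑ʳ eqi)) (trans (cong (In.size ↑ʳ_) (Out.at-injective eq)) (Fin.splitAt⁻¹-↑ʳ eqj))
    π⁻¹ : Fin k → Fin (In.size + Out.size)
    π⁻¹ l with Q? l
    ... | yes q = proj₁ (In.at-complete l q) ↑ˡ Out.size
    ... | no ¬q = In.size ↑ʳ proj₁ (Out.at-complete l ¬q)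
    π-π⁻¹ : ∀ l → π (π⁻¹ l) ≡ l
    π-π⁻¹ l with Q? l
    ... | yes q = trans (cong [ In.at , Out.at ] (Fin.splitAt-↑ˡ In.size _ Out.size)) (proj₂ (In.at-complete l q))
    ... | no ¬q = trans (cong [ In.at , Out.at ] (Fin.splitAt-↑ʳ In.size Out.size _)) (proj₂ (Out.at-complete l ¬q))
    π⁻¹-Q : ∀ l → Q l → ∃ λ a → π⁻¹ l ≡ a ↑ˡ Out.size
    π⁻¹-Q l q with Q? l
    ... | yes _ = _ , refl
    ... | no ¬q = ⊥-elim (¬q q)

  module _ (σ : Signature) where
    open Signature σ

    record Guard {A : Set} (𝔄 : Structure σ A) {m} (α : FAtom σ m) (ρ : Fin m → A ⊎ Fin nC) : Set where
      field
        size            : ℕ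
        elems           : Fin size → A
        elems-injective : Injective _≡_ _≡_ elems
        size≤wd         : size ≤ wd σ
        guarded         : Guarded σ (tp σ 𝔄 elems)
        term            : ∀ i → OccursA σ i α → Fin size ⊎ Fin nC
        term-sound      : ∀ i p → ρ i ≡ map₁ elems (term i p)

      term-irrelevant : ∀ {i} p q → term i p ≡ term i q
      term-irrelevant {i} p q = map₁-injective elems-injective (trans (sym (term-sound i p)) (term-sound i q))

    guard : ∀ {A} (𝔄 : Structure σ A) → DecidableEquality A → ∀ {m} (α : FAtom σ m) {ρ} →
            SatA σ 𝔄 α ρ → Guard 𝔄 α ρ
    guard 𝔄 _≟_ (relA R ts) {ρ} sat = record
      { size = F.size ; elems = F.elems ; elems-injective = F.elems-injective
      ; size≤wd = ℕ.≤-trans F.size≤ (ar≤wd σ R)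
      ; guarded = inj₂ ((R , F.shape) , Equivalence.from (isFull⇔ σ) F.shape-full
                       , trans (cong (Structure.rel 𝔄 R) F.shape-map) (Equivalence.to T-≡ sat))
      ; term = λ i p → Vec.lookup F.shape (index p)
      ; term-sound = term-sound }
      where
      module F = Factorisation (factorise _≟_ (Vec.map [ ρ , inj₂ ] ts))
      term-sound : ∀ i (p : inj₁ i ∈ᵥ ts) → ρ i ≡ map₁ F.elems (Vec.lookup F.shape (index p))
      term-sound i p = begin
        ρ i                                                    ≡⟨ cong [ ρ , inj₂ ] (VAny.lookup-index p) ⟩
        [ ρ , inj₂ ] (Vec.lookup ts (index p))                 ≡⟨ Vec.lookup-map (index p) [ ρ , inj₂ ] ts ⟨
        Vec.lookup (Vec.map [ ρ , inj₂ ] ts) (index p)         ≡⟨ cong (λ v → Vec.lookup v (index p)) F.shape-map ⟨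
        Vec.lookup (Vec.map (map₁ F.elems) F.shape) (index p)  ≡⟨ Vec.lookup-map (index p) (map₁ F.elems) F.shape ⟩
        map₁ F.elems (Vec.lookup F.shape (index p))            ∎
        where open ≡-Reasoning
    guard 𝔄 _≟_ (eqA t u) {ρ} t≡u = record
      { size = F.size ; elems = F.elems ; elems-injective = F.elems-injective
      ; size≤wd = ℕ.≤-trans F.size≤ (1≤wd σ)
      ; guarded = inj₁ F.size≤
      ; term = λ _ _ → Vec.lookup F.shape Fin.zero
      ; term-sound = λ { i (inj₁ refl) → value-t ; i (inj₂ refl) → trans (sym t≡u) value-t } }
      where
      module F = Factorisation (factorise _≟_ (evalT σ 𝔄 ρ t ∷ []))
      value-t : evalT σ 𝔄 ρ t ≡ map₁ F.elems (Vec.lookup F.shape Fin.zero)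
      value-t = trans (cong (λ v → Vec.lookup v Fin.zero) (sym F.shape-map)) (Vec.lookup-map Fin.zero (map₁ F.elems) F.shape)

    module Agreement {A B : Set} (𝔄 : Structure σ A) (𝔅 : Structure σ B) {n m : ℕ}
                     {eA : Fin n → A} {eB : Fin n → B}
                     (eA-injective : Injective _≡_ _≡_ eA) (eB-injective : Injective _≡_ _≡_ eB)
                     (same-type : tp σ 𝔄 eA ≗ tp σ 𝔅 eB)
                     {V : Fin m → Set} (term : ∀ i → V i → Fin n ⊎ Fin nC)
                     {ρA : Fin m → A ⊎ Fin nC} {ρB : Fin m → B ⊎ Fin nC}
                     (ρA≡ : ∀ i v → ρA i ≡ map₁ eA (term i v)) (ρB≡ : ∀ i v → ρB i ≡ map₁ eB (term i v)) where

      termOf : (t : Term σ m) → (∀ i → t ≡ inj₁ i → V i) → Fin n ⊎ Fin nC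
      termOf (inj₁ i) h = term i (h i refl)
      termOf (inj₂ c) h = inj₂ c

      shapeOf : ∀ {l} (ts : Vec (Term σ m) l) → (∀ i → inj₁ i ∈ᵥ ts → V i) → Vec (Fin n ⊎ Fin nC) l
      shapeOf []       h = []
      shapeOf (t ∷ ts) h = termOf t (λ i t≡ → h i (here (sym t≡))) ∷ shapeOf ts (λ i → h i ∘ there)

      module _ {X : Set} {eX : Fin n → X} {ρX : Fin m → X ⊎ Fin nC}
               (ρX≡ : ∀ i v → ρX i ≡ map₁ eX (term i v)) where

        eval-termOf : ∀ t h → [ ρX , inj₂ ] t ≡ map₁ eX (termOf t h)
        eval-termOf (inj₁ i) h = ρX≡ i _
        eval-termOf (inj₂ c) h = refl

        eval-shapeOf : ∀ {l} (ts : Vec (Term σ m) l) h → Vec.map [ ρX , inj₂ ] ts ≡ Vec.map (map₁ eX) (shapeOf ts h)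
        eval-shapeOf []       h = refl
        eval-shapeOf (t ∷ ts) h = cong₂ _∷_ (eval-termOf t _) (eval-shapeOf ts _)

        eval-≡⇔ : Injective _≡_ _≡_ eX → ∀ t u ht hu →
                  [ ρX , inj₂ ] t ≡ [ ρX , inj₂ ] u ⇔ termOf t ht ≡ termOf u hu
        eval-≡⇔ eX-injective t u ht hu = mk⇔
          (λ eq → map₁-injective eX-injective (trans (sym (eval-termOf t ht)) (trans eq (eval-termOf u hu))))
          (λ eq → trans (eval-termOf t ht) (trans (cong (map₁ eX) eq) (sym (eval-termOf u hu))))

      satA⇔ : (α : FAtom σ m) → (∀ i → OccursA σ i α → V i) → SatA σ 𝔄 α ρA ⇔ SatA σ 𝔅 α ρB
      satA⇔ (relA R ts) h = mk⇔ (subst T rel≡) (subst T (sym rel≡))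
        where
        rel≡ : Structure.rel 𝔄 R (Vec.map [ ρA , inj₂ ] ts) ≡ Structure.rel 𝔅 R (Vec.map [ ρB , inj₂ ] ts)
        rel≡ = begin
          Structure.rel 𝔄 R (Vec.map [ ρA , inj₂ ] ts)  ≡⟨ cong (Structure.rel 𝔄 R) (eval-shapeOf ρA≡ ts h) ⟩
          tp σ 𝔄 eA (R , shapeOf ts h)                  ≡⟨ same-type _ ⟩
          tp σ 𝔅 eB (R , shapeOf ts h)                  ≡⟨ cong (Structure.rel 𝔅 R) (eval-shapeOf ρB≡ ts h) ⟨
          Structure.rel 𝔅 R (Vec.map [ ρB , inj₂ ] ts)  ∎
          where open ≡-Reasoning
      satA⇔ (eqA t u) h =
        ⇔.trans (eval-≡⇔ ρA≡ eA-injective t u ht hu) (⇔.sym (eval-≡⇔ ρB≡ eB-injective t u ht hu))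
        where
        ht : ∀ i → t ≡ inj₁ i → V i
        ht i = h i ∘ inj₁
        hu : ∀ i → u ≡ inj₁ i → V i
        hu i = h i ∘ inj₂

      satQF⇔ : (ψ : QF σ m) → (∀ i → FreeIn σ i ψ → V i) → SatQF σ 𝔄 ψ ρA ⇔ SatQF σ 𝔅 ψ ρB
      satQF⇔ (atomQ α)  h = satA⇔ α h
      satQF⇔ (negQ ψ)   h = ¬-cong-⇔ (satQF⇔ ψ h)
      satQF⇔ (andQ ψ χ) h = satQF⇔ ψ (λ i → h i ∘ inj₁) ×-⇔ satQF⇔ χ (λ i → h i ∘ inj₂)
      satQF⇔ (orQ ψ χ)  h = satQF⇔ ψ (λ i → h i ∘ inj₁) ⊎-⇔ satQF⇔ χ (λ i → h i ∘ inj₂)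

  module _ (σ : Signature) (τs : TypeFamily σ) where
    open Signature σ

    record Admissible {A : Set} (𝔄 : Structure σ A) : Set₁ where
      field
        _≟_           : DecidableEquality A
        Extendable    : ∀ {k} → (Fin k → A) → Set
        extendable-∘  : ∀ {k ℓ} {ā : Fin k → A} (π : Fin ℓ → Fin k) → Injective _≡_ _≡_ π →
                        Extendable ā → Extendable (ā ∘ π)
        extendable-[] : Extendable {0} (λ ())
        guarded       : ∀ {k} (ā : Fin k → A) → Injective _≡_ _≡_ ā → Guarded σ (tp σ 𝔄 ā) →
                        _∈ᵗ_ σ (tp σ 𝔄 ā) (τs k) × Extendable ā
        extend        : ∀ {k} → suc k ≤ wd σ → ∀ {τ₁ τ₂} → _∈ᵗ_ σ τ₁ (τs k) → _∈ᵗ_ σ τ₂ (τs (suc k)) →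
                        _⊆ᵗ_ σ τ₁ τ₂ → (ā : Fin k → A) → Injective _≡_ _≡_ ā → Extendable ā → tp σ 𝔄 ā ≗ τ₁ →
                        Σ[ b ∈ A ] ((∀ i → b ≢ ā i) × Extendable (snoc σ ā b) × tp σ 𝔄 (snoc σ ā b) ≗ τ₂)

    module Realisation (closed : Closed σ τs) (consistent : Consistent σ τs)
                       {A : Set} {𝔄 : Structure σ A} (adm : Admissible 𝔄) where
      open Admissible adm

      record Realiser {n} (τ : KType σ n) : Set where
        field
          elems            : Fin n → A
          elems-injective  : Injective _≡_ _≡_ elems
          realises         : tp σ 𝔄 elems ≗ τ

      ≤‴⇒≤ : ∀ {k n} → k ≤‴ n → k ≤ n
      ≤‴⇒≤ = ℕ.≤″⇒≤ ∘ ℕ.≤‴⇒≤″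

      realise-from : ∀ {k n} (k≤n : k ≤‴ n) {τ : KType σ n} → _∈ᵗ_ σ τ (τs n) → n ≤ wd σ →
                     (x : Fin k → A) → Injective _≡_ _≡_ x → Extendable x →
                     tp σ 𝔄 x ≗ restrict σ τ (λ i → inject≤ i (≤‴⇒≤ k≤n)) →
                     Σ[ r ∈ Realiser τ ] (∀ i → Realiser.elems r (inject≤ i (≤‴⇒≤ k≤n)) ≡ x i)
      realise-from ≤‴-refl {τ} τ∈ n≤w x x-inj x-ext tp-x =
        record { elems = x ; elems-injective = x-inj
               ; realises = λ a → trans (tp-x a) (trans (restrict-cong σ τ (λ i → Fin.inject≤-refl i _) a) (restrict-id σ τ a)) }
        , λ i → cong x (Fin.inject≤-refl i _)
      realise-from {k} {n} (≤‴-step k<n) {τ} τ∈ n≤w x x-inj x-ext tp-x =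
        let b , b∉x , b-ext , tp-b = extend (ℕ.≤-trans sk≤n n≤w) τ₁∈ τ₂∈ τ₁⊆τ₂ x x-inj x-ext tp-x
            r , r-x = realise-from k<n τ∈ n≤w (snoc σ x b) (snoc-injective σ x b x-inj b∉x) b-ext tp-b
        in r , λ i → trans (cong (Realiser.elems r) (inject≤-inject₁ i)) (trans (r-x (inject₁ i)) (snoc-inject₁ σ x b i))
        where
        k≤n : k ≤ n
        k≤n = ≤‴⇒≤ (≤‴-step k<n)
        sk≤n : suc k ≤ n
        sk≤n = ≤‴⇒≤ k<n
        inject≤-inject₁ : ∀ i → inject≤ i k≤n ≡ inject≤ (inject₁ i) sk≤n
        inject≤-inject₁ i = Fin.toℕ-injective (trans (Fin.toℕ-inject≤ i k≤n)
          (trans (sym (Fin.toℕ-inject₁ i)) (sym (Fin.toℕ-inject≤ (inject₁ i) sk≤n))))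
        τ₁∈ : _∈ᵗ_ σ (restrict σ τ (λ i → inject≤ i k≤n)) (τs k)
        τ₁∈ = closed n k n≤w τ τ∈ _ (Fin.inject≤-injective k≤n k≤n _ _)
        τ₂∈ : _∈ᵗ_ σ (restrict σ τ (λ i → inject≤ i sk≤n)) (τs (suc k))
        τ₂∈ = closed n (suc k) n≤w τ τ∈ _ (Fin.inject≤-injective sk≤n sk≤n _ _)
        τ₁⊆τ₂ : _⊆ᵗ_ σ (restrict σ τ (λ i → inject≤ i k≤n)) (restrict σ τ (λ i → inject≤ i sk≤n))
        τ₁⊆τ₂ a = trans (restrict-∘ σ τ _ inject₁ a) (restrict-cong σ τ (sym ∘ inject≤-inject₁) a)

      realise : ∀ {n} {τ : KType σ n} → _∈ᵗ_ σ τ (τs n) → n ≤ wd σ → Realiser τ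
      realise {n} {τ} τ∈ n≤w =
        proj₁ (realise-from (ℕ.≤⇒≤‴ z≤n) τ∈ n≤w (λ ()) (λ { {()} }) extendable-[]
                (proj₂ consistent _ _ (proj₁ (guarded (λ ()) (λ { {()} }) (inj₁ z≤n)))
                                       (closed n 0 n≤w τ τ∈ _ (λ { {()} }))))

    module Transport (closed : Closed σ τs) (consistent : Consistent σ τs)
                     {A B : Set} {𝔄 : Structure σ A} {𝔅 : Structure σ B}
                     (adm𝔄 : Admissible 𝔄) (adm𝔅 : Admissible 𝔅) where
      private
        module A = Admissible adm𝔄
        module B = Admissible adm𝔅
      open Realisation closed consistent adm𝔅

      transport : ∀ {m} (α : FAtom σ m) → (∀ i → OccursA σ i α) → ∀ {ρA} → SatA σ 𝔄 α ρA →
                  Σ[ ρB ∈ (Fin m → B ⊎ Fin nC) ] (∀ ψ → SatQF σ 𝔄 ψ ρA ⇔ SatQF σ 𝔅 ψ ρB)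
      transport α occ {ρA} sat = (λ i → map₁ r.elems (G.term i (occ i))) , λ ψ → satQF⇔ ψ _
        where
        module G = Guard (guard σ 𝔄 A._≟_ α sat)
        module r = Realiser (realise (proj₁ (A.guarded G.elems G.elems-injective G.guarded)) G.size≤wd)
        open Agreement σ 𝔄 𝔅 G.elems-injective r.elems-injective (sym ∘ r.realises)
                       {V = λ _ → ⊤} (λ i _ → G.term i (occ i)) (λ i _ → G.term-sound i (occ i)) (λ _ _ → refl)

    module Transfer (closed : Closed σ τs) (consistent : Consistent σ τs)
                    {A B : Set} {𝔄 : Structure σ A} {𝔅 : Structure σ B}
                    (adm𝔄 : Admissible 𝔄) (adm𝔅 : Admissible 𝔅) where
      private
        module A = Admissible adm𝔄
        module B = Admissible adm𝔅
        module Realise𝔄 = Realisation closed consistent adm𝔄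
        module Realise𝔅 = Realisation closed consistent adm𝔅
        module 𝔄⇒𝔅 = Transport closed consistent adm𝔄 adm𝔅
        module 𝔅⇒𝔄 = Transport closed consistent adm𝔅 adm𝔄

      record Amalgam {k k₂} (d : Fin k → A) (e : Fin k → B) (d₂ : Fin k₂ → B) : Set where
        field
          elems           : Fin k₂ → A
          elems-injective : Injective _≡_ _≡_ elems
          same-type       : tp σ 𝔄 elems ≗ tp σ 𝔅 d₂
          agrees          : ∀ j l → e j ≡ d₂ l → d j ≡ elems l

      amalgamate : ∀ {k k₂} {d : Fin k → A} {e : Fin k → B} {d₂ : Fin k₂ → B} →
                   Injective _≡_ _≡_ d → A.Extendable d → Injective _≡_ _≡_ e → tp σ 𝔅 e ≗ tp σ 𝔄 d →
                   Injective _≡_ _≡_ d₂ → _∈ᵗ_ σ (tp σ 𝔅 d₂) (τs k₂) → k₂ ≤ wd σ → Amalgam d e d₂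
      amalgamate {k} {k₂} {d} {e} {d₂} d-inj d-ext e-inj e≗d d₂-inj d₂∈ k₂≤w = record
        { elems = c ; elems-injective = c-injective ; same-type = c-type ; agrees = c-agrees }
        where
        open Rearrangement (rearrangement (λ l → Fin.any? (λ j → e j B.≟ d₂ l)))
        πX : Fin n₁ → Fin k
        πX a = proj₁ (Q-first a)
        e-πX : ∀ a → e (πX a) ≡ d₂ (π (a ↑ˡ n₂))
        e-πX a = proj₂ (Q-first a)
        πX-injective : Injective _≡_ _≡_ πX
        πX-injective {a} {b} eq =
          Fin.↑ˡ-injective n₂ a b (π-injective (d₂-inj (trans (sym (e-πX a)) (trans (cong e eq) (e-πX b)))))
        n₁≤n : n₁ ≤ n₁ + n₂
        n₁≤n = ℕ.m≤m+n n₁ n₂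
        inject≤≡↑ˡ : ∀ a → inject≤ a n₁≤n ≡ a ↑ˡ n₂
        inject≤≡↑ˡ a = Fin.toℕ-injective (trans (Fin.toℕ-inject≤ a n₁≤n) (sym (Fin.toℕ-↑ˡ a n₂)))
        d′∈ : _∈ᵗ_ σ (tp σ 𝔅 (d₂ ∘ π)) (τs (n₁ + n₂))
        d′∈ = ∈ᵗ-resp-≗ σ (sym ∘ tp-reindex σ 𝔅 π (λ _ → refl)) (closed k₂ _ k₂≤w _ d₂∈ π π-injective)
        tp-x : tp σ 𝔄 (d ∘ πX) ≗ restrict σ (tp σ 𝔅 (d₂ ∘ π)) (λ a → inject≤ a n₁≤n)
        tp-x a = begin
          tp σ 𝔄 (d ∘ πX) a               ≡⟨ tp-reindex σ 𝔄 πX (λ _ → refl) a ⟩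
          restrict σ (tp σ 𝔄 d) πX a     ≡⟨ e≗d _ ⟨
          restrict σ (tp σ 𝔅 e) πX a     ≡⟨ tp-reindex σ 𝔅 πX (λ _ → refl) a ⟨
          tp σ 𝔅 (e ∘ πX) a               ≡⟨ tp-reindex σ 𝔅 _ (λ a → trans (e-πX a) (cong (d₂ ∘ π) (sym (inject≤≡↑ˡ a)))) a ⟩
          restrict σ (tp σ 𝔅 (d₂ ∘ π)) (λ a → inject≤ a n₁≤n) a  ∎
          where open ≡-Reasoning
        realisation : Σ[ r ∈ Realise𝔄.Realiser (tp σ 𝔅 (d₂ ∘ π)) ]
                        (∀ a → Realise𝔄.Realiser.elems r (inject≤ a n₁≤n) ≡ d (πX a))
        realisation = Realise𝔄.realise-from (ℕ.≤⇒≤‴ n₁≤n) d′∈ (ℕ.≤-trans (Fin.injective⇒≤ π-injective) k₂≤w)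
                        (d ∘ πX) (πX-injective ∘ d-inj) (A.extendable-∘ πX πX-injective d-ext) tp-x
        module r = Realise𝔄.Realiser (proj₁ realisation)
        c : Fin k₂ → A
        c = r.elems ∘ π⁻¹
        c-injective : Injective _≡_ _≡_ c
        c-injective {l} {l′} eq = trans (sym (π-π⁻¹ l)) (trans (cong π (r.elems-injective eq)) (π-π⁻¹ l′))
        c-type : tp σ 𝔄 c ≗ tp σ 𝔅 d₂
        c-type a = trans (tp-reindex σ 𝔄 π⁻¹ (λ _ → refl) a)
                   (trans (r.realises _) (sym (tp-reindex σ 𝔅 π⁻¹ (λ l → cong d₂ (sym (π-π⁻¹ l))) a)))
        c-agrees : ∀ j l → e j ≡ d₂ l → d j ≡ c l
        c-agrees j l ej≡d₂l with π⁻¹-Q l (j , ej≡d₂l)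
        ... | a , π⁻¹l≡ = begin
          d j                        ≡⟨ cong d (e-inj (trans ej≡d₂l (trans (cong d₂ (sym (π-π⁻¹ l)))
                                         (trans (cong (d₂ ∘ π) π⁻¹l≡) (sym (e-πX a)))))) ⟩
          d (πX a)                   ≡⟨ proj₂ realisation a ⟨
          r.elems (inject≤ a n₁≤n)   ≡⟨ cong r.elems (trans (inject≤≡↑ˡ a) (sym π⁻¹l≡)) ⟩
          c l                        ∎
          where open ≡-Reasoning

      transfer-allC : ∀ {n} α occ ψ → SatC σ 𝔅 (allC n α occ ψ) → SatC σ 𝔄 (allC n α occ ψ)
      transfer-allC α occ ψ hyp ρA satα =
        let ρB , ρA⇔ρB = 𝔄⇒𝔅.transport α occ satα
        in Equivalence.from (ρA⇔ρB ψ) (hyp ρB (Equivalence.to (ρA⇔ρB (atomQ α)) satα))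

      transfer-exC : ∀ {n} α occ ψ → SatC σ 𝔅 (exC n α occ ψ) → SatC σ 𝔄 (exC n α occ ψ)
      transfer-exC α occ ψ (ρB , satα , satψ) =
        let ρA , ρB⇔ρA = 𝔅⇒𝔄.transport α occ satα
        in ρA , Equivalence.to (ρB⇔ρA (atomQ α)) satα , Equivalence.to (ρB⇔ρA ψ) satψ

      lift-witness : ∀ {n m k} {d : Fin k → A} {e : Fin k → B} →
                     Injective _≡_ _≡_ d → A.Extendable d → Injective _≡_ _≡_ e → tp σ 𝔅 e ≗ tp σ 𝔄 d →
                     (g : Fin n → Fin k ⊎ Fin nC) {ρA : Fin n → A ⊎ Fin nC} {ρB : Fin n → B ⊎ Fin nC} →
                     (∀ i → ρA i ≡ map₁ d (g i)) → (∀ i → ρB i ≡ map₁ e (g i)) →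
                     (β : FAtom σ (n + m)) → (∀ j → OccursA σ (n ↑ʳ j) β) →
                     (ψ : QF σ (n + m)) → (∀ i → FreeIn σ i ψ → OccursA σ i β) →
                     (ρ′B : Fin m → B ⊎ Fin nC) →
                     SatA σ 𝔅 β (combine σ 𝔅 ρB ρ′B) → SatQF σ 𝔅 ψ (combine σ 𝔅 ρB ρ′B) →
                     Σ[ ρ′A ∈ (Fin m → A ⊎ Fin nC) ]
                       (SatA σ 𝔄 β (combine σ 𝔄 ρA ρ′A) × SatQF σ 𝔄 ψ (combine σ 𝔄 ρA ρ′A))
      lift-witness {n} {m} {k} {d} {e} d-inj d-ext e-inj e≗d g {ρA} {ρB} ρA≡ ρB≡ β occβ ψ fvψ ρ′B satβ satψ =
        ρ′A , Equivalence.to (satA⇔ β (λ _ p → p)) satβ , Equivalence.to (satQF⇔ ψ fvψ) satψ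
        where
        module H = Guard (guard σ 𝔅 B._≟_ β satβ)
        module c = Amalgam (amalgamate d-inj d-ext e-inj e≗d H.elems-injective
                                       (proj₁ (B.guarded H.elems H.elems-injective H.guarded)) H.size≤wd)
        ρ′A : Fin m → A ⊎ Fin nC
        ρ′A j = map₁ c.elems (H.term (n ↑ʳ j) (occβ j))
        lift : ∀ (x : Fin k ⊎ Fin nC) (y : Fin H.size ⊎ Fin nC) → map₁ e x ≡ map₁ H.elems y → map₁ d x ≡ map₁ c.elems y
        lift (inj₁ j) (inj₁ l) eq = cong inj₁ (c.agrees j l (Sum.inj₁-injective eq))
        lift (inj₂ κ) (inj₂ .κ) refl = refl
        H-term-cong : ∀ {i i′} → i ≡ i′ → ∀ p q → H.term i p ≡ H.term i′ q
        H-term-cong refl = H.term-irrelevant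
        combine≡ : ∀ i p → combine σ 𝔄 ρA ρ′A i ≡ map₁ c.elems (H.term i p)
        combine≡ i p = ⊎-elim-≡ [ ρA , ρ′A ] (splitAt n i)
          (λ i₀ split≡ → trans (ρA≡ i₀) (lift (g i₀) (H.term i p) (trans (sym (ρB≡ i₀))
                          (trans (cong [ ρB , ρ′B ] (sym split≡)) (H.term-sound i p)))))
          (λ j split≡ → cong (map₁ c.elems) (H-term-cong (Fin.splitAt⁻¹-↑ʳ split≡) (occβ j) p))
        open Agreement σ 𝔅 𝔄 {n = H.size} {m = n + m} {eA = H.elems} {eB = c.elems}
                       H.elems-injective c.elems-injective (λ a → sym (c.same-type a))
                       {V = λ i → OccursA σ i β} H.term {ρA = combine σ 𝔅 ρB ρ′B} {ρB = combine σ 𝔄 ρA ρ′A}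
                       H.term-sound combine≡

      transfer-allExC : ∀ {n m} α occα β occβ ψ fvψ →
                        SatC σ 𝔅 (allExC n m α occα β occβ ψ fvψ) → SatC σ 𝔄 (allExC n m α occα β occβ ψ fvψ)
      transfer-allExC {n} α occα β occβ ψ fvψ hyp ρA satα =
        let ρ′B , satβ , satψ = hyp ρB (Equivalence.to (satA⇔ α (λ _ _ → _)) satα)
        in lift-witness G.elems-injective (proj₂ G∈) r.elems-injective r.realises g
                        (λ i → G.term-sound i (occα i)) (λ _ → refl) β occβ ψ fvψ ρ′B satβ satψ
        where
        module G = Guard (guard σ 𝔄 A._≟_ α satα)
        G∈ : _∈ᵗ_ σ (tp σ 𝔄 G.elems) (τs G.size) × A.Extendable G.elems
        G∈ = A.guarded G.elems G.elems-injective G.guarded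
        module r = Realise𝔅.Realiser (Realise𝔅.realise (proj₁ G∈) G.size≤wd)
        g : Fin n → Fin G.size ⊎ Fin nC
        g i = G.term i (occα i)
        ρB : Fin n → B ⊎ Fin nC
        ρB = map₁ r.elems ∘ g
        open Agreement σ 𝔄 𝔅 G.elems-injective r.elems-injective (sym ∘ r.realises)
                       {V = λ _ → ⊤} (λ i _ → g i) (λ i _ → G.term-sound i (occα i)) (λ _ _ → refl)

      transfer : ∀ φ → Models σ 𝔅 φ → Models σ 𝔄 φ
      transfer φ = All.map transfer-conjunct
        where
        transfer-conjunct : ∀ {C} → SatC σ 𝔅 C → SatC σ 𝔄 C
        transfer-conjunct {exC n α occ ψ}                 = transfer-exC α occ ψ
        transfer-conjunct {allC n α occ ψ}                = transfer-allC α occ ψ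
        transfer-conjunct {allExC n m α occα β occβ ψ fv} = transfer-allExC α occα β occβ ψ fv

module FreeStructure (σ : Signature) (τs : TypeFamily σ) (closed : Closed σ τs) (consistent : Consistent σ τs) where
  open import Data.List.Membership.Propositional using () renaming (_∈_ to _∈ₗ_)
  open import Data.Bool using (Bool; true; false; T; _∧_)
  open import Data.Bool.Properties using (T-∧; T-irrelevant)
  open import Data.Empty using (⊥-elim)
  open import Data.Fin using (Fin; inject₁; fromℕ)
  import Data.Fin as Fin
  import Data.Fin.Properties as Fin
  open import Data.Fin.Relation.Unary.Top using (view; ‵fromℕ; ‵inject₁)
  open import Data.List using (List; []; _∷_; head)
  import Data.List.Relation.Unary.Any as Any
  open import Data.Maybe using (Maybe; just; nothing)
  open import Data.Maybe.Properties using (just-injective)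
  open import Data.List.Relation.Unary.Any.Properties using (lookup-index)
  import Data.Maybe as Maybe
  import Data.Maybe.Relation.Unary.Any as MaybeAny
  open import Data.Nat using (ℕ; zero; suc; _+_; _≤_; _<_; _≤?_; s≤s)
  import Data.Nat.Properties as ℕ
  open import Data.Product using (Σ-syntax; Σ; _×_; _,_; proj₁; proj₂)
  open import Data.Sum using (_⊎_; inj₁; inj₂; [_,_]; map₁)
  open import Data.Unit using (⊤; tt)
  open import Data.Vec using (Vec; []; _∷_; toList; lookup; tabulate)
  import Data.Vec as Vec
  import Data.Vec.Properties as Vec
  open import Data.Vec.Relation.Unary.Any using (here; there; index)
  import Data.Vec.Relation.Unary.Any.Properties as VAny
  open import Data.Vec.Relation.Unary.All using (All; []; _∷_)
  import Data.Vec.Relation.Unary.All as All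
  open import Data.Vec.Membership.Propositional using (_∈_)
  open import Data.Vec.Membership.Propositional.Properties using (∈-map⁺; ∈-toList⁺; ∈-toList⁻; ∈-lookup)
  import Data.Vec.Membership.DecPropositional as VecDec
  open import Function using (_∘_; Equivalence)
  open import Function.Definitions using (Injective)
  open import Relation.Binary.Definitions using (DecidableEquality)
  open import Relation.Binary.PropositionalEquality hiding ([_])
  open import Relation.Nullary using (¬_; Dec; yes; no; does; _×-dec_; _→-dec_)
  open import Relation.Nullary.Decidable using (map′)

  open TypeLemmas
  open Admissibility
  open Signature σ

  -- node k ch j is a formal new element that, together with the tuple ch of earlier elements,
  -- realises the j-th type of τs (suc k); it is an element of ℭ when valid, i.e. when that type
  -- extends the type of ch.  A fact is decided by the unique element of it whose family
  -- (its children and itself) contains all elements of the fact.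
  data Node : Set where
    node : (k : ℕ) → Vec Node k → ℕ → Node

  arity : Node → ℕ
  arity (node k _ _) = k

  children : (b : Node) → Vec Node (arity b)
  children (node _ ch _) = ch

  typeIndex : Node → ℕ
  typeIndex (node _ _ j) = j

  mutual
    _≟ᴺ_ : DecidableEquality Node
    node k ch j ≟ᴺ node k′ ch′ j′ with k ℕ.≟ k′
    ... | no k≢k′ = no λ { refl → k≢k′ refl }
    ... | yes refl with ch ≟ⱽ ch′ | j ℕ.≟ j′
    ... | yes refl | yes refl = yes refl
    ... | no ch≢ch′ | _       = no λ { refl → ch≢ch′ refl }
    ... | yes _    | no j≢j′  = no λ { refl → j≢j′ refl }

    _≟ⱽ_ : ∀ {k} → DecidableEquality (Vec Node k)
    []       ≟ⱽ []         = yes refl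
    (x ∷ xs) ≟ⱽ (y ∷ ys) with x ≟ᴺ y | xs ≟ⱽ ys
    ... | yes refl | yes refl = yes refl
    ... | no x≢y   | _        = no λ { refl → x≢y refl }
    ... | yes _    | no xs≢ys = no λ { refl → xs≢ys refl }

  mutual
    size : Node → ℕ
    size (node _ ch _) = suc (sizes ch)

    sizes : ∀ {k} → Vec Node k → ℕ
    sizes []       = 0
    sizes (x ∷ xs) = size x + sizes xs

  child< : ∀ {x} b → x ∈ children b → size x < size b
  child< (node _ ch _) x∈ = s≤s (go x∈)
    where
    go : ∀ {k x} {xs : Vec Node k} → x ∈ xs → size x ≤ sizes xs
    go (here refl)        = ℕ.m≤m+n _ _
    go {xs = y ∷ _} (there x∈) = ℕ.≤-trans (go x∈) (ℕ.m≤n+m _ (size y))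

  Term′ : Set
  Term′ = Node ⊎ Fin nC

  Covers : Node → Term′ → Set
  Covers b (inj₁ x) = x ≡ b ⊎ x ∈ children b
  Covers b (inj₂ _) = ⊤

  covers? : ∀ b t → Dec (Covers b t)
  covers? b (inj₁ x) with x ≟ᴺ b | x ∈? children b
    where open import Data.Vec.Membership.DecPropositional _≟ᴺ_ using (_∈?_)
  ... | yes x≡b | _      = yes (inj₁ x≡b)
  ... | no _    | yes x∈ = yes (inj₂ x∈)
  ... | no x≢b  | no x∉  = no [ x≢b , x∉ ]
  covers? b (inj₂ _) = yes tt

  Claims : ∀ {l} → Node → Vec Term′ l → Set
  Claims b = All (Covers b)

  claimant-unique : ∀ {l} {v : Vec Term′ l} b b′ → Claims b v → Claims b′ v →
                    inj₁ b ∈ v → inj₁ b′ ∈ v → b ≡ b′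
  claimant-unique b b′ b-claims b′-claims b∈ b′∈ with All.lookup b-claims b′∈ | All.lookup b′-claims b∈
  ... | inj₁ b′≡b | _         = sym b′≡b
  ... | inj₂ _    | inj₁ b≡b′ = b≡b′
  ... | inj₂ b′<b | inj₂ b<b′ = ⊥-elim (ℕ.<-asym (child< b b′<b) (child< b′ b<b′))

  firstClaimant : ∀ {l} → Vec Term′ l → List Term′ → Maybe Node
  firstClaimant v []            = nothing
  firstClaimant v (inj₂ _ ∷ ts) = firstClaimant v ts
  firstClaimant v (inj₁ b ∷ ts) with All.all? (covers? b) v
  ... | yes _ = just b
  ... | no _  = firstClaimant v ts

  claimant : ∀ {l} → Vec Term′ l → Maybe Node
  claimant v = firstClaimant v (toList v)

  claimant-sound : ∀ {l} (v : Vec Term′ l) {b} → claimant v ≡ just b → Claims b v × inj₁ b ∈ v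
  claimant-sound v = go (toList v) ∈-toList⁻
    where
    go : ∀ ts → (∀ {t} → t ∈ₗ ts → t ∈ v) → ∀ {b} → firstClaimant v ts ≡ just b → Claims b v × inj₁ b ∈ v
    go (inj₂ _ ∷ ts) ⊆v eq = go ts (⊆v ∘ Any.there) eq
    go (inj₁ b ∷ ts) ⊆v eq with All.all? (covers? b) v
    go (inj₁ b ∷ ts) ⊆v refl | yes b-claims = b-claims , ⊆v (Any.here refl)
    go (inj₁ b ∷ ts) ⊆v eq   | no _         = go ts (⊆v ∘ Any.there) eq

  claimant-none : ∀ {l} (v : Vec Term′ l) → (∀ b → ¬ inj₁ b ∈ v) → claimant v ≡ nothing
  claimant-none v no-node = go (toList v) ∈-toList⁻
    where
    go : ∀ ts → (∀ {t} → t ∈ₗ ts → t ∈ v) → firstClaimant v ts ≡ nothing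
    go []            ⊆v = refl
    go (inj₂ _ ∷ ts) ⊆v = go ts (⊆v ∘ Any.there)
    go (inj₁ b ∷ ts) ⊆v = ⊥-elim (no-node b (⊆v (Any.here refl)))

  claimant-complete : ∀ {l} (v : Vec Term′ l) {b} → Claims b v → inj₁ b ∈ v → claimant v ≡ just b
  claimant-complete v {b} b-claims b∈ = go (toList v) (∈-toList⁺ b∈) ∈-toList⁻
    where
    go : ∀ ts → inj₁ b ∈ₗ ts → (∀ {t} → t ∈ₗ ts → t ∈ v) → firstClaimant v ts ≡ just b
    go (inj₂ _ ∷ ts)  (Any.there b∈ts) ⊆v = go ts b∈ts (⊆v ∘ Any.there)
    go (inj₁ b′ ∷ ts) b∈ts ⊆v with All.all? (covers? b′) v
    ... | yes b′-claims = cong just (claimant-unique b′ b b′-claims b-claims (⊆v (Any.here refl)) b∈)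
    go (inj₁ b′ ∷ ts) (Any.here refl)  ⊆v | no ¬b-claims = ⊥-elim (¬b-claims b-claims)
    go (inj₁ b′ ∷ ts) (Any.there b∈ts) ⊆v | no _         = go ts b∈ts (⊆v ∘ Any.there)

  pullᴺ : ∀ {l r} → Vec Node l → Vec Term′ r → Maybe (Vec (Fin l ⊎ Fin nC) r)
  pullᴺ t []           = just []
  pullᴺ t (inj₂ c ∷ v) = Maybe.map (inj₂ c ∷_) (pullᴺ t v)
  pullᴺ t (inj₁ x ∷ v) with Fin.any? (λ i → lookup t i ≟ᴺ x)
  ... | yes (i , _) = Maybe.map (inj₁ i ∷_) (pullᴺ t v)
  ... | no _        = nothing

  pullᴺ-map : ∀ {l r} (t : Vec Node l) → Injective _≡_ _≡_ (lookup t) → (s : Vec (Fin l ⊎ Fin nC) r) →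
              pullᴺ t (Vec.map (map₁ (lookup t)) s) ≡ just s
  pullᴺ-map t t-inj []           = refl
  pullᴺ-map t t-inj (inj₂ c ∷ s) = cong (Maybe.map (inj₂ c ∷_)) (pullᴺ-map t t-inj s)
  pullᴺ-map t t-inj (inj₁ i ∷ s) with Fin.any? (λ i′ → lookup t i′ ≟ᴺ lookup t i)
  ... | yes (i′ , eq) rewrite t-inj eq = cong (Maybe.map (inj₁ i ∷_)) (pullᴺ-map t t-inj s)
  ... | no ∄i′                        = ⊥-elim (∄i′ (i , refl))

  pullᴺ-[] : ∀ {r} (v : Vec Term′ r) {x} → inj₁ x ∈ v → pullᴺ [] v ≡ nothing
  pullᴺ-[] (inj₁ _ ∷ v) (here refl) = refl
  pullᴺ-[] (inj₁ _ ∷ v) (there x∈) = refl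
  pullᴺ-[] (inj₂ c ∷ v) (there x∈) = cong (Maybe.map (inj₂ c ∷_)) (pullᴺ-[] v x∈)

  typeOf : (b : Node) → Maybe (KType σ (suc (arity b)))
  typeOf b = lookupM σ (τs (suc (arity b))) (typeIndex b)

  family : (b : Node) → Vec Node (suc (arity b))
  family b = tabulate (snoc σ (lookup (children b)) b)

  holds : ∀ {l} (R : Fin nR) → Maybe (KType σ l) → Maybe (Vec (Fin l ⊎ Fin nC) (ar R)) → Bool
  holds R (just τ) (just s) = τ (R , s)
  holds R _        _        = false

  factBy : (R : Fin nR) → Vec Term′ (ar R) → Maybe Node → Bool
  factBy R v (just b) = holds R (typeOf b) (pullᴺ (family b) v)
  factBy R v nothing  = holds R (head (τs 0)) (pullᴺ [] v)

  fact : (R : Fin nR) → Vec Term′ (ar R) → Bool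
  fact R v = factBy R v (claimant v)

  typeRaw : ∀ {k} → Vec Node k → KType σ k
  typeRaw ch (R , s) = fact R (Vec.map (map₁ (lookup ch)) s)

  WellFormed : Node → Set
  WellFormed b = Injective _≡_ _≡_ (lookup (children b)) × suc (arity b) ≤ wd σ ×
                 MaybeAny.Any (λ τ → restrict σ τ inject₁ ≗ typeRaw (children b)) (typeOf b)

  wellFormed? : ∀ b → Dec (WellFormed b)
  wellFormed? b = injective? ×-dec (suc (arity b) ≤? wd σ) ×-dec
                  MaybeAny.dec (λ τ → _≟ᵗ_ σ (restrict σ τ inject₁) (typeRaw (children b))) (typeOf b)
    where
    injective? : Dec (Injective _≡_ _≡_ (lookup (children b)))
    injective? = map′ (λ inj {i} {j} → inj i j) (λ inj i j → inj)
      (Fin.all? λ i → Fin.all? λ j → (lookup (children b) i ≟ᴺ lookup (children b) j) →-dec (i Fin.≟ j))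

  mutual
    valid : Node → Bool
    valid b@(node _ ch _) = allValid ch ∧ does (wellFormed? b)

    allValid : ∀ {k} → Vec Node k → Bool
    allValid []       = true
    allValid (x ∷ xs) = valid x ∧ allValid xs

  El : Set
  El = Σ Node (T ∘ valid)

  El-≡ : ∀ {x y : El} → proj₁ x ≡ proj₁ y → x ≡ y
  El-≡ {b , p} {.b , q} refl = cong (b ,_) (T-irrelevant p q)

  _≟ᴱ_ : DecidableEquality El
  x ≟ᴱ y = map′ El-≡ (cong proj₁) (proj₁ x ≟ᴺ proj₁ y)

  ℭ : Structure σ El
  Structure.rel ℭ R v = fact R (Vec.map (map₁ proj₁) v)

  allValid⇔ : ∀ {k} (ch : Vec Node k) → T (allValid ch) Function.⇔ (∀ i → T (valid (lookup ch i)))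
  allValid⇔ ch = Function.mk⇔ (to ch) (from ch)
    where
    to : ∀ {k} (ch : Vec Node k) → T (allValid ch) → ∀ i → T (valid (lookup ch i))
    to (x ∷ ch) v Fin.zero    = proj₁ (Equivalence.to T-∧ v)
    to (x ∷ ch) v (Fin.suc i) = to ch (proj₂ (Equivalence.to (T-∧ {valid x}) v)) i
    from : ∀ {k} (ch : Vec Node k) → (∀ i → T (valid (lookup ch i))) → T (allValid ch)
    from []       _ = _
    from (x ∷ ch) v = Equivalence.from T-∧ (v Fin.zero , from ch (v ∘ Fin.suc))

  valid⇔ : ∀ b → T (valid b) Function.⇔ ((∀ i → T (valid (lookup (children b) i))) × WellFormed b)
  valid⇔ b@(node _ ch _) = Function.mk⇔
    (λ v → let vs , wf = Equivalence.to T-∧ v in Equivalence.to (allValid⇔ ch) vs , does-sound (wellFormed? b) wf)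
    (λ (vs , wf) → Equivalence.from T-∧ (Equivalence.from (allValid⇔ ch) vs , does-complete (wellFormed? b) wf))

  record Valid (b : Node) : Set where
    field
      children-valid   : ∀ i → T (valid (lookup (children b) i))
      children-inj     : Injective _≡_ _≡_ (lookup (children b))
      arity<wd         : suc (arity b) ≤ wd σ
      type             : KType σ (suc (arity b))
      typeOf≡          : typeOf b ≡ just type
      type-children    : restrict σ type inject₁ ≗ typeRaw (children b)

    type∈ : _∈ᵗ_ σ type (τs (suc (arity b)))
    type∈ = Any.map (λ { refl _ → refl }) (lookupM-∈ σ (τs (suc (arity b))) typeOf≡)

  toValid : ∀ {b} → T (valid b) → Valid b
  toValid {b} v with Equivalence.to (valid⇔ b) v
  ... | vs , ch-inj , a<w , type-ok with typeOf b in eq | type-ok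
  ... | just τ | MaybeAny.just τ-ok = record
    { children-valid = vs ; children-inj = ch-inj ; arity<wd = a<w ; type = τ ; typeOf≡ = eq ; type-children = τ-ok }

  module _ {b : Node} (b-valid : T (valid b)) where
    private
      module V = Valid (toValid {b} b-valid)
      ch = children b

    lookup-family : lookup (family b) ≗ snoc σ (lookup ch) b
    lookup-family = Vec.lookup∘tabulate _

    family-injective : Injective _≡_ _≡_ (lookup (family b))
    family-injective {i} {j} eq =
      snoc-injective σ (lookup ch) b V.children-inj b∉ch
        (trans (sym (lookup-family i)) (trans eq (lookup-family j)))
      where
      b∉ch : ∀ i → b ≢ lookup ch i
      b∉ch i b≡ = ℕ.<-irrefl refl (child< b (subst (_∈ ch) (sym b≡) (∈-lookup i ch)))

    family-inject₁ : ∀ i → lookup (family b) (inject₁ i) ≡ lookup ch i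
    family-inject₁ i = trans (lookup-family (inject₁ i)) (snoc-inject₁ σ (lookup ch) b i)

    family-claims : ∀ {r} (s : Vec (Fin (suc (arity b)) ⊎ Fin nC) r) → Claims b (Vec.map (map₁ (lookup (family b))) s)
    family-claims []            = []
    family-claims (inj₂ _ ∷ s) = tt ∷ family-claims s
    family-claims (inj₁ i ∷ s) = covers i ∷ family-claims s
      where
      covers : ∀ i → Covers b (inj₁ (lookup (family b) i))
      covers i with view i
      ... | ‵inject₁ j = inj₂ (subst (_∈ ch) (sym (family-inject₁ j)) (∈-lookup j ch))
      ... | ‵fromℕ     = inj₁ (trans (lookup-family (fromℕ (arity b))) (snoc-last σ (lookup ch) b))

    fact-family : ∀ R (s : Vec (Fin (suc (arity b)) ⊎ Fin nC) (ar R)) →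
                  fact R (Vec.map (map₁ (lookup (family b))) s) ≡ V.type (R , s)
    fact-family R s with VecDec._∈?_ (decTerm σ) (inj₁ (fromℕ (arity b))) s
    ... | yes last∈ = begin
      factBy R v (claimant v)                ≡⟨ cong (factBy R v) (claimant-complete v (family-claims s) b∈v) ⟩
      holds R (typeOf b) (pullᴺ (family b) v) ≡⟨ cong₂ (holds R) V.typeOf≡ (pullᴺ-map (family b) family-injective s) ⟩
      V.type (R , s)                          ∎
      where
      open ≡-Reasoning
      v : Vec Term′ (ar R)
      v = Vec.map (map₁ (lookup (family b))) s
      b∈v : inj₁ b ∈ v
      b∈v = subst (λ x → inj₁ x ∈ v) (trans (lookup-family (fromℕ (arity b))) (snoc-last σ (lookup ch) b)) (∈-map⁺ _ last∈)
    ... | no last∉ with shape-without-last s last∉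
    ... | s′ , refl = begin
      fact R (Vec.map (map₁ (lookup (family b))) (Vec.map (map₁ inject₁) s′))
        ≡⟨ cong (fact R) (map-map₁ family-inject₁ s′) ⟩
      typeRaw ch (R , s′)                                   ≡⟨ V.type-children (R , s′) ⟨
      V.type (R , Vec.map (map₁ inject₁) s′)                ∎
      where open ≡-Reasoning

    childrenᴱ : Fin (arity b) → El
    childrenᴱ i = lookup ch i , V.children-valid i

    familyᴱ : Fin (suc (arity b)) → El
    familyᴱ = snoc σ childrenᴱ (b , b-valid)

    tp-familyᴱ : tp σ ℭ familyᴱ ≗ V.type
    tp-familyᴱ (R , s) = trans (cong (fact R) (map-map₁ proj₁-familyᴱ s)) (fact-family R s)
      where
      proj₁-familyᴱ : proj₁ ∘ familyᴱ ≗ lookup (family b)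
      proj₁-familyᴱ i = trans (snoc-map σ proj₁ childrenᴱ (b , b-valid) i) (sym (lookup-family i))

    covered-type∈ : ∀ {n} (ā : Fin n → El) → Injective _≡_ _≡_ ā → (∀ i → Covers b (inj₁ (proj₁ (ā i)))) →
                    _∈ᵗ_ σ (tp σ ℭ ā) (τs n)
    covered-type∈ ā ā-inj covered =
      ∈ᵗ-resp-≗ σ (λ a → sym (trans (tp-reindex σ ℭ π ā≡ a) (tp-familyᴱ _)))
        (closed _ _ V.arity<wd _ V.type∈ π (λ eq → ā-inj (trans (ā≡ _) (trans (cong familyᴱ eq) (sym (ā≡ _))))))
      where
      position : ∀ {x} → Covers b (inj₁ x) → Fin (suc (arity b))
      position (inj₁ _)  = fromℕ _
      position (inj₂ x∈) = inject₁ (index x∈)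
      familyᴱ-position : ∀ {x} (c : Covers b (inj₁ x)) → proj₁ (familyᴱ (position c)) ≡ x
      familyᴱ-position (inj₁ x≡b) = trans (cong proj₁ (snoc-last σ childrenᴱ (b , b-valid))) (sym x≡b)
      familyᴱ-position (inj₂ x∈)  =
        trans (cong proj₁ (snoc-inject₁ σ childrenᴱ (b , b-valid) (index x∈))) (sym (VAny.lookup-index x∈))
      π : Fin _ → Fin (suc (arity b))
      π i = position (covered i)
      ā≡ : ā ≗ familyᴱ ∘ π
      ā≡ i = El-≡ (sym (familyᴱ-position (covered i)))

  holds-nothing : ∀ {l} {R} {m : Maybe (KType σ l)} {x} → x ≡ holds R m nothing → x ≡ false
  holds-nothing {m = just _}  refl = refl
  holds-nothing {m = nothing} refl = refl

  image : ∀ {n r} → (Fin n → El) → Vec (Fin n ⊎ Fin nC) r → Vec Term′ r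
  image ā s = Vec.map (map₁ proj₁) (Vec.map (map₁ ā) s)

  occurs : ∀ {n} (ā : Fin n → El) {R} {s : Vec (Fin n ⊎ Fin nC) (ar R)} → isFull σ (R , s) ≡ true →
           ∀ i → inj₁ (proj₁ (ā i)) ∈ image ā s
  occurs ā full i = ∈-map⁺ (map₁ proj₁) (∈-map⁺ (map₁ ā) (Equivalence.to (isFull⇔ σ) full i))

  ℭ-guarded : ∀ {n} (ā : Fin n → El) → Injective _≡_ _≡_ ā → Guarded σ (tp σ ℭ ā) → _∈ᵗ_ σ (tp σ ℭ ā) (τs n)
  ℭ-guarded {zero} ā _ _ = ∈ᵗ-resp-≗ σ (sym ∘ tp≗τ₀) (proj₂ (proj₂ (initialType σ τs consistent)))
    where
    tp≗τ₀ : tp σ ℭ ā ≗ proj₁ (initialType σ τs consistent)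
    tp≗τ₀ (R , s) = begin
      fact R v                                   ≡⟨ cong (factBy R v) (claimant-none v no-node) ⟩
      holds R (head (τs 0)) (pullᴺ [] v)         ≡⟨ cong₂ (holds R) (proj₁ (proj₂ (initialType σ τs consistent)))
                                                             (trans (cong (pullᴺ []) v≡) (pullᴺ-map [] (λ { {()} }) s)) ⟩
      proj₁ (initialType σ τs consistent) (R , s)   ∎
      where
      open ≡-Reasoning
      v : Vec Term′ (ar R)
      v = image ā s
      v≡ : v ≡ Vec.map (map₁ (lookup [])) s
      v≡ = map-map₁ (λ ()) s
      no-node : ∀ b → ¬ inj₁ b ∈ v
      no-node b b∈ with ∈ᵥ-map⁻ _ (subst (inj₁ b ∈_) v≡ b∈)
      ... | inj₁ () , _
  ℭ-guarded {suc zero}    ā ā-inj (inj₁ _) = covered-type∈ (proj₂ (ā Fin.zero)) ā ā-inj λ { Fin.zero → inj₁ refl }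
  ℭ-guarded {suc (suc n)} ā ā-inj (inj₁ (s≤s ()))
  ℭ-guarded {suc n} ā ā-inj (inj₂ ((R , s) , full , holds-true)) with claimant (image ā s) in claimant≡
  ... | nothing = ⊥-elim (false≢true (trans (sym (holds-nothing {R = R} {m = head (τs 0)} (cong (holds R (head (τs 0)))
                                                  (pullᴺ-[] (image ā s) (occurs ā {R} {s} full Fin.zero))))) holds-true))
    where
    false≢true : false ≢ true
    false≢true ()
  ... | just b with claimant-sound (image ā s) claimant≡
  ... | claims , b∈v with ∈ᵥ-map⁻ (map₁ proj₁) b∈v
  ... | inj₁ x , x∈ , refl with ∈ᵥ-map⁻ (map₁ ā) x∈
  ... | inj₁ i₀ , _ , refl = covered-type∈ (proj₂ (ā i₀)) ā ā-inj (λ i → All.lookup claims (occurs ā {R} {s} full i))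

  ℭ-extend : ∀ {k} → suc k ≤ wd σ → ∀ {τ₁ τ₂} → _∈ᵗ_ σ τ₁ (τs k) → _∈ᵗ_ σ τ₂ (τs (suc k)) → _⊆ᵗ_ σ τ₁ τ₂ →
             (ā : Fin k → El) → Injective _≡_ _≡_ ā → tp σ ℭ ā ≗ τ₁ →
             Σ[ b ∈ El ] ((∀ i → b ≢ ā i) × tp σ ℭ (snoc σ ā b) ≗ τ₂)
  ℭ-extend {k} sk≤w {τ₁} {τ₂} _ τ₂∈ τ₁⊆τ₂ ā ā-inj tp-ā = (b , b-valid) , b∉ā , tp-snoc
    where
    j : Fin (Data.List.length (τs (suc k)))
    j = Any.index τ₂∈
    τ₂′ : KType σ (suc k)
    τ₂′ = Data.List.lookup (τs (suc k)) j
    τ₂≗τ₂′ : τ₂ ≗ τ₂′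
    τ₂≗τ₂′ = lookup-index τ₂∈
    ch : Vec Node k
    ch = tabulate (proj₁ ∘ ā)
    lookup-ch : lookup ch ≗ proj₁ ∘ ā
    lookup-ch = Vec.lookup∘tabulate _
    b : Node
    b = node k ch (Fin.toℕ j)
    type-children : restrict σ τ₂′ inject₁ ≗ typeRaw ch
    type-children (R , s) = begin
      τ₂′ (R , Vec.map (map₁ inject₁) s)   ≡⟨ τ₂≗τ₂′ _ ⟨
      τ₂ (R , Vec.map (map₁ inject₁) s)    ≡⟨ τ₁⊆τ₂ (R , s) ⟩
      τ₁ (R , s)                           ≡⟨ tp-ā (R , s) ⟨
      tp σ ℭ ā (R , s)                     ≡⟨ cong (fact R) (map-map₁ (sym ∘ lookup-ch) s) ⟩
      typeRaw ch (R , s)                   ∎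
      where open ≡-Reasoning
    b-valid : T (valid b)
    b-valid = Equivalence.from (valid⇔ b)
      ( (λ i → subst (T ∘ valid) (sym (lookup-ch i)) (proj₂ (ā i)))
      , (λ eq → ā-inj (El-≡ (trans (sym (lookup-ch _)) (trans eq (lookup-ch _)))))
      , sk≤w
      , subst (MaybeAny.Any _) (sym (lookupM-lookup σ (τs (suc k)) j)) (MaybeAny.just type-children) )
    b∉ā : ∀ i → (b , b-valid) ≢ ā i
    b∉ā i eq = ℕ.<-irrefl refl (child< b (subst (_∈ ch) (trans (lookup-ch i) (cong proj₁ (sym eq))) (∈-lookup i ch)))
    tp-snoc : tp σ ℭ (snoc σ ā (b , b-valid)) ≗ τ₂
    tp-snoc a = begin
      tp σ ℭ (snoc σ ā (b , b-valid)) a   ≡⟨ tp-cong σ ℭ (snoc-cong σ (b , b-valid) (λ i → El-≡ (sym (lookup-ch i)))) a ⟩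
      tp σ ℭ (familyᴱ b-valid) a          ≡⟨ tp-familyᴱ b-valid a ⟩
      Valid.type (toValid b-valid) a      ≡⟨ cong (λ τ → τ a) (just-injective (trans (sym (Valid.typeOf≡ (toValid b-valid)))
                                               (lookupM-lookup σ (τs (suc k)) j))) ⟩
      τ₂′ a                               ≡⟨ τ₂≗τ₂′ a ⟨
      τ₂ a                                ∎
      where open ≡-Reasoning

  ℭ-admissible : Admissible σ τs ℭ
  ℭ-admissible = record
    { _≟_ = _≟ᴱ_ ; Extendable = λ _ → ⊤ ; extendable-∘ = λ _ _ _ → tt ; extendable-[] = tt
    ; guarded = λ ā ā-inj g → ℭ-guarded ā ā-inj g , tt
    ; extend = λ sk≤w τ₁∈ τ₂∈ τ₁⊆τ₂ ā ā-inj _ tp-ā →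
        let b , b∉ā , tp-b = ℭ-extend sk≤w τ₁∈ τ₂∈ τ₁⊆τ₂ ā ā-inj tp-ā in b , b∉ā , tt , tp-b }

  ℭ-guardedBy : IsGuardedBy σ ℭ τs
  ℭ-guardedBy _ = ℭ-guarded

  ℭ-hasExtension : HasExtension σ ℭ τs
  ℭ-hasExtension _ sk≤w _ _ τ₁∈ τ₂∈ τ₁⊆τ₂ = ℭ-extend sk≤w τ₁∈ τ₂∈ τ₁⊆τ₂

module Arithmetic where

  open import Data.Nat
  open import Data.Nat.Properties
  open import Data.Nat.DivMod
  open import Data.Nat.Divisibility
  open import Data.Nat.Coprimality using (Coprime; coprime-Bézout; coprime-divisor)
  import Data.Nat.Coprimality as Coprime
  open import Data.Nat.GCD using (module Bézout)
  open import Data.Nat.Solver using (module +-*-Solver)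
  open import Data.Nat.ListAction using (sum; product)
  open import Data.List using (List; []; _∷_; map)
  import Data.List.Properties as List
  import Data.List.Relation.Unary.All.Properties as AllProps
  open import Function using (_∘_)
  open import Data.List.Relation.Unary.All as All using (All; []; _∷_)
  open import Data.List.Relation.Unary.AllPairs using (AllPairs; []; _∷_)
  open import Data.List.Membership.Propositional using (_∈_)
  open import Data.List.Membership.Propositional.Properties using (∈-map⁺)
  open import Data.List.Relation.Unary.Any using (here; there)
  open import Data.Product using (∃; _×_; _,_; proj₁; proj₂)
  open import Data.Empty using (⊥-elim)
  open import Relation.Binary.PropositionalEquality

  open +-*-Solver

  powerSum : List ℕ → ℕ
  powerSum xs = sum (map (2 ^_) xs)

  powerSum<2^ : ∀ {xs a B} → AllPairs _<_ xs → All (a ≤_) xs → All (_< B) xs → a ≤ B → powerSum xs + 2 ^ a ≤ 2 ^ B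
  powerSum<2^ {[]}     {a} {B} _ _ _ a≤B = ^-monoʳ-≤ 2 a≤B
  powerSum<2^ {x ∷ xs} {a} {B} (x<xs ∷ sorted) (a≤x ∷ _) (x<B ∷ xs<B) _ = begin
    (2 ^ x + powerSum xs) + 2 ^ a ≤⟨ +-monoʳ-≤ (2 ^ x + powerSum xs) (^-monoʳ-≤ 2 a≤x) ⟩
    (2 ^ x + powerSum xs) + 2 ^ x ≡⟨ solve 2 (λ P S → (P :+ S) :+ P := S :+ con 2 :* P) refl (2 ^ x) (powerSum xs) ⟩
    powerSum xs + 2 ^ suc x       ≤⟨ powerSum<2^ sorted (All.map (λ x<y → x<y) x<xs) xs<B x<B ⟩
    2 ^ B                         ∎
    where open ≤-Reasoning

  private
    2^[1+a]∣powerSum : ∀ a xs → All (a <_) xs → 2 ^ suc a ∣ powerSum xs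
    2^[1+a]∣powerSum a []       _            = _ ∣0
    2^[1+a]∣powerSum a (x ∷ xs) (a<x ∷ a<xs) = ∣m∣n⇒∣m+n 2^[1+a]∣2^x (2^[1+a]∣powerSum a xs a<xs)
      where
      2^[1+a]∣2^x : 2 ^ suc a ∣ 2 ^ x
      2^[1+a]∣2^x = divides (2 ^ (x ∸ suc a)) (trans (cong (2 ^_) (sym (m+[n∸m]≡n a<x)))
                      (trans (^-distribˡ-+-* 2 (suc a) (x ∸ suc a)) (*-comm (2 ^ suc a) _)))

    odd≢even : ∀ q r → 1 + 2 * q ≢ 2 * r
    odd≢even q zero ()
    odd≢even zero (suc r) eq with trans eq (solve 1 (λ r → con 2 :* (con 1 :+ r) := con 2 :+ con 2 :* r) refl r)
    ... | ()
    odd≢even (suc q) (suc r) eq = odd≢even q r (suc-injective (suc-injective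
      (trans (solve 1 (λ q → con 2 :+ (con 1 :+ con 2 :* q) := con 1 :+ con 2 :* (con 1 :+ q)) refl q)
      (trans eq (solve 1 (λ r → con 2 :* (con 1 :+ r) := con 2 :+ con 2 :* r) refl r)))))

    2-adic-unique : ∀ a b q q′ → 2 ^ a * (1 + 2 * q) ≡ 2 ^ b * (1 + 2 * q′) → a ≡ b × q ≡ q′
    2-adic-unique zero zero q q′ eq =
      refl , *-cancelˡ-≡ q q′ 2 (suc-injective (trans (sym (*-identityˡ _)) (trans eq (*-identityˡ _))))
    2-adic-unique zero (suc b) q q′ eq =
      ⊥-elim (odd≢even q (2 ^ b * (1 + 2 * q′)) (trans (sym (*-identityˡ _)) (trans eq (*-assoc 2 (2 ^ b) _))))
    2-adic-unique (suc a) zero q q′ eq =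
      ⊥-elim (odd≢even q′ (2 ^ a * (1 + 2 * q)) (trans (sym (*-identityˡ _)) (trans (sym eq) (*-assoc 2 (2 ^ a) _))))
    2-adic-unique (suc a) (suc b) q q′ eq
      with 2-adic-unique a b q q′ (*-cancelˡ-≡ _ _ 2 (trans (sym (*-assoc 2 (2 ^ a) _)) (trans eq (*-assoc 2 (2 ^ b) _))))
    ... | refl , q≡q′ = refl , q≡q′

    powerSum-split : ∀ x xs → All (x <_) xs →
                     ∃ λ q → powerSum (x ∷ xs) ≡ 2 ^ x * (1 + 2 * q) × powerSum xs ≡ q * 2 ^ suc x
    powerSum-split x xs x<xs with 2^[1+a]∣powerSum x xs x<xs
    ... | divides q eq = q , trans (cong (2 ^ x +_) eq)
                                 (solve 2 (λ P q → P :+ q :* (con 2 :* P) := P :* (con 1 :+ con 2 :* q)) refl (2 ^ x) q) , eq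

  powerSum-injective : ∀ xs ys → AllPairs _<_ xs → AllPairs _<_ ys → powerSum xs ≡ powerSum ys → xs ≡ ys
  powerSum-injective []       []       _ _ _  = refl
  powerSum-injective []       (y ∷ ys) _ _ eq = ⊥-elim (<⇒≢ (≤-trans (m^n>0 2 y) (m≤m+n (2 ^ y) _)) eq)
  powerSum-injective (x ∷ xs) []       _ _ eq = ⊥-elim (<⇒≢ (≤-trans (m^n>0 2 x) (m≤m+n (2 ^ x) _)) (sym eq))
  powerSum-injective (x ∷ xs) (y ∷ ys) (x<xs ∷ xs-sorted) (y<ys ∷ ys-sorted) eq
    with powerSum-split x xs x<xs | powerSum-split y ys y<ys
  ... | q , eqx , eqxs | q′ , eqy , eqys with 2-adic-unique x y q q′ (trans (sym eqx) (trans eq eqy))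
  ... | refl , refl = cong (x ∷_) (powerSum-injective xs ys xs-sorted ys-sorted (trans eqxs (sym eqys)))

  private
    unit-mod : ∀ a b → Coprime (suc a) (suc b) → ∃ λ e → e % suc a ≡ 0 × e % suc b ≡ 1 % suc b
    unit-mod a b coprime with coprime-Bézout coprime
    ... | Bézout.+- x y eq = x * suc a , m*n%n≡0 x (suc a) , trans (cong (_% suc b) (sym eq)) ([m+kn]%n≡m%n 1 y (suc b))
    ... | Bézout.-+ x y eq = x * suc a * b , e%a≡0 , e%b≡1
      where
      e%a≡0 : (x * suc a * b) % suc a ≡ 0
      e%a≡0 = trans (cong (_% suc a) (solve 3 (λ x a b → x :* (con 1 :+ a) :* b := (x :* b) :* (con 1 :+ a)) refl x a b))
                    (m*n%n≡0 (x * b) (suc a))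
      e%b≡1 : (x * suc a * b) % suc b ≡ 1 % suc b
      e%b≡1 = trans (sym ([m+n]%n≡m%n (x * suc a * b) (suc b))) (trans (cong (_% suc b) shift) ([m+kn]%n≡m%n 1 (y * b) (suc b)))
        where
        shift : x * suc a * b + suc b ≡ 1 + (y * b) * suc b
        shift = begin
          x * suc a * b + suc b
            ≡⟨ solve 3 (λ x a b → x :* (con 1 :+ a) :* b :+ (con 1 :+ b) := con 1 :+ (con 1 :+ x :* (con 1 :+ a)) :* b) refl x a b ⟩
          1 + (1 + x * suc a) * b ≡⟨ cong (λ z → 1 + z * b) eq ⟩
          1 + (y * suc b) * b    ≡⟨ solve 2 (λ y b → con 1 :+ (y :* (con 1 :+ b)) :* b := con 1 :+ (y :* b) :* (con 1 :+ b)) refl y b ⟩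
          1 + (y * b) * suc b    ∎
          where open ≡-Reasoning

    *-unit-mod : ∀ n u e → e % suc n ≡ 1 % suc n → (u * e) % suc n ≡ u % suc n
    *-unit-mod n u e e≡1 = begin
      (u * e) % suc n                      ≡⟨ %-distribˡ-* u e (suc n) ⟩
      ((u % suc n) * (e % suc n)) % suc n  ≡⟨ cong (λ z → ((u % suc n) * z) % suc n) e≡1 ⟩
      ((u % suc n) * (1 % suc n)) % suc n  ≡⟨ %-distribˡ-* u 1 (suc n) ⟨
      (u * 1) % suc n                      ≡⟨ cong (_% suc n) (*-identityʳ u) ⟩
      u % suc n                            ∎
      where open ≡-Reasoning

    *-zero-mod : ∀ n u e → e % suc n ≡ 0 → (u * e) % suc n ≡ 0
    *-zero-mod n u e e≡0 = trans (%-distribˡ-* u e (suc n))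
      (trans (cong (λ z → ((u % suc n) * z) % suc n) e≡0) (cong (_% suc n) (*-zeroʳ (u % suc n))))

    +-zero-mod : ∀ n x y → y % suc n ≡ 0 → (x + y) % suc n ≡ x % suc n
    +-zero-mod n x y y≡0 = trans (%-distribˡ-+ x y (suc n))
      (trans (cong (λ z → (x % suc n + z) % suc n) y≡0) (trans (cong (_% suc n) (+-identityʳ (x % suc n))) (m%n%n≡m%n x (suc n))))

    crt₂ : ∀ a b → Coprime (suc a) (suc b) → ∀ u v →
           ∃ λ y → y < suc a * suc b × y % suc a ≡ u % suc a × y % suc b ≡ v % suc b
    crt₂ a b coprime u v = z % (suc a * suc b) , m%n<n z (suc a * suc b) , z≡u , z≡v
      where
      ea : ∃ λ e → e % suc b ≡ 0 × e % suc a ≡ 1 % suc a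
      ea = unit-mod b a (Coprime.sym coprime)
      eb : ∃ λ e → e % suc a ≡ 0 × e % suc b ≡ 1 % suc b
      eb = unit-mod a b coprime
      z : ℕ
      z = u * proj₁ ea + v * proj₁ eb
      z≡u : z % (suc a * suc b) % suc a ≡ u % suc a
      z≡u = trans (m∣n⇒o%n%m≡o%m (suc a) (suc a * suc b) z (divides (suc b) (*-comm (suc a) (suc b))))
                 (trans (+-zero-mod a (u * proj₁ ea) (v * proj₁ eb) (*-zero-mod a v (proj₁ eb) (proj₁ (proj₂ eb))))
                        (*-unit-mod a u (proj₁ ea) (proj₂ (proj₂ ea))))
      z≡v : z % (suc a * suc b) % suc b ≡ v % suc b
      z≡v = trans (m∣n⇒o%n%m≡o%m (suc b) (suc a * suc b) z (divides (suc a) refl))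
                 (trans (cong (_% suc b) (+-comm (u * proj₁ ea) (v * proj₁ eb)))
                 (trans (+-zero-mod b (v * proj₁ eb) (u * proj₁ ea) (*-zero-mod b u (proj₁ ea) (proj₁ (proj₂ ea))))
                        (*-unit-mod b v (proj₁ eb) (proj₂ (proj₂ eb)))))

    coprime-product : ∀ {a} (xs : List ℕ) → All (Coprime a) xs → Coprime a (product xs)
    coprime-product []       _                  (_ , d∣1)        = ∣1⇒≡1 d∣1
    coprime-product (x ∷ xs) (a⊥x ∷ a⊥xs) {d} (d∣a , d∣x*xs) =
      coprime-product xs a⊥xs (d∣a , coprime-divisor (λ (e∣d , e∣x) → a⊥x (∣-trans e∣d d∣a , e∣x)) d∣x*xs)

    ∣-product : ∀ {x} {xs : List ℕ} → x ∈ xs → x ∣ product xs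
    ∣-product {xs = y ∷ xs} (here refl) = divides (product xs) (*-comm y (product xs))
    ∣-product {xs = y ∷ xs} (there x∈)  = ∣-trans (∣-product x∈) (divides y refl)

    product-suc : ∀ (xs : List ℕ) → ∃ λ q → product (map suc xs) ≡ suc q
    product-suc []       = 0 , refl
    product-suc (x ∷ xs) = let q , eq = product-suc xs in _ , cong (suc x *_) eq

  chinese-remainder : ∀ (m c : ℕ → ℕ) (is : List ℕ) → AllPairs (λ i j → Coprime (suc (m i)) (suc (m j))) is →
                      ∃ λ y → y < product (map (suc ∘ m) is) × All (λ i → y % suc (m i) ≡ c i % suc (m i)) is
  chinese-remainder m c []       _                 = 0 , s≤s z≤n , []
  chinese-remainder m c (i ∷ is) (i⊥is ∷ coprime) =
    y , subst (λ z → y < suc (m i) * z) (sym Q≡) y<iQ , y≡ci ∷ All.tabulate y≡c-is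
    where
    rest : ∃ λ y′ → y′ < product (map (suc ∘ m) is) × All (λ j → y′ % suc (m j) ≡ c j % suc (m j)) is
    rest = chinese-remainder m c is coprime
    Q : ℕ
    Q = proj₁ (product-suc (map m is))
    Q≡ : product (map (suc ∘ m) is) ≡ suc Q
    Q≡ = trans (cong product (List.map-∘ is)) (proj₂ (product-suc (map m is)))
    i⊥Q : Coprime (suc (m i)) (suc Q)
    i⊥Q = subst (Coprime (suc (m i))) Q≡ (coprime-product (map (suc ∘ m) is) (AllProps.map⁺ i⊥is))
    solution : ∃ λ y → y < suc (m i) * suc Q × y % suc (m i) ≡ c i % suc (m i) × y % suc Q ≡ proj₁ rest % suc Q
    solution = crt₂ (m i) Q i⊥Q (c i) (proj₁ rest)
    y : ℕ
    y = proj₁ solution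
    y<iQ : y < suc (m i) * suc Q
    y<iQ = proj₁ (proj₂ solution)
    y≡ci : y % suc (m i) ≡ c i % suc (m i)
    y≡ci = proj₁ (proj₂ (proj₂ solution))
    y%Q≡y′ : y % suc Q ≡ proj₁ rest
    y%Q≡y′ = trans (proj₂ (proj₂ (proj₂ solution))) (m<n⇒m%n≡m (subst (proj₁ rest <_) Q≡ (proj₁ (proj₂ rest))))
    y≡c-is : ∀ {j} → j ∈ is → y % suc (m j) ≡ c j % suc (m j)
    y≡c-is {j} j∈ = begin
      y % suc (m j)                 ≡⟨ m∣n⇒o%n%m≡o%m (suc (m j)) (suc Q) y
                                         (subst (suc (m j) ∣_) Q≡ (∣-product (∈-map⁺ (suc ∘ m) j∈))) ⟨
      y % suc Q % suc (m j)         ≡⟨ cong (_% suc (m j)) y%Q≡y′ ⟩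
      proj₁ rest % suc (m j)        ≡⟨ All.lookup (proj₂ (proj₂ rest)) j∈ ⟩
      c j % suc (m j)               ∎
      where open ≡-Reasoning

  +-%-shift : ∀ q X y j → y % suc q ≡ (j + (suc q ∸ X % suc q)) % suc q → j < suc q → (X + y) % suc q ≡ j
  +-%-shift q X y j y≡ j<q = begin
    (X + y) % suc q                           ≡⟨ %-distribˡ-+ X y (suc q) ⟩
    (X % suc q + y % suc q) % suc q           ≡⟨ cong (λ z → (X % suc q + z) % suc q) y≡ ⟩
    (X % suc q + shift % suc q) % suc q       ≡⟨ cong (λ z → (z + shift % suc q) % suc q) (m%n%n≡m%n X (suc q)) ⟨
    (X % suc q % suc q + shift % suc q) % suc q ≡⟨ %-distribˡ-+ (X % suc q) shift (suc q) ⟨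
    (X % suc q + shift) % suc q               ≡⟨ cong (_% suc q) X+shift ⟩
    (j + suc q) % suc q                       ≡⟨ [m+n]%n≡m%n j (suc q) ⟩
    j % suc q                                 ≡⟨ m<n⇒m%n≡m j<q ⟩
    j                                         ∎
    where
    open ≡-Reasoning
    shift : ℕ
    shift = j + (suc q ∸ X % suc q)
    X+shift : X % suc q + shift ≡ j + suc q
    X+shift = trans (sym (+-assoc (X % suc q) j _)) (trans (cong (_+ (suc q ∸ X % suc q)) (+-comm (X % suc q) j))
                (trans (+-assoc j (X % suc q) _) (cong (j +_) (m+[n∸m]≡n (m%n≤n X (suc q))))))

module HashingStages (σ : Signature) (τs : TypeFamily σ) (p : ℕ → ℕ) (enum : TypeFamily σ) where
  open import Data.List.Membership.Propositional using () renaming (_∈_ to _∈ₗ_)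
  open import Data.Bool using (Bool; true; false; T; if_then_else_)
  open import Data.Bool.Properties using (T-∧)
  open import Data.Empty using (⊥-elim)
  open import Data.Fin using (Fin; toℕ)
  import Data.Fin as Fin
  import Data.Fin.Properties as Fin
  open import Data.List using (List; []; _∷_)
  import Data.List as List
  open import Data.List.Relation.Unary.Any using (here; there)
  open import Data.List.Membership.Propositional.Properties using (∈-filter⁺; ∈-filter⁻; ∈-cartesianProduct⁺; ∈-allFin)
  open import Data.Maybe using (just; nothing)
  open import Data.Maybe.Properties using (just-injective)
  open import Data.Nat using (ℕ; zero; suc; _≤_; _<_; _<?_; z≤n; s≤s)
  import Data.Nat.Properties as ℕ
  open import Data.Product using (∃; _×_; _,_; proj₁; proj₂)
  open import Data.Sum using (_⊎_; inj₁; inj₂; map₁)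
  import Data.Sum as Sum
  import Data.Sum.Properties as Sum
  open import Data.Vec using (Vec; []; _∷_; lookup)
  import Data.Vec as Vec
  open import Data.Vec.Relation.Unary.Any using (here; there; index)
  import Data.Vec.Relation.Unary.Any.Properties as VAny
  import Data.Vec.Relation.Unary.All as VAll
  open import Data.Vec.Membership.Propositional using (_∈_)
  open import Data.Vec.Membership.Propositional.Properties using (∈-map⁺; ∈-lookup)
  open import Function using (_∘_; Equivalence)
  open import Function.Definitions using (Injective)
  open import Relation.Binary.PropositionalEquality
  open import Relation.Nullary using (¬_; yes; no)
  open import Relation.Nullary.Decidable using (T?)

  open TypeLemmas
  open Signature σ
  open Hashing σ τs p enum

  Dom′ : Set
  Dom′ = Elem ⊎ Fin nC

  indexOf-sound : ∀ {l} (t : Vec Elem l) {e i} → indexOf t e ≡ just i → lookup t i ≡ e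
  indexOf-sound (x ∷ t) {e} eq with decElem x e
  indexOf-sound (x ∷ t) refl | yes x≡e = x≡e
  ... | no _ with indexOf t e in eq′
  indexOf-sound (x ∷ t) refl | no _ | just j = indexOf-sound t eq′

  indexOf-complete : ∀ {l} (t : Vec Elem l) {e} → e ∈ t → ∃ λ i → indexOf t e ≡ just i
  indexOf-complete (x ∷ t) {e} e∈ with decElem x e
  ... | yes _ = Fin.zero , refl
  indexOf-complete (x ∷ t) (here refl) | no x≢e = ⊥-elim (x≢e refl)
  indexOf-complete (x ∷ t) (there e∈) | no _ with indexOf-complete t e∈
  ... | i , eq rewrite eq = Fin.suc i , refl

  pull-sound : ∀ {l n} (t : Vec Elem l) (v : Vec Dom′ n) {s} → pull t v ≡ just s → Vec.map (map₁ (lookup t)) s ≡ v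
  pull-sound t [] refl = refl
  pull-sound t (x ∷ v) eq with pullElem t x in eq₁ | pull t v in eq₂
  pull-sound t (x ∷ v) refl | just a | just s = cong₂ _∷_ (element x eq₁) (pull-sound t v eq₂)
    where
    element : ∀ x {a} → pullElem t x ≡ just a → map₁ (lookup t) a ≡ x
    element (inj₂ c) refl = refl
    element (inj₁ e) eq with indexOf t e in eq′
    element (inj₁ e) refl | just i = cong inj₁ (indexOf-sound t eq′)

  pull-complete : ∀ {l n} (t : Vec Elem l) (v : Vec Dom′ n) → (∀ {x} → inj₁ x ∈ v → x ∈ t) →
                  ∃ λ s → pull t v ≡ just s
  pull-complete t [] _ = [] , refl
  pull-complete t (inj₂ c ∷ v) ⊆t with pull-complete t v (⊆t ∘ there)
  ... | s , eq rewrite eq = inj₂ c ∷ s , refl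
  pull-complete t (inj₁ x ∷ v) ⊆t with pull-complete t v (⊆t ∘ there) | indexOf-complete t (⊆t (here refl))
  ... | s , eq | i , eq′ rewrite eq | eq′ = inj₁ i ∷ s , refl

  pull-map : ∀ {l n} (t : Vec Elem l) → Injective _≡_ _≡_ (lookup t) → (s : Vec (Fin l ⊎ Fin nC) n) →
             pull t (Vec.map (map₁ (lookup t)) s) ≡ just s
  pull-map t t-inj s with pull-complete t (Vec.map (map₁ (lookup t)) s) ⊆t
    where
    ⊆t : ∀ {x} → inj₁ x ∈ Vec.map (map₁ (lookup t)) s → x ∈ t
    ⊆t x∈ with ∈ᵥ-map⁻ (map₁ (lookup t)) x∈
    ... | inj₁ j , _ , refl = ∈-lookup j t
  ... | s′ , eq = trans eq (cong just (Vec-map-injective (map₁-injective t-inj) (pull-sound t _ eq)))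

  pull-[] : ∀ {n} (v : Vec Dom′ n) {x} → inj₁ x ∈ v → pull [] v ≡ nothing
  pull-[] v x∈ with pull [] v in eq
  ... | nothing = refl
  ... | just s with ∈ᵥ-map⁻ (map₁ (lookup [])) (subst (inj₁ _ ∈_) (sym (pull-sound [] v eq)) x∈)
  ... | inj₁ () , _

  Enumerates : ∀ {l r} → Vec Elem l → Vec Dom′ r → Set
  Enumerates t v = (∀ {x} → x ∈ t → inj₁ x ∈ v) × (∀ {x} → inj₁ x ∈ v → x ∈ t)

  pull-full⇒enumerates : ∀ {l} (t : Vec Elem l) {R} (v : Vec Dom′ (ar R)) {s} → pull t v ≡ just s →
                         isFull σ (R , s) ≡ true → Enumerates t v
  pull-full⇒enumerates t v {s} pull≡ full = to , from
    where
    v≡ : Vec.map (map₁ (lookup t)) s ≡ v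
    v≡ = pull-sound t v pull≡
    to : ∀ {x} → x ∈ t → inj₁ x ∈ v
    to x∈ = subst (inj₁ _ ∈_) v≡ (subst (λ y → inj₁ y ∈ Vec.map (map₁ (lookup t)) s) (sym (VAny.lookup-index x∈))
              (∈-map⁺ (map₁ (lookup t)) (Equivalence.to (isFull⇔ σ) full (index x∈))))
    from : ∀ {x} → inj₁ x ∈ v → x ∈ t
    from x∈ with ∈ᵥ-map⁻ (map₁ (lookup t)) (subst (inj₁ _ ∈_) (sym v≡) x∈)
    ... | inj₁ j , _ , refl = ∈-lookup j t

  enumerates⇒full : ∀ {l} (t : Vec Elem l) → Injective _≡_ _≡_ (lookup t) → ∀ {R} (v : Vec Dom′ (ar R)) {s} →
                    Enumerates t v → pull t v ≡ just s → isFull σ (R , s) ≡ true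
  enumerates⇒full t t-inj v {s} (to , _) pull≡ = Equivalence.from (isFull⇔ σ) occurs
    where
    occurs : ∀ j → inj₁ j ∈ s
    occurs j with ∈ᵥ-map⁻ (map₁ (lookup t)) (subst (inj₁ _ ∈_) (sym (pull-sound t v pull≡)) (to (∈-lookup j t)))
    ... | inj₁ j′ , j′∈ , eq = subst (λ i → inj₁ i ∈ s) (t-inj (Sum.inj₁-injective (sym eq))) j′∈

  row : Elem → ℕ
  row = toℕ ∘ proj₁

  Increasing : ∀ {l} → Vec Elem l → Set
  Increasing t = T (increasing t)

  increasing-tail : ∀ {l} x (t : Vec Elem l) → Increasing (x ∷ t) → Increasing t
  increasing-tail x []      _   = _
  increasing-tail x (y ∷ t) inc = proj₂ (Equivalence.to T-∧ inc)

  increasing-head : ∀ {l} x (t : Vec Elem l) → Increasing (x ∷ t) → ∀ {y} → y ∈ t → row x < row y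
  increasing-head x (y ∷ t) inc (here refl) = does-sound (row x <? row y) (proj₁ (Equivalence.to T-∧ inc))
  increasing-head x (y ∷ t) inc (there z∈)  =
    ℕ.<-trans (increasing-head x (y ∷ t) inc (here refl)) (increasing-head y t (increasing-tail x (y ∷ t) inc) z∈)

  increasing-cons : ∀ {l} x (t : Vec Elem l) → Increasing t → (∀ {y} → y ∈ t → row x < row y) → Increasing (x ∷ t)
  increasing-cons x []      _   _     = _
  increasing-cons x (y ∷ t) inc x<t = Equivalence.from T-∧ (does-complete (row x <? row y) (x<t (here refl)) , inc)

  increasing-rows-injective : ∀ {l} (t : Vec Elem l) → Increasing t → Injective _≡_ _≡_ (row ∘ lookup t)
  increasing-rows-injective (x ∷ t) inc {Fin.zero}  {Fin.zero}  _  = refl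
  increasing-rows-injective (x ∷ t) inc {Fin.zero}  {Fin.suc j} eq = ⊥-elim (ℕ.<-irrefl eq (increasing-head x t inc (∈-lookup j t)))
  increasing-rows-injective (x ∷ t) inc {Fin.suc i} {Fin.zero}  eq = ⊥-elim (ℕ.<-irrefl (sym eq) (increasing-head x t inc (∈-lookup i t)))
  increasing-rows-injective (x ∷ t) inc {Fin.suc i} {Fin.suc j} eq =
    cong Fin.suc (increasing-rows-injective t (increasing-tail x t inc) eq)

  increasing-injective : ∀ {l} (t : Vec Elem l) → Increasing t → Injective _≡_ _≡_ (lookup t)
  increasing-injective t inc = increasing-rows-injective t inc ∘ cong row

  increasing-length≤wd : ∀ {l} (t : Vec Elem l) → Increasing t → l ≤ wd σ
  increasing-length≤wd t inc = Fin.injective⇒≤ {f = proj₁ ∘ lookup t} (increasing-rows-injective t inc ∘ cong toℕ)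

  SameElements : ∀ {l l′} → Vec Elem l → Vec Elem l′ → Set
  SameElements t t′ = (∀ {x} → x ∈ t → x ∈ t′) × (∀ {x} → x ∈ t′ → x ∈ t)

  same-elements : ∀ {l l′ r} {t : Vec Elem l} {t′ : Vec Elem l′} {v : Vec Dom′ r} →
                  Enumerates t v → Enumerates t′ v → SameElements t t′
  same-elements (to , from) (to′ , from′) = from′ ∘ to , from ∘ to′

  increasing-uncons : ∀ {l l′} {x x′} {t : Vec Elem l} {t′ : Vec Elem l′} → Increasing (x ∷ t) → Increasing (x′ ∷ t′) →
                      SameElements (x ∷ t) (x′ ∷ t′) → x ≡ x′ × SameElements t t′
  increasing-uncons {x = x} {x′} {t} {t′} inc inc′ (to , from) = x≡x′ , tail-to , tail-from
    where
    x≡x′ : x ≡ x′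
    x≡x′ with to (here refl) | from (here refl)
    ... | here x≡x′ | _         = x≡x′
    ... | there _   | here x′≡x = sym x′≡x
    ... | there x∈  | there x′∈ = ⊥-elim (ℕ.<-asym (increasing-head x′ t′ inc′ x∈) (increasing-head x t inc x′∈))
    tail-to : ∀ {y} → y ∈ t → y ∈ t′
    tail-to y∈ with to (there y∈)
    ... | here refl = ⊥-elim (ℕ.<-irrefl (cong row x≡x′) (increasing-head x t inc y∈))
    ... | there y∈′ = y∈′
    tail-from : ∀ {y} → y ∈ t′ → y ∈ t
    tail-from y∈ with from (there y∈)
    ... | here refl = ⊥-elim (ℕ.<-irrefl (cong row (sym x≡x′)) (increasing-head x′ t′ inc′ y∈))
    ... | there y∈′ = y∈′

  increasing-length : ∀ {l l′} (t : Vec Elem l) (t′ : Vec Elem l′) → Increasing t → Increasing t′ →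
                      SameElements t t′ → l ≡ l′
  increasing-length []      []        _   _    _          = refl
  increasing-length []      (x′ ∷ t′) _   _    (_ , from) with from (here refl)
  ... | ()
  increasing-length (x ∷ t) []        _   _    (to , _)   with to (here refl)
  ... | ()
  increasing-length (x ∷ t) (x′ ∷ t′) inc inc′ same =
    cong suc (increasing-length t t′ (increasing-tail x t inc) (increasing-tail x′ t′ inc′)
                                     (proj₂ (increasing-uncons inc inc′ same)))

  increasing-≡ : ∀ {l} (t t′ : Vec Elem l) → Increasing t → Increasing t′ → SameElements t t′ → t ≡ t′
  increasing-≡ []      []        _   _    _    = refl
  increasing-≡ (x ∷ t) (x′ ∷ t′) inc inc′ same =
    let x≡x′ , same′ = increasing-uncons inc inc′ same
    in cong₂ _∷_ x≡x′ (increasing-≡ t t′ (increasing-tail x t inc) (increasing-tail x′ t′ inc′) same′)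

  tuples-increasing : ∀ {l} {t : Vec Elem l} → t ∈ₗ tuples l → Increasing t
  tuples-increasing {l} t∈ =
    proj₂ (∈-filter⁻ (T? ∘ increasing) {xs = allVecs σ (List.cartesianProduct (List.allFin w) (List.allFin M)) l} t∈)

  increasing-tuples : ∀ {l} {t : Vec Elem l} → Increasing t → t ∈ₗ tuples l
  increasing-tuples {t = t} inc = ∈-filter⁺ (T? ∘ increasing)
    (allVecs-complete σ t (VAll.universal (λ e → ∈-cartesianProduct⁺ (∈-allFin (proj₁ e)) (∈-allFin (proj₂ e))) t)) inc

  update : ∀ {k} → Structure σ Elem → (R : Fin nR) → Vec Dom′ (ar R) → Vec Elem k → KType σ k →
           Vec (Fin k ⊎ Fin nC) (ar R) → Bool
  update 𝔄 R v t τ s = if compatibleᵇ σ τ (tp σ 𝔄 (lookup t)) then τ (R , s) else Structure.rel 𝔄 R v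

  stepFact-untouched : ∀ {k} 𝔄 R v (ts : List (Vec Elem k)) →
                       stepFact 𝔄 R v ts ≡ Structure.rel 𝔄 R v ⊎ ∃ λ t → t ∈ₗ ts × Enumerates t v
  stepFact-untouched 𝔄 R v [] = inj₁ refl
  stepFact-untouched 𝔄 R v (t ∷ ts) with pull t v in pull≡ | hashType t
  ... | just s | just τ with isFull σ (R , s) in full
  ...   | true  = inj₂ (t , here refl , pull-full⇒enumerates t v pull≡ full)
  ...   | false = Sum.map₂ (λ (t′ , t′∈ , enum) → t′ , there t′∈ , enum) (stepFact-untouched 𝔄 R v ts)
  stepFact-untouched 𝔄 R v (t ∷ ts) | just s | nothing =
    Sum.map₂ (λ (t′ , t′∈ , enum) → t′ , there t′∈ , enum) (stepFact-untouched 𝔄 R v ts)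
  stepFact-untouched 𝔄 R v (t ∷ ts) | nothing | _ =
    Sum.map₂ (λ (t′ , t′∈ , enum) → t′ , there t′∈ , enum) (stepFact-untouched 𝔄 R v ts)

  stepFact-updates : ∀ {k} 𝔄 R v (ts : List (Vec Elem k)) {t₀ τ s} → t₀ ∈ₗ ts → (∀ {t} → t ∈ₗ ts → Increasing t) →
                     Enumerates t₀ v → hashType t₀ ≡ just τ → pull t₀ v ≡ just s →
                     stepFact 𝔄 R v ts ≡ update 𝔄 R v t₀ τ s
  stepFact-updates 𝔄 R v (t ∷ ts) {t₀} (here refl) incs enum hash≡ pull≡
    rewrite pull≡ | hash≡ | enumerates⇒full t₀ (increasing-injective t₀ (incs (here refl))) v enum pull≡ = refl
  stepFact-updates 𝔄 R v (t ∷ ts) {t₀} (there t₀∈) incs enum hash≡ pull≡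
    with pull t v in pull≡′ | hashType t in hash≡′
  ... | just s | just τ′ with isFull σ (R , s) in full
  ...   | true  with increasing-≡ t t₀ (incs (here refl)) (incs (there t₀∈))
                                  (same-elements (pull-full⇒enumerates t v pull≡′ full) enum)
  ...     | refl rewrite just-injective (trans (sym hash≡′) hash≡) | just-injective (trans (sym pull≡′) pull≡) = refl
  stepFact-updates 𝔄 R v (t ∷ ts) (there t₀∈) incs enum hash≡ pull≡ | just s | just τ′ | false =
    stepFact-updates 𝔄 R v ts t₀∈ (incs ∘ there) enum hash≡ pull≡
  stepFact-updates 𝔄 R v (t ∷ ts) (there t₀∈) incs enum hash≡ pull≡ | just s | nothing =
    stepFact-updates 𝔄 R v ts t₀∈ (incs ∘ there) enum hash≡ pull≡
  stepFact-updates 𝔄 R v (t ∷ ts) (there t₀∈) incs enum hash≡ pull≡ | nothing | _ =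
    stepFact-updates 𝔄 R v ts t₀∈ (incs ∘ there) enum hash≡ pull≡

  factAt : ℕ → (R : Fin nR) → Vec Dom′ (ar R) → Bool
  factAt n = Structure.rel (stage n)

  stage-untouched : ∀ k R v → factAt (suc k) R v ≡ factAt k R v ⊎
                              ∃ λ (t : Vec Elem (suc k)) → Increasing t × Enumerates t v
  stage-untouched k R v = Sum.map₂ (λ (t , t∈ , enum) → t , tuples-increasing t∈ , enum)
                                   (stepFact-untouched (stage k) R v (tuples (suc k)))

  stage-updates : ∀ k R v {t : Vec Elem (suc k)} {τ s} → Increasing t → Enumerates t v →
                  hashType t ≡ just τ → pull t v ≡ just s → factAt (suc k) R v ≡ update (stage k) R v t τ s
  stage-updates k R v inc = stepFact-updates (stage k) R v (tuples (suc k)) (increasing-tuples inc) tuples-increasing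

  stable-from : ∀ R v n₀ → (∀ n → n₀ ≤ n → ∀ (t : Vec Elem (suc n)) → Increasing t → ¬ Enumerates t v) →
                ∀ n → n₀ ≤ n → factAt n R v ≡ factAt n₀ R v
  stable-from R v n₀ untouched n n₀≤n with ℕ.m≤n⇒m<n∨m≡n n₀≤n
  ... | inj₂ refl = refl
  stable-from R v n₀ untouched (suc n) _ | inj₁ (s≤s n₀≤n) with stage-untouched n R v
  ... | inj₁ same            = trans same (stable-from R v n₀ untouched n n₀≤n)
  ... | inj₂ (t , inc , enum) = ⊥-elim (untouched n n₀≤n t inc enum)

  fact-after : ∀ {l} R v {t : Vec Elem l} → Increasing t → Enumerates t v → ∀ n → l ≤ n → factAt n R v ≡ factAt l R v
  fact-after {l} R v {t} inc enum = stable-from R v l λ n l≤n t′ inc′ enum′ →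
    ℕ.<-irrefl (increasing-length t t′ inc inc′ (same-elements enum enum′)) (s≤s l≤n)

  fact-before : ∀ {l} R v {t : Vec Elem l} → Increasing t → Enumerates t v → ∀ n → n < l → factAt n R v ≡ factAt 0 R v
  fact-before R v inc enum zero    _   = refl
  fact-before R v {t} inc enum (suc n) n<l with stage-untouched n R v
  ... | inj₁ same              = trans same (fact-before R v inc enum n (ℕ.<-trans (ℕ.n<1+n n) n<l))
  ... | inj₂ (t′ , inc′ , enum′) = ⊥-elim (ℕ.<-irrefl (sym (increasing-length t t′ inc inc′ (same-elements enum enum′))) n<l)

  fact-without-elements : ∀ R v → (∀ x → ¬ inj₁ x ∈ v) → ∀ n → factAt n R v ≡ factAt 0 R v
  fact-without-elements R v none n = stable-from R v 0 (λ { _ _ (x ∷ _) _ (to , _) → none x (to (here refl)) }) n z≤n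

  fact₀-element : ∀ R v {x} → inj₁ x ∈ v → factAt 0 R v ≡ false
  fact₀-element R v x∈ with pull [] v | pull-[] v x∈
  ... | .nothing | refl = refl

  module _ (consistent : Consistent σ τs) where

    τ₀ : KType σ 0
    τ₀ = proj₁ (initialType σ τs consistent)

    fact₀-constants : ∀ R (s : Vec (Fin 0 ⊎ Fin nC) (ar R)) → factAt 0 R (Vec.map (map₁ (lookup [])) s) ≡ τ₀ (R , s)
    fact₀-constants R s with pull [] (Vec.map (map₁ (lookup [])) s) | pull-map [] (λ { {()} }) s
                           | List.head (τs 0) | proj₁ (proj₂ (initialType σ τs consistent))
    ... | .(just s) | refl | .(just τ₀) | refl = refl

module HashingGuarded (σ : Signature) (τs : TypeFamily σ) (p : ℕ → ℕ) (enum : TypeFamily σ)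
                      (closed : Closed σ τs) (consistent : Consistent σ τs) (nonempty : Nonempty σ τs)
                      (enum-ok : ∀ k → 1 ≤ k → k ≤ wd σ → IsEnumeration σ (τs k) (enum k)) where
  open import Data.List.Membership.Propositional using () renaming (_∈_ to _∈ₗ_)
  open import Data.Bool using (true; false; if_then_else_)
  open import Data.Empty using (⊥-elim)
  open import Data.Fin using (Fin; toℕ)
  import Data.Fin as Fin
  import Data.Fin.Properties as Fin
  open import Data.List using (List; []; _∷_; length)
  open import Data.List.Relation.Unary.Any using (here; there)
  import Data.List.Relation.Unary.Any as Any
  open import Data.Maybe using (just)
  open import Data.Nat using (ℕ; zero; suc; _≤_; _<_; z≤n; s≤s)
  import Data.Nat.Properties as ℕ
  import Data.Nat.DivMod as ℕ
  open import Data.Product using (∃; _×_; _,_; proj₁; proj₂)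
  open import Data.Sum using (_⊎_; inj₁; inj₂; map₁)
  import Data.Sum.Properties as Sum
  open import Data.Vec using (Vec; []; _∷_; lookup)
  import Data.Vec as Vec
  import Data.Vec.Properties as Vec
  open import Data.Vec.Relation.Unary.Any using (here; there; index)
  import Data.Vec.Relation.Unary.Any.Properties as VAny
  open import Data.Vec.Membership.Propositional using (_∈_)
  open import Data.Vec.Membership.Propositional.Properties using (∈-map⁺; ∈-lookup)
  open import Function using (_∘_; Equivalence)
  open import Function.Definitions using (Injective)
  open import Relation.Binary.PropositionalEquality
  open import Relation.Nullary using (¬_)

  open TypeLemmas
  open Signature σ
  open Hashing σ τs p enum
  open HashingStages σ τs p enum

  lookupM-modT : ∀ {A : Set} (xs : List A) a → 0 < length xs → ∃ λ x → lookupM σ xs (modT σ a (length xs)) ≡ just x × x ∈ₗ xs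
  lookupM-modT xs@(_ ∷ ys) a _ = go xs (ℕ.m%n<n a (suc (length ys)))
    where
    go : ∀ {A : Set} (xs : List A) {j} → j < length xs → ∃ λ x → lookupM σ xs j ≡ just x × x ∈ₗ xs
    go (z ∷ zs) {zero}  _         = z , refl , here refl
    go (z ∷ zs) {suc j} (s≤s j<n) = let x , eq , x∈ = go zs j<n in x , eq , there x∈

  hashType-defined : ∀ {k} (t : Vec Elem (suc k)) → suc k ≤ wd σ →
                     ∃ λ τ → hashType t ≡ just τ × _∈ᵗ_ σ τ (τs (suc k))
  hashType-defined {k} t sk≤w with enum-ok (suc k) (s≤s z≤n) sk≤w
  ... | enum⊆ , ⊆enum , _ with ⊆enum _ (proj₂ (nonempty (suc k) sk≤w))
  ... | τ∈enum with lookupM-modT (enum (suc k)) _ (nonempty-length τ∈enum)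
    where
    nonempty-length : ∀ {A : Set} {P : A → Set} {xs : List A} → Any.Any P xs → 0 < length xs
    nonempty-length {xs = _ ∷ _} _ = s≤s z≤n
  ... | τ , eq , τ∈ = τ , eq , enum⊆ τ (Any.map (λ { refl _ → refl }) τ∈)

  fewer-elements : ∀ {k} (t₀ : Vec Elem k) → Injective _≡_ _≡_ (lookup t₀) → ∀ {R} (s : Vec (Fin k ⊎ Fin nC) (ar R)) →
                   isFull σ (R , s) ≡ false → ∀ {l} (t : Vec Elem l) → Increasing t →
                   Enumerates t (Vec.map (map₁ (lookup t₀)) s) → l < k
  fewer-elements {suc k} t₀ t₀-inj s not-full t inc (to , _) with missing-variable σ not-full
  ... | j , j∉s = s≤s (Fin.injective⇒≤ g-injective)
    where
    in-t₀ : ∀ i → ∃ λ i₀ → inj₁ i₀ ∈ s × lookup t i ≡ lookup t₀ i₀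
    in-t₀ i with ∈ᵥ-map⁻ (map₁ (lookup t₀)) (to (∈-lookup i t))
    ... | inj₁ i₀ , i₀∈ , eq = i₀ , i₀∈ , Sum.inj₁-injective eq
    f : Fin _ → Fin (suc k)
    f i = proj₁ (in-t₀ i)
    j≢f : ∀ i → j ≢ f i
    j≢f i j≡ = j∉s (subst (λ i₀ → inj₁ i₀ ∈ s) (sym j≡) (proj₁ (proj₂ (in-t₀ i))))
    g-injective : Injective _≡_ _≡_ (λ i → Fin.punchOut (j≢f i))
    g-injective {i} {i′} eq = increasing-injective t inc
      (trans (proj₂ (proj₂ (in-t₀ i))) (trans (cong (lookup t₀) (Fin.punchOut-injective (j≢f i) (j≢f i′) eq))
                                              (sym (proj₂ (proj₂ (in-t₀ i′))))))

  tp-settled : ∀ k (t : Vec Elem (suc k)) {τ} → Increasing t → suc k ≤ wd σ → hashType t ≡ just τ →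
               compatibleᵇ σ τ (tp σ (stage k) (lookup t)) ≡ true → tp σ 𝔅 (lookup t) ≗ τ
  tp-settled k t {τ} inc sk≤w hash≡ compatible (R , s) with isFull σ (R , s) in full
  ... | true = begin
    factAt (wd σ) R v                    ≡⟨ fact-after R v inc t-enumerates (wd σ) sk≤w ⟩
    factAt (suc k) R v                   ≡⟨ stage-updates k R v inc t-enumerates hash≡ (pull-map t t-inj s) ⟩
    update (stage k) R v t τ s           ≡⟨ cong (if_then τ (R , s) else factAt k R v) compatible ⟩
    τ (R , s)                            ∎
    where
    open ≡-Reasoning
    v = Vec.map (map₁ (lookup t)) s
    t-inj : Injective _≡_ _≡_ (lookup t)
    t-inj = increasing-injective t inc
    t-enumerates : Enumerates t v
    t-enumerates = pull-full⇒enumerates t v (pull-map t t-inj s) full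
  ... | false = begin
    factAt (wd σ) R v    ≡⟨ stable-from R v k untouched (wd σ) (ℕ.≤-trans (ℕ.n≤1+n k) sk≤w) ⟩
    factAt k R v         ≡⟨ Equivalence.to (compatibleᵇ⇔ σ {τ = τ} {τ′ = tp σ (stage k) (lookup t)}) compatible (R , s) full ⟨
    τ (R , s)            ∎
    where
    open ≡-Reasoning
    v = Vec.map (map₁ (lookup t)) s
    untouched : ∀ n → k ≤ n → ∀ (t′ : Vec Elem (suc n)) → Increasing t′ → ¬ Enumerates t′ v
    untouched n k≤n t′ inc′ enum′ =
      ℕ.<-irrefl refl (ℕ.≤-trans (fewer-elements t (increasing-injective t inc) s full t′ inc′ enum′) (s≤s k≤n))

  DistinctRows : ∀ {n} → (Fin n → Elem) → Set
  DistinctRows ā = Injective _≡_ _≡_ (proj₁ ∘ ā)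

  covered-type∈ : ∀ {n k} (ā : Fin n → Elem) → Injective _≡_ _≡_ ā → (t : Vec Elem (suc k)) → Increasing t →
                  suc k ≤ wd σ → ∀ {τ} → _∈ᵗ_ σ τ (τs (suc k)) → tp σ 𝔅 (lookup t) ≗ τ → (∀ i → ā i ∈ t) →
                  _∈ᵗ_ σ (tp σ 𝔅 ā) (τs n) × DistinctRows ā
  covered-type∈ ā ā-inj t inc sk≤w τ∈ tp-t ā⊆t =
    ∈ᵗ-resp-≗ σ (λ a → sym (trans (tp-reindex σ 𝔅 π ā≡ a) (tp-t _))) (closed _ _ sk≤w _ τ∈ π π-injective) ,
    λ eq → π-injective (increasing-rows-injective t inc (trans (cong row (sym (ā≡ _))) (trans (cong toℕ eq) (cong row (ā≡ _)))))
    where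
    π : Fin _ → Fin _
    π i = index (ā⊆t i)
    ā≡ : ā ≗ lookup t ∘ π
    ā≡ i = VAny.lookup-index (ā⊆t i)
    π-injective : Injective _≡_ _≡_ π
    π-injective eq = ā-inj (trans (ā≡ _) (trans (cong (lookup t) eq) (sym (ā≡ _))))

  singleton-compatible : ∀ (a : Elem) {τ} → _∈ᵗ_ σ τ (τs 1) → compatibleᵇ σ τ (tp σ (stage 0) (lookup (a ∷ []))) ≡ true
  singleton-compatible a {τ} τ∈ = Equivalence.from (compatibleᵇ⇔ σ) interior
    where
    interior : Compatible σ τ (tp σ (stage 0) (lookup (a ∷ [])))
    interior (R , s) not-full with missing-variable σ not-full
    ... | Fin.zero , x∉s with shape-without-variables s (λ { Fin.zero → x∉s })
    ... | s′ , s≡ = subst (λ s → τ (R , s) ≡ tp σ (stage 0) (lookup (a ∷ [])) (R , s)) (sym s≡) (begin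
      τ (R , Vec.map (map₁ (λ ())) s′)                       ≡⟨ constant-facts σ τs closed consistent τ∈ (1≤wd σ) R s′ ⟩
      τ₀ consistent (R , s′)                                 ≡⟨ fact₀-constants consistent R s′ ⟨
      factAt 0 R (Vec.map (map₁ (lookup [])) s′)             ≡⟨ cong (factAt 0 R) (sym (map-map₁ (λ ()) s′)) ⟩
      tp σ (stage 0) (lookup (a ∷ [])) (R , Vec.map (map₁ (λ ())) s′) ∎)
      where open ≡-Reasoning

  fact-source : ∀ R v n → factAt n R v ≡ true → factAt 0 R v ≡ false →
                ∃ λ k → ∃ λ (t : Vec Elem (suc k)) → Increasing t × Enumerates t v
  fact-source R v zero    fact≡ fact₀≡ = ⊥-elim (true≢false (trans (sym fact≡) fact₀≡))
    where
    true≢false : true ≢ false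
    true≢false ()
  fact-source R v (suc n) fact≡ fact₀≡ with stage-untouched n R v
  ... | inj₁ same = fact-source R v n (trans (sym same) fact≡) fact₀≡
  ... | inj₂ (t , inc , enum) = n , t , inc , enum

  occurs : ∀ {n} (ā : Fin n → Elem) {R} {s : Vec (Fin n ⊎ Fin nC) (ar R)} → isFull σ (R , s) ≡ true →
           ∀ i → inj₁ (ā i) ∈ Vec.map (map₁ ā) s
  occurs ā full i = ∈-map⁺ (map₁ ā) (Equivalence.to (isFull⇔ σ) full i)

  𝔅-guarded : ∀ {n} (ā : Fin n → Elem) → Injective _≡_ _≡_ ā → Guarded σ (tp σ 𝔅 ā) →
              _∈ᵗ_ σ (tp σ 𝔅 ā) (τs n) × DistinctRows ā
  𝔅-guarded {zero} ā _ _ = ∈ᵗ-resp-≗ σ (sym ∘ tp≗τ₀) (proj₂ (proj₂ (initialType σ τs consistent))) , λ { {()} }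
    where
    tp≗τ₀ : tp σ 𝔅 ā ≗ τ₀ consistent
    tp≗τ₀ (R , s) =
      trans (fact-without-elements R _ no-element (wd σ))
            (trans (cong (factAt 0 R) (Vec.map-cong (Sum.map₁-cong (λ ())) s)) (fact₀-constants consistent R s))
      where
      no-element : ∀ x → ¬ inj₁ x ∈ Vec.map (map₁ ā) s
      no-element x x∈ with ∈ᵥ-map⁻ (map₁ ā) x∈
      ... | inj₁ () , _
  𝔅-guarded {suc zero} ā ā-inj (inj₁ _) with hashType-defined (ā Fin.zero ∷ []) (1≤wd σ)
  ... | τ , hash≡ , τ∈ =
    covered-type∈ ā ā-inj (ā Fin.zero ∷ []) _ (1≤wd σ) τ∈
      (tp-settled 0 (ā Fin.zero ∷ []) _ (1≤wd σ) hash≡ (singleton-compatible (ā Fin.zero) τ∈)) λ { Fin.zero → here refl }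
  𝔅-guarded {suc (suc n)} ā ā-inj (inj₁ (s≤s ()))
  𝔅-guarded {suc n} ā ā-inj (inj₂ ((R , s) , full , fact≡))
    with fact-source R (Vec.map (map₁ ā) s) (wd σ) fact≡ (fact₀-element R _ (occurs ā {R} {s} full Fin.zero))
  ... | k , t , inc , t-enumerates
    with hashType-defined t (increasing-length≤wd t inc) | pull-complete t (Vec.map (map₁ ā) s) (proj₂ t-enumerates)
  ... | τ , hash≡ , τ∈ | s₀ , pull≡ with compatibleᵇ σ τ (tp σ (stage k) (lookup t)) in compatible
  ... | true  = covered-type∈ ā ā-inj t inc (increasing-length≤wd t inc) τ∈
                  (tp-settled k t inc (increasing-length≤wd t inc) hash≡ compatible) (proj₂ t-enumerates ∘ occurs ā {R} {s} full)
  ... | false = ⊥-elim (false≢true (begin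
    false                          ≡⟨ fact₀-element R v (occurs ā {R} {s} full Fin.zero) ⟨
    factAt 0 R v                   ≡⟨ fact-before R v inc t-enumerates k (ℕ.n<1+n k) ⟨
    factAt k R v                   ≡⟨ cong (if_then τ (R , s₀) else factAt k R v) compatible ⟨
    update (stage k) R v t τ s₀    ≡⟨ stage-updates k R v inc t-enumerates hash≡ pull≡ ⟨
    factAt (suc k) R v             ≡⟨ fact-after R v inc t-enumerates (wd σ) (increasing-length≤wd t inc) ⟨
    factAt (wd σ) R v              ≡⟨ fact≡ ⟩
    true                           ∎))
    where
    open ≡-Reasoning
    v : Vec Dom′ (ar R)
    v = Vec.map (map₁ ā) s
    false≢true : false ≢ true
    false≢true ()

module Rows where

  open import Data.List.Membership.Propositional using () renaming (_∈_ to _∈ₗ_)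
  open import Data.Bool using (Bool; T)
  open import Data.Empty using (⊥-elim)
  open import Data.Fin using (Fin; toℕ)
  import Data.Fin as Fin
  import Data.Fin.Properties as Fin
  open import Data.List using (List; []; _∷_; filter)
  import Data.List as List
  import Data.List.Relation.Unary.All as All
  open import Data.List.Relation.Unary.AllPairs using (AllPairs; []; _∷_)
  import Data.List.Relation.Unary.AllPairs as AllPairs
  import Data.List.Relation.Unary.AllPairs.Properties as AllPairs
  open import Data.List.Relation.Unary.Any using (here; there)
  open import Data.List.Membership.Propositional.Properties using (∈-filter⁺; ∈-filter⁻)
  open import Data.Nat using (ℕ; zero; suc; _+_; _≤_; _<_; z≤n; s≤s)
  import Data.Nat.Properties as ℕ
  open import Data.Product using (∃; _×_; _,_; proj₁; proj₂)
  open import Data.Sum using (inj₁; inj₂)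
  open import Function using (_∘_)
  open import Function.Definitions using (Injective)
  open import Relation.Binary.PropositionalEquality
  open import Relation.Nullary using (yes; no; ¬?)
  open import Relation.Nullary.Decidable using (T?)

  open TypeLemmas

  module _ (σ : Signature) where

    free-row : ∀ {k} {A : Set} (ā : Fin k → Fin (wd σ) × A) → Injective _≡_ _≡_ (proj₁ ∘ ā) → k < wd σ →
               ∃ λ α → ∀ i → proj₁ (ā i) ≢ α
    free-row {k} ā rows-inj k<w with Fin.any? (λ α → Fin.all? (λ i → ¬? (proj₁ (ā i) Fin.≟ α)))
    ... | yes free = free
    ... | no ¬free = ⊥-elim (ℕ.<⇒≱ k<w (Fin.injective⇒≤ preimage-injective))
      where
      preimage : ∀ α → ∃ λ i → proj₁ (ā i) ≡ α
      preimage α with Fin.any? (λ i → proj₁ (ā i) Fin.≟ α)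
      ... | yes hit = hit
      ... | no miss = ⊥-elim (¬free (α , λ i eq → miss (i , eq)))
      preimage-injective : Injective _≡_ _≡_ (proj₁ ∘ preimage)
      preimage-injective {α} {α′} eq = trans (sym (proj₂ (preimage α))) (trans (cong (proj₁ ∘ ā) eq) (proj₂ (preimage α′)))

  module SortedByRow {w K : ℕ} (rw : Fin K → Fin w) (rw-injective : Injective _≡_ _≡_ rw) where

    row< : Fin K → Fin K → Set
    row< u v = toℕ (rw u) < toℕ (rw v)

    scan : ℕ → ℕ → List (Fin K)
    scan r zero    = []
    scan r (suc d) with Fin.any? (λ u → toℕ (rw u) ℕ.≟ r)
    ... | yes (u , _) = u ∷ scan (suc r) d
    ... | no _        = scan (suc r) d

    scan-sound-step : ∀ r d {u} → suc r ≤ toℕ (rw u) × toℕ (rw u) < suc r + d → r ≤ toℕ (rw u) × toℕ (rw u) < r + suc d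
    scan-sound-step r d {u} (r<u , u<r+d) = ℕ.<⇒≤ r<u , subst (λ z → toℕ (rw u) < z) (sym (ℕ.+-suc r d)) u<r+d

    scan-sound : ∀ r d {u} → u ∈ₗ scan r d → r ≤ toℕ (rw u) × toℕ (rw u) < r + d
    scan-sound r (suc d) u∈ with Fin.any? (λ u → toℕ (rw u) ℕ.≟ r)
    scan-sound r (suc d) (here refl) | yes (_ , refl) = ℕ.≤-refl , ℕ.m<m+n _ (s≤s z≤n)
    scan-sound r (suc d) {u} (there u∈)  | yes _ = scan-sound-step r d (scan-sound (suc r) d u∈)
    scan-sound r (suc d) {u} u∈          | no _  = scan-sound-step r d (scan-sound (suc r) d u∈)

    scan-complete : ∀ r d u → r ≤ toℕ (rw u) → toℕ (rw u) < r + d → u ∈ₗ scan r d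
    scan-complete r zero    u r≤u u<r = ⊥-elim (ℕ.<⇒≱ u<r (subst (_≤ toℕ (rw u)) (sym (ℕ.+-identityʳ r)) r≤u))
    scan-complete r (suc d) u r≤u u<r+d with Fin.any? (λ u → toℕ (rw u) ℕ.≟ r) | ℕ.m≤n⇒m<n∨m≡n r≤u
    ... | yes (u′ , u′≡r) | inj₂ r≡u = here (rw-injective (Fin.toℕ-injective (trans (sym r≡u) (sym u′≡r))))
    ... | yes _           | inj₁ r<u = there (scan-complete (suc r) d u r<u (subst (toℕ (rw u) <_) (ℕ.+-suc r d) u<r+d))
    ... | no none         | inj₂ r≡u = ⊥-elim (none (u , sym r≡u))
    ... | no _            | inj₁ r<u = scan-complete (suc r) d u r<u (subst (toℕ (rw u) <_) (ℕ.+-suc r d) u<r+d)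

    scan-sorted : ∀ r d → AllPairs row< (scan r d)
    scan-sorted r zero = []
    scan-sorted r (suc d) with Fin.any? (λ u → toℕ (rw u) ℕ.≟ r)
    ... | yes (u , u≡r) = All.tabulate (λ v∈ → subst (_< _) (sym u≡r) (proj₁ (scan-sound (suc r) d v∈))) ∷ scan-sorted (suc r) d
    ... | no _          = scan-sorted (suc r) d

    byRow : List (Fin K)
    byRow = scan 0 w

    ∈-byRow : ∀ u → u ∈ₗ byRow
    ∈-byRow u = scan-complete 0 w u z≤n (Fin.toℕ<n (rw u))

    select : (Fin K → Bool) → List (Fin K)
    select S = filter (T? ∘ S) byRow

    select-sorted : ∀ S → AllPairs row< (select S)
    select-sorted S = AllPairs.filter⁺ (T? ∘ S) (scan-sorted 0 w)

    ∈-select⁺ : ∀ {S u} → T (S u) → u ∈ₗ select S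
    ∈-select⁺ {S} {u} Su = ∈-filter⁺ (T? ∘ S) (∈-byRow u) Su

    ∈-select⁻ : ∀ {S u} → u ∈ₗ select S → T (S u)
    ∈-select⁻ {S} u∈ = proj₂ (∈-filter⁻ (T? ∘ S) {xs = byRow} u∈)

    rows-sorted : ∀ (P : List (Fin K)) → AllPairs row< P → AllPairs _<_ (List.map (toℕ ∘ rw) P)
    rows-sorted P sorted = AllPairs.map⁺ sorted

module HashingExtension (σ : Signature) (τs : TypeFamily σ) (p : ℕ → ℕ) (enum : TypeFamily σ)
                        (closed : Closed σ τs) (consistent : Consistent σ τs) (nonempty : Nonempty σ τs)
                        (enum-ok : ∀ k → 1 ≤ k → k ≤ wd σ → IsEnumeration σ (τs k) (enum k))
                        (primes : PrimeHyps σ p) where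
  open import Data.List.Membership.Propositional using () renaming (_∈_ to _∈ₗ_)
  open import Data.Bool using (Bool; true; false; T; if_then_else_)
  open import Data.Empty using (⊥-elim)
  open import Data.Fin using (Fin; toℕ; fromℕ; fromℕ<; inject₁)
  open import Data.Fin.Relation.Unary.Top using (view; ‵fromℕ; ‵inject₁)
  import Data.Fin as Fin
  import Data.Fin.Properties as Fin
  open import Data.List using (List; []; _∷_; length; applyUpTo)
  import Data.List as List
  import Data.List.Properties as List
  open import Data.List.Relation.Unary.All using ([]; _∷_)
  import Data.List.Relation.Unary.All as All
  import Data.List.Relation.Unary.All.Properties as AllProps
  open import Data.List.Relation.Unary.AllPairs using (AllPairs; []; _∷_)
  import Data.List.Relation.Unary.AllPairs as AllPairs
  import Data.List.Relation.Unary.AllPairs.Properties as AllPairs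
  open import Data.List.Relation.Unary.Any using (here; there)
  open import Data.List.Relation.Unary.Any.Properties using (lookup-index)
  import Data.List.Relation.Unary.Any as Any
  open import Data.List.Membership.Propositional.Properties using (∈-map⁺; ∈-applyUpTo⁺; ∈-applyUpTo⁻)
  open import Data.Maybe using (Maybe; just; nothing)
  import Data.Maybe
  open import Data.Nat using (ℕ; zero; suc; pred; _+_; _∸_; _^_; _≤_; _<_; _%_; z≤n; s≤s)
  import Data.Nat.Properties as ℕ
  import Data.Nat.DivMod as ℕ
  open import Data.Nat.ListAction using (sum; product)
  open import Data.Nat.Primality using (Prime; prime⇒nonZero)
  open import Data.Nat.Coprimality using (Coprime; prime⇒coprime)
  import Data.Nat.Coprimality as Coprime
  open import Data.Product using (Σ-syntax; ∃; _×_; _,_; proj₁; proj₂)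
  open import Data.Sum using (_⊎_; inj₁; inj₂; map₁)
  import Data.Sum.Properties as Sum
  open import Data.Vec using (Vec; []; _∷_; lookup; toList; fromList; tabulate)
  import Data.Vec as Vec
  import Data.Vec.Properties as Vec
  import Data.Vec.Relation.Unary.All as VAll
  open import Data.Vec.Membership.Propositional using (_∈_)
  open import Data.Vec.Membership.Propositional.Properties using (∈-fromList⁺; ∈-fromList⁻)
  import Data.Vec.Membership.Propositional.Properties
  import Data.Vec.Membership.DecPropositional as VecDec
  open import Function using (_∘_; Equivalence)
  open import Function.Definitions using (Injective)
  open import Relation.Binary.PropositionalEquality
  open import Relation.Nullary using (¬_; yes; no; does)

  open TypeLemmas
  open Admissibility using (Admissible)
  open Arithmetic
  open Rows
  open Signature σ
  open Hashing σ τs p enum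
  open HashingStages σ τs p enum
  open HashingGuarded σ τs p enum closed consistent nonempty enum-ok

  N : ℕ
  N = 2 ^ wd σ ∸ 1

  InRange : ℕ → Set
  InRange i = 1 ≤ i × i ≤ N

  p-prime : ∀ {i} → InRange i → Prime (p i)
  p-prime (1≤i , i≤N) = proj₁ primes _ 1≤i i≤N

  p≡suc : ∀ {i} → InRange i → p i ≡ suc (pred (p i))
  p≡suc {i} i∈ with p i | prime⇒nonZero (p-prime i∈)
  ... | suc _ | _ = refl

  p-increasing : ∀ {i j} → 1 ≤ i → i < j → j ≤ N → p i < p j
  p-increasing {i} {suc j} 1≤i (s≤s i≤j) j<N with ℕ.m≤n⇒m<n∨m≡n i≤j
  ... | inj₂ refl = proj₂ (proj₂ primes) i 1≤i j<N
  ... | inj₁ i<j  = ℕ.<-trans (p-increasing 1≤i i<j (ℕ.≤-trans (ℕ.n≤1+n j) j<N))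
                             (proj₂ (proj₂ primes) j (ℕ.≤-trans 1≤i (ℕ.<⇒≤ i<j)) j<N)

  p₁≤p : ∀ {i} → InRange i → p 1 ≤ p i
  p₁≤p {suc zero}    _           = ℕ.≤-refl
  p₁≤p {suc (suc i)} (_ , i≤N) = ℕ.<⇒≤ (p-increasing (s≤s z≤n) (s≤s (s≤s z≤n)) i≤N)

  enum-length≤p : ∀ {l i} → 1 ≤ l → l ≤ wd σ → InRange i → length (enum l) ≤ p i
  enum-length≤p {l} 1≤l l≤w i∈ = begin
    length (enum l)    ≤⟨ length-distinct-types σ (enum l) (proj₂ (proj₂ (enum-ok l 1≤l l≤w))) ⟩
    numTypes σ l       ≤⟨ numTypes-mono σ l≤w ⟩
    numTypes σ (wd σ)  ≤⟨ proj₁ (proj₂ primes) ⟩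
    p 1                ≤⟨ p₁≤p i∈ ⟩
    p _                ∎
    where open ℕ.≤-Reasoning

  indices : List ℕ
  indices = applyUpTo suc N

  ∈-indices⁻ : ∀ {i} → i ∈ₗ indices → InRange i
  ∈-indices⁻ i∈ with ∈-applyUpTo⁻ suc i∈
  ... | _ , i<N , refl = s≤s z≤n , i<N

  ∈-indices⁺ : ∀ {i} → InRange i → i ∈ₗ indices
  ∈-indices⁺ {suc i} (_ , i<N) = ∈-applyUpTo⁺ suc i<N

  indices-coprime : AllPairs (λ i j → Coprime (suc (pred (p i))) (suc (pred (p j)))) indices
  indices-coprime = AllPairs.applyUpTo⁺₁ suc N λ {i} {j} i<j j<N →
    let i∈ = (s≤s z≤n , ℕ.<-trans i<j j<N) ; j∈ = (s≤s z≤n , j<N) in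
    subst₂ Coprime (p≡suc i∈) (p≡suc j∈)
      (Coprime.sym (prime⇒coprime (p-prime j∈) {{prime⇒nonZero (p-prime i∈)}} (p-increasing (s≤s z≤n) (s≤s i<j) j<N)))

  product-indices : product (List.map (suc ∘ pred ∘ p) indices) ≡ M
  product-indices = cong product (List.map-cong-local (All.tabulate (λ i∈ → sym (p≡suc (∈-indices⁻ i∈)))))

  position : ∀ {l} → KType σ l → List (KType σ l) → ℕ
  position τ xs with Any.any? (_≟ᵗ_ σ τ) xs
  ... | yes τ∈ = toℕ (Any.index τ∈)
  ... | no _   = 0

  position-correct : ∀ {l} {τ : KType σ l} {xs} → _∈ᵗ_ σ τ xs →
                     position τ xs < length xs × ∃ λ τ′ → lookupM σ xs (position τ xs) ≡ just τ′ × τ ≗ τ′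
  position-correct {τ = τ} {xs} τ∈ with Any.any? (_≟ᵗ_ σ τ) xs
  ... | yes τ∈′ = Fin.toℕ<n _ , _ , lookupM-lookup σ xs _ , lookup-index τ∈′
  ... | no τ∉   = ⊥-elim (τ∉ τ∈)

  module Extension {k} (sk≤w : suc k ≤ wd σ) {τ₁ : KType σ k} {τ₂ : KType σ (suc k)}
                   (τ₂∈ : _∈ᵗ_ σ τ₂ (τs (suc k))) (τ₁⊆τ₂ : _⊆ᵗ_ σ τ₁ τ₂)
                   (ā : Fin k → Elem) (ā-injective : Injective _≡_ _≡_ ā) (ā-rows : DistinctRows ā)
                   (tp-ā : tp σ 𝔅 ā ≗ τ₁) where

    last : Fin (suc k)
    last = fromℕ k

    abstract
      α : Fin (wd σ)
      α = proj₁ (free-row σ ā ā-rows sk≤w)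

      α-free : ∀ i → proj₁ (ā i) ≢ α
      α-free = proj₂ (free-row σ ā ā-rows sk≤w)

    rw : Fin (suc k) → Fin (wd σ)
    rw = snoc σ (proj₁ ∘ ā) α

    rw-injective : Injective _≡_ _≡_ rw
    rw-injective = snoc-injective σ (proj₁ ∘ ā) α ā-rows (λ i → α-free i ∘ sym)

    open SortedByRow rw rw-injective

    Subset : Set
    Subset = Vec Bool (suc k)

    members : Subset → List (Fin (suc k))
    members m = select (lookup m)

    rowIndex : List (Fin (suc k)) → ℕ
    rowIndex P = powerSum (List.map (toℕ ∘ rw) P)

    members-injective : ∀ m m′ → rowIndex (members m) ≡ rowIndex (members m′) → members m ≡ members m′
    members-injective m m′ eq =
      List.map-injective (rw-injective ∘ Fin.toℕ-injective)
        (powerSum-injective _ _ (rows-sorted _ (select-sorted _)) (rows-sorted _ (select-sorted _)) eq)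

    oldβ : Fin (suc k) → ℕ
    oldβ = snoc σ (toℕ ∘ proj₂ ∘ ā) 0

    offset : List (Fin (suc k)) → ℕ
    offset P = sum (List.map oldβ P)

    τ₂∣ : (P : List (Fin (suc k))) → KType σ (length P)
    τ₂∣ P = restrict σ τ₂ (lookup (fromList P))

    -- If y ≡ residue P i (mod p i), then (offset P + y) mod p i is the position of τ₂∣ P in enum (length P).
    residue : List (Fin (suc k)) → ℕ → ℕ
    residue P i = position (τ₂∣ P) (enum (length P)) + (p i ∸ modT σ (offset P) (p i))

    subsets : List Subset
    subsets = allVecs σ (true ∷ false ∷ []) (suc k)

    withIndex : ℕ → List Subset → Maybe Subset
    withIndex i []       = nothing
    withIndex i (m ∷ ms) with rowIndex (members m) ℕ.≟ i
    ... | yes _ = just m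
    ... | no _  = withIndex i ms

    -- The row index determines the set of positions (members-injective), so the residues
    -- requested for different sets never conflict.
    residueAt : ℕ → ℕ
    residueAt i = Data.Maybe.maybe (λ m → residue (members m) i) 0 (withIndex i subsets)

    residueAt-members : ∀ m → residueAt (rowIndex (members m)) ≡ residue (members m) (rowIndex (members m))
    residueAt-members m₀ = go subsets (allVecs-complete σ m₀ (VAll.universal bool∈ m₀))
      where
      bool∈ : ∀ b → b ∈ₗ true ∷ false ∷ []
      bool∈ true  = here refl
      bool∈ false = there (here refl)
      go : ∀ ms → m₀ ∈ₗ ms → Data.Maybe.maybe (λ m → residue (members m) (rowIndex (members m₀))) 0
                                (withIndex (rowIndex (members m₀)) ms) ≡ residue (members m₀) (rowIndex (members m₀))
      go (m ∷ ms) m₀∈ with rowIndex (members m) ℕ.≟ rowIndex (members m₀)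
      ... | yes eq = cong (λ P → residue P (rowIndex (members m₀))) (members-injective m m₀ eq)
      go (m ∷ ms) (here refl) | no neq = ⊥-elim (neq refl)
      go (m ∷ ms) (there m₀∈) | no _   = go ms m₀∈

    abstract
      y : ℕ
      y = proj₁ (chinese-remainder (pred ∘ p) residueAt indices indices-coprime)

      y<M : y < M
      y<M = subst (y <_) product-indices (proj₁ (proj₂ (chinese-remainder (pred ∘ p) residueAt indices indices-coprime)))

      y-residue : ∀ {i} → InRange i → y % suc (pred (p i)) ≡ residueAt i % suc (pred (p i))
      y-residue i∈ = All.lookup (proj₂ (proj₂ (chinese-remainder (pred ∘ p) residueAt indices indices-coprime))) (∈-indices⁺ i∈)

    b : Elem
    b = α , fromℕ< y<M

    c : Fin (suc k) → Elem
    c = snoc σ ā b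

    c-rows : proj₁ ∘ c ≗ rw
    c-rows = snoc-map σ proj₁ ā b

    b∉ā : ∀ i → b ≢ ā i
    b∉ā i eq = α-free i (sym (cong proj₁ eq))

    c-distinct-rows : DistinctRows c
    c-distinct-rows eq = rw-injective (trans (sym (c-rows _)) (trans eq (c-rows _)))

    tupleOf : (P : List (Fin (suc k))) → Vec Elem (length P)
    tupleOf P = Vec.map c (fromList P)

    toList-tupleOf : ∀ P → toList (tupleOf P) ≡ List.map c P
    toList-tupleOf P = trans (Vec.toList-map c (fromList P)) (cong (List.map c) (Vec.toList∘fromList P))

    tupleOf-increasing : ∀ P → AllPairs row< P → Increasing (tupleOf P)
    tupleOf-increasing []      _               = _
    tupleOf-increasing (u ∷ P) (u<P ∷ sorted) = increasing-cons (c u) (tupleOf P) (tupleOf-increasing P sorted) below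
      where
      below : ∀ {e} → e ∈ tupleOf P → row (c u) < row e
      below e∈ with ∈ᵥ-map⁻ c e∈
      ... | v , v∈ , refl = subst₂ _<_ (cong toℕ (sym (c-rows u))) (cong toℕ (sym (c-rows v)))
                                   (All.lookup u<P (∈-fromList⁻ v∈))

    rowIndex-tupleOf : ∀ P → sum (List.map (λ e → 2 ^ toℕ (proj₁ e)) (toList (tupleOf P))) ≡ rowIndex P
    rowIndex-tupleOf P = cong sum (begin
      List.map (λ e → 2 ^ toℕ (proj₁ e)) (toList (tupleOf P))  ≡⟨ cong (List.map _) (toList-tupleOf P) ⟩
      List.map (λ e → 2 ^ toℕ (proj₁ e)) (List.map c P)        ≡⟨ List.map-∘ P ⟨
      List.map (λ u → 2 ^ toℕ (proj₁ (c u))) P                 ≡⟨ List.map-cong (λ u → cong (λ α → 2 ^ toℕ α) (c-rows u)) P ⟩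
      List.map (λ u → 2 ^ toℕ (rw u)) P                        ≡⟨ List.map-∘ P ⟩
      List.map (2 ^_) (List.map (toℕ ∘ rw) P)                  ∎)
      where open ≡-Reasoning

    βsum-tupleOf : ∀ P → AllPairs _≢_ P → last ∈ₗ P → sum (List.map (toℕ ∘ proj₂) (toList (tupleOf P))) ≡ offset P + y
    βsum-tupleOf P distinct last∈ = begin
      sum (List.map (toℕ ∘ proj₂) (toList (tupleOf P)))   ≡⟨ cong (sum ∘ List.map _) (toList-tupleOf P) ⟩
      sum (List.map (toℕ ∘ proj₂) (List.map c P))         ≡⟨ cong sum (List.map-∘ P) ⟨
      sum (List.map (toℕ ∘ proj₂ ∘ c) P)                  ≡⟨ cong sum (List.map-cong β-c P) ⟩
      sum (List.map (snoc σ (toℕ ∘ proj₂ ∘ ā) y) P)       ≡⟨ sum-with-last P distinct last∈ ⟩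
      offset P + y                                        ∎
      where
      open ≡-Reasoning
      β-c : ∀ u → toℕ (proj₂ (c u)) ≡ snoc σ (toℕ ∘ proj₂ ∘ ā) y u
      β-c u = trans (snoc-map σ (toℕ ∘ proj₂) ā b u) (cong (λ z → snoc σ (toℕ ∘ proj₂ ∘ ā) z u) (Fin.toℕ-fromℕ< y<M))
      snoc-old : ∀ x u → u ≢ last → snoc σ (toℕ ∘ proj₂ ∘ ā) x u ≡ oldβ u
      snoc-old x u u≢last with view u
      ... | ‵inject₁ j = trans (snoc-inject₁ σ _ x j) (sym (snoc-inject₁ σ _ 0 j))
      ... | ‵fromℕ     = ⊥-elim (u≢last refl)
      sum-without-last : ∀ Q → ¬ last ∈ₗ Q → sum (List.map (snoc σ (toℕ ∘ proj₂ ∘ ā) y) Q) ≡ offset Q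
      sum-without-last []      _       = refl
      sum-without-last (u ∷ Q) last∉ = cong₂ _+_ (snoc-old y u (λ u≡ → last∉ (here (sym u≡)))) (sum-without-last Q (last∉ ∘ there))
      sum-with-last : ∀ Q → AllPairs _≢_ Q → last ∈ₗ Q → sum (List.map (snoc σ (toℕ ∘ proj₂ ∘ ā) y) Q) ≡ offset Q + y
      sum-with-last (u ∷ Q) (u∉Q ∷ _) (here refl) = begin
        snoc σ _ y last + sum (List.map _ Q)  ≡⟨ cong₂ _+_ (snoc-last σ (toℕ ∘ proj₂ ∘ ā) y)
                                                   (sum-without-last Q (λ last∈ → All.lookup u∉Q last∈ refl)) ⟩
        y + offset Q                          ≡⟨ ℕ.+-comm y _ ⟩
        offset Q + y                          ≡⟨ cong (λ z → z + offset Q + y) (snoc-last σ (toℕ ∘ proj₂ ∘ ā) 0) ⟨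
        oldβ last + offset Q + y              ∎
      sum-with-last (u ∷ Q) (u∉Q ∷ distinct) (there last∈) with u Fin.≟ last
      ... | yes refl = ⊥-elim (All.lookup u∉Q last∈ refl)
      ... | no u≢last = trans (cong₂ _+_ (snoc-old y u u≢last) (sum-with-last Q distinct last∈)) (sym (ℕ.+-assoc (oldβ u) _ y))

    members-lookup-injective : ∀ m → Injective _≡_ _≡_ (lookup (fromList (members m)))
    members-lookup-injective m {i} {j} eq =
      increasing-injective (tupleOf P) (tupleOf-increasing P (select-sorted (lookup m)))
        (trans (Vec.lookup-map i c (fromList P)) (trans (cong c eq) (sym (Vec.lookup-map j c (fromList P)))))
      where
      P : List (Fin (suc k))
      P = members m

    rowIndex-inRange : ∀ m → last ∈ₗ members m → InRange (rowIndex (members m))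
    rowIndex-inRange m last∈ = positive (members m) last∈ , ℕ.m+n≤o⇒m≤o∸n _ bound
      where
      positive : ∀ P → last ∈ₗ P → 1 ≤ rowIndex P
      positive (u ∷ P) _ = ℕ.≤-trans (ℕ.m^n>0 2 (toℕ (rw u))) (ℕ.m≤m+n _ _)
      bound : rowIndex (members m) + 2 ^ 0 ≤ 2 ^ wd σ
      bound = powerSum<2^ (rows-sorted _ (select-sorted (lookup m))) (All.universal (λ _ → z≤n) _)
                (AllProps.map⁺ (All.universal (λ u → Fin.toℕ<n (rw u)) (members m))) z≤n

    hashType-members : ∀ m → last ∈ₗ members m →
                       ∃ λ τ′ → hashType (tupleOf (members m)) ≡ just τ′ × τ₂∣ (members m) ≗ τ′
    hashType-members m last∈ = τ′ , hash≡ , τ₂∣≗τ′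
      where
      P : List (Fin (suc k))
      P = members m
      inc : Increasing (tupleOf P)
      inc = tupleOf-increasing P (select-sorted (lookup m))
      l≤w : length P ≤ wd σ
      l≤w = increasing-length≤wd (tupleOf P) inc
      1≤l : 1 ≤ length P
      1≤l = nonempty-length last∈
        where
        nonempty-length : ∀ {Q : List (Fin (suc k))} → last ∈ₗ Q → 1 ≤ length Q
        nonempty-length {_ ∷ _} _ = s≤s z≤n
      i∈ : InRange (rowIndex P)
      i∈ = rowIndex-inRange m last∈
      τ₂∣∈ : _∈ᵗ_ σ (τ₂∣ P) (enum (length P))
      τ₂∣∈ = proj₁ (proj₂ (enum-ok _ 1≤l l≤w)) _ (closed (suc k) (length P) sk≤w τ₂ τ₂∈ _ (members-lookup-injective m))
      j : ℕ
      j = position (τ₂∣ P) (enum (length P))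
      correct : j < length (enum (length P)) × ∃ λ τ′ → lookupM σ (enum (length P)) j ≡ just τ′ × τ₂∣ P ≗ τ′
      correct = position-correct τ₂∣∈
      τ′ : KType σ (length P)
      τ′ = proj₁ (proj₂ correct)
      τ₂∣≗τ′ : τ₂∣ P ≗ τ′
      τ₂∣≗τ′ = proj₂ (proj₂ (proj₂ correct))
      q : ℕ
      q = pred (p (rowIndex P))
      j<p : j < suc q
      j<p = subst (j <_) (p≡suc i∈) (ℕ.<-≤-trans (proj₁ correct) (enum-length≤p 1≤l l≤w i∈))
      y-target : y % suc q ≡ (j + (suc q ∸ (offset P) % suc q)) % suc q
      y-target = trans (y-residue i∈) (cong (_% suc q) (trans (residueAt-members m)
                   (cong (λ n → j + (n ∸ modT σ (offset P) n)) (p≡suc i∈))))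
      modT-p : ∀ X → modT σ X (p (rowIndex P)) ≡ X % suc q
      modT-p X = cong (modT σ X) (p≡suc i∈)
      hash≡ : hashType (tupleOf P) ≡ just τ′
      hash≡ = begin
        hashType (tupleOf P)
          ≡⟨ cong₂ (λ β i → lookupM σ (enum (length P)) (modT σ (modT σ β (p i)) (length (enum (length P)))))
                   (βsum-tupleOf P (AllPairs.map (λ u<v u≡v → ℕ.<-irrefl (cong (toℕ ∘ rw) u≡v) u<v) (select-sorted (lookup m))) last∈)
                   (rowIndex-tupleOf P) ⟩
        lookupM σ (enum (length P)) (modT σ (modT σ (offset P + y) (p (rowIndex P))) (length (enum (length P))))
          ≡⟨ cong (λ z → lookupM σ (enum (length P)) (modT σ z (length (enum (length P)))))
                  (trans (modT-p _) (+-%-shift q (offset P) y j y-target j<p)) ⟩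
        lookupM σ (enum (length P)) (modT σ j (length (enum (length P))))
          ≡⟨ cong (lookupM σ (enum (length P))) (modT-small (proj₁ correct)) ⟩
        lookupM σ (enum (length P)) j
          ≡⟨ proj₁ (proj₂ (proj₂ correct)) ⟩
        just τ′ ∎
        where
        open ≡-Reasoning
        modT-small : ∀ {a n} → a < n → modT σ a n ≡ a
        modT-small {n = suc _} a<n = ℕ.m<n⇒m%n≡m a<n

    occurs? : ∀ {r} → Vec (Fin (suc k) ⊎ Fin nC) r → Fin (suc k) → Bool
    occurs? s u = does (VecDec._∈?_ (decTerm σ) (inj₁ u) s)

    occurring : ∀ {r} → Vec (Fin (suc k) ⊎ Fin nC) r → Subset
    occurring s = tabulate (occurs? s)

    support : ∀ {r} → Vec (Fin (suc k) ⊎ Fin nC) r → List (Fin (suc k))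
    support s = members (occurring s)

    ∈-support⁺ : ∀ {r} {s : Vec (Fin (suc k) ⊎ Fin nC) r} {u} → inj₁ u ∈ s → u ∈ₗ support s
    ∈-support⁺ {s = s} {u} u∈ = ∈-select⁺ {S = lookup (occurring s)}
      (subst T (sym (Vec.lookup∘tabulate (occurs? s) u)) (does-complete (VecDec._∈?_ (decTerm σ) (inj₁ u) s) u∈))

    ∈-support⁻ : ∀ {r} {s : Vec (Fin (suc k) ⊎ Fin nC) r} {u} → u ∈ₗ support s → inj₁ u ∈ s
    ∈-support⁻ {s = s} {u} u∈ = does-sound (VecDec._∈?_ (decTerm σ) (inj₁ u) s)
      (subst T (Vec.lookup∘tabulate (occurs? s) u) (∈-select⁻ {S = lookup (occurring s)} u∈))

    image : ∀ {r} → Vec (Fin (suc k) ⊎ Fin nC) r → Vec Dom′ r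
    image = Vec.map (map₁ c)

    support-increasing : ∀ {r} (s : Vec (Fin (suc k) ⊎ Fin nC) r) → Increasing (tupleOf (support s))
    support-increasing s = tupleOf-increasing (support s) (select-sorted _)

    support-enumerates : ∀ {r} (s : Vec (Fin (suc k) ⊎ Fin nC) r) → Enumerates (tupleOf (support s)) (image s)
    support-enumerates s = to , from
      where
      to : ∀ {x} → x ∈ tupleOf (support s) → inj₁ x ∈ image s
      to x∈ with ∈ᵥ-map⁻ c x∈
      ... | u , u∈ , refl = Data.Vec.Membership.Propositional.Properties.∈-map⁺ (map₁ c) (∈-support⁻ (∈-fromList⁻ u∈))
      from : ∀ {x} → inj₁ x ∈ image s → x ∈ tupleOf (support s)
      from x∈ with ∈ᵥ-map⁻ (map₁ c) x∈
      ... | inj₁ u , u∈ , refl = Data.Vec.Membership.Propositional.Properties.∈-map⁺ c (∈-fromList⁺ (∈-support⁺ u∈))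

    fact-settled : ∀ n R (s : Vec (Fin (suc k) ⊎ Fin nC) (ar R)) {l} (t : Vec Elem l) → l ≡ suc n →
                   (π : Fin l → Fin (suc k)) → ∀ {τ′} → Increasing t → Enumerates t (image s) → lookup t ≗ c ∘ π →
                   hashType t ≡ just τ′ → restrict σ τ₂ π ≗ τ′ →
                   (∀ R′ (s′ : Vec (Fin (suc k) ⊎ Fin nC) (ar R′)) → length (support s′) ≤ n →
                      factAt n R′ (image s′) ≡ τ₂ (R′ , s′)) →
                   factAt (suc n) R (image s) ≡ τ₂ (R , s)
    fact-settled n R s t refl π {τ′} inc t-enumerates t≡cπ hash≡ τ₂π≗τ′ earlier
      with pull-complete t (image s) (proj₂ t-enumerates)
    ... | s₀ , pull≡ = begin
      factAt (suc n) R (image s)                      ≡⟨ stage-updates n R (image s) inc t-enumerates hash≡ pull≡ ⟩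
      update (stage n) R (image s) t τ′ s₀            ≡⟨ cong (if_then τ′ (R , s₀) else factAt n R (image s)) compatible ⟩
      τ′ (R , s₀)                                     ≡⟨ τ₂π≗τ′ (R , s₀) ⟨
      τ₂ (R , Vec.map (map₁ π) s₀)                    ≡⟨ cong (λ s → τ₂ (R , s)) s₀↦s ⟩
      τ₂ (R , s)                                      ∎
      where
      open ≡-Reasoning
      c-injective : Injective _≡_ _≡_ c
      c-injective = snoc-injective σ ā b ā-injective b∉ā
      via-π : ∀ {r} (s′ : Vec (Fin (suc n) ⊎ Fin nC) r) → Vec.map (map₁ (lookup t)) s′ ≡ image (Vec.map (map₁ π) s′)
      via-π s′ = trans (Vec.map-cong (Sum.map₁-cong t≡cπ) s′) (sym (map-map₁ (λ _ → refl) s′))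
      s₀↦s : Vec.map (map₁ π) s₀ ≡ s
      s₀↦s = Vec-map-injective (map₁-injective c-injective) (trans (sym (via-π s₀)) (pull-sound t (image s) pull≡))
      smaller : ∀ {R′} (s′ : Vec (Fin (suc n) ⊎ Fin nC) (ar R′)) → isFull σ (R′ , s′) ≡ false →
                length (support (Vec.map (map₁ π) s′)) ≤ n
      smaller s′ not-full = ℕ.≤-pred (fewer-elements t (increasing-injective t inc) s′ not-full
        (tupleOf (support (Vec.map (map₁ π) s′))) (support-increasing (Vec.map (map₁ π) s′))
        (subst (Enumerates _) (sym (via-π s′)) (support-enumerates (Vec.map (map₁ π) s′))))
      compatible : compatibleᵇ σ τ′ (tp σ (stage n) (lookup t)) ≡ true
      compatible = Equivalence.from (compatibleᵇ⇔ σ) λ (R′ , s′) not-full → begin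
        τ′ (R′ , s′)                                  ≡⟨ τ₂π≗τ′ (R′ , s′) ⟨
        τ₂ (R′ , Vec.map (map₁ π) s′)                 ≡⟨ earlier R′ (Vec.map (map₁ π) s′) (smaller s′ not-full) ⟨
        factAt n R′ (image (Vec.map (map₁ π) s′))     ≡⟨ cong (factAt n R′) (via-π s′) ⟨
        tp σ (stage n) (lookup t) (R′ , s′)           ∎

    fact-image : ∀ n R (s : Vec (Fin (suc k) ⊎ Fin nC) (ar R)) → length (support s) ≤ n → factAt n R (image s) ≡ τ₂ (R , s)
    fact-image zero R s empty
      with shape-without-variables s (λ u u∈ → ℕ.<-irrefl (sym (ℕ.n≤0⇒n≡0 empty)) (length-positive (∈-support⁺ u∈)))
      where
      length-positive : ∀ {u} {Q : List (Fin (suc k))} → u ∈ₗ Q → 0 < length Q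
      length-positive {Q = _ ∷ _} _ = s≤s z≤n
    ... | s′ , s≡ = subst (λ s → factAt 0 R (image s) ≡ τ₂ (R , s)) (sym s≡) (begin
      factAt 0 R (image (Vec.map (map₁ (λ ())) s′))        ≡⟨ cong (factAt 0 R) (map-map₁ (λ ()) s′) ⟩
      factAt 0 R (Vec.map (map₁ (lookup [])) s′)            ≡⟨ fact₀-constants consistent R s′ ⟩
      τ₀ consistent (R , s′)                                ≡⟨ constant-facts σ τs closed consistent τ₂∈ sk≤w R s′ ⟨
      τ₂ (R , Vec.map (map₁ (λ ())) s′)                     ∎)
      where open ≡-Reasoning
    fact-image (suc n) R s len≤ with ℕ.m≤n⇒m<n∨m≡n len≤
    ... | inj₁ (s≤s len≤n) with stage-untouched n R (image s)
    ...   | inj₁ same = trans same (fact-image n R s len≤n)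
    ...   | inj₂ (t , inc , t-enumerates) =
      ⊥-elim (ℕ.<-irrefl (increasing-length _ t (support-increasing s) inc (same-elements (support-enumerates s) t-enumerates))
                         (s≤s len≤n))
    fact-image (suc n) R s len≤ | inj₂ len≡ with Any.any? (Fin._≟ last) (support s)
    ... | yes last∈ =
      let τ′ , hash≡ , τ₂∣≗τ′ = hashType-members (occurring s) (Any.map sym last∈)
      in fact-settled n R s (tupleOf (support s)) len≡ (lookup (fromList (support s))) (support-increasing s)
           (support-enumerates s) (λ j → Vec.lookup-map j c (fromList (support s))) hash≡ τ₂∣≗τ′ (fact-image n)
    ... | no last∉ with shape-without-last s (last∉ ∘ Any.map sym ∘ ∈-support⁺)
    ... | s′ , s≡ = subst (λ s → factAt (suc n) R (image s) ≡ τ₂ (R , s)) (sym s≡) (begin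
      factAt (suc n) R (image s″)  ≡⟨ fact-after R (image s″) (support-increasing s″) (support-enumerates s″) (suc n)
                                        (ℕ.≤-reflexive len≡′) ⟩
      factAt l R (image s″)        ≡⟨ fact-after R (image s″) (support-increasing s″) (support-enumerates s″) (wd σ)
                                        (increasing-length≤wd (tupleOf (support s″)) (support-increasing s″)) ⟨
      factAt (wd σ) R (image s″)   ≡⟨ cong (factAt (wd σ) R) (map-map₁ (snoc-inject₁ σ ā b) s′) ⟩
      tp σ 𝔅 ā (R , s′)            ≡⟨ tp-ā (R , s′) ⟩
      τ₁ (R , s′)                  ≡⟨ τ₁⊆τ₂ (R , s′) ⟨
      τ₂ (R , s″)                  ∎)
      where
      open ≡-Reasoning
      s″ : Vec (Fin (suc k) ⊎ Fin nC) (ar R)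
      s″ = Vec.map (map₁ inject₁) s′
      l : ℕ
      l = length (support s″)
      len≡′ : l ≡ suc n
      len≡′ = trans (cong (length ∘ support) (sym s≡)) len≡

    extension : Σ[ b′ ∈ Elem ] ((∀ i → b′ ≢ ā i) × DistinctRows (snoc σ ā b′) × tp σ 𝔅 (snoc σ ā b′) ≗ τ₂)
    extension = b , b∉ā , c-distinct-rows ,
                λ (R , s) → fact-image (wd σ) R s (increasing-length≤wd (tupleOf (support s)) (support-increasing s))

  𝔅-admissible : Admissible σ τs 𝔅
  𝔅-admissible = record
    { _≟_ = decElem ; Extendable = DistinctRows ; extendable-∘ = λ π π-inj rows-inj → π-inj ∘ rows-inj
    ; extendable-[] = λ { {()} }
    ; guarded = 𝔅-guarded
    ; extend = λ sk≤w _ τ₂∈ τ₁⊆τ₂ → Extension.extension sk≤w τ₂∈ τ₁⊆τ₂ }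

lemma37 : (σ : Signature) (φ : Sentence σ) (τs : TypeFamily σ) →
          IsWitness σ φ τs →
          (p : ℕ → ℕ) → PrimeHyps σ p →
          (enum : TypeFamily σ) →
          (∀ k → 1 ≤ k → k ≤ wd σ → IsEnumeration σ (τs k) (enum k)) →
          Models σ (Hashing.𝔅 σ τs p enum) φ
lemma37 σ φ τs witness p primes enum enum-ok =
  transfer φ (models El ℭ ℭ-guardedBy ℭ-hasExtension)
  where
  open IsWitness witness
  open FreeStructure σ τs closed consistent
  open HashingExtension σ τs p enum closed consistent nonempty enum-ok primes
  open Admissibility.Transfer σ τs closed consistent 𝔅-admissible ℭ-admissible
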